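{- Let $F$ be a finite field with $f$ elements, let $q$ be a non-degenerate quadratic form of dimension $2$ over $F$ and let $a\in\widetilde{\mathsf D}(q)$. The number of cycles of length $4$ in $\mathcal{G}_{q,a}$ is: (i) if $a\ne 0$ and $q$ is isotropic: $\frac{f^2(f-1)(f-3)}{8}$ if $\mathrm{char}(F)\ne 2$ and $\frac{f^2(f-1)(f-2)}{8}$ if $\mathrm{char}(F)=2$; (ii) if $a\ne0$ and $q$ is anisotropic: $\frac{f^2(f+1)(f-1)}{8}$ if $\mathrm{char}(F)\neq2$ and $\frac{f^3(f+1)}{8}$ if $\mathrm{char}(F)=2$; (iii) if $a=0$ (so $q$ is isotropic): $\frac{f^2}{4}\left(6\binom{f-1}{3}+(f-1)^2\right)$.
   Context: A quadratic form on a finite-dimensional $F$-vector space $V$ is a map $q:V\to F$ with $q(\lambda x)=\lambda^2q(x)$ such that $b_q(x,y)=q(x+y)-q(x)-q(y)$ is bilinear; non-degenerate means $\{x: b_q(x,y)=0\ \forall y\}=\{0\}$. $q$ is isotropic if $q(v)=0$ for some $v\ne0$. $\mathsf D(q)=\{q(v):v\in V\}\cap F^\ast$; $\widetilde{\mathsf D}(q)=\mathsf D(q)\cup\{0\}$ if $q$ is isotropic and $=\mathsf D(q)$ otherwise. The representation graph $\mathcal{G}_{q,a}$ has vertex set $V$, with distinct $x,y$ adjacent iff $q(x-y)=a$. A cycle of length $n$ is given by pairwise distinct vertices $v_0,\dots,v_{n-1}$ with $v_{i-1},v_i$ adjacent (indices mod $n$); cycles are counted as subgraphs, i.e. up to cyclic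 rotation and reversal of the sequence. -}

module Defs where

open import Level using (0ℓ)
open import Data.Nat as ℕ using (ℕ)
open import Data.Fin using (Fin)
open import Data.List using (List; map; concatMap; allFin; length; filter)
open import Data.Product using (_×_; _,_; ∃; Σ)
open import Data.Sum using (_⊎_)
open import Relation.Nullary using (¬_; Dec; does; ¬?)
open import Relation.Nullary.Decidable using (_×-dec_)
open import Data.Product.Properties using (≡-dec)
open import Relation.Binary.PropositionalEquality using (_≡_; _≢_)
open import Algebra.Structures using (IsCommutativeRing)
open import Function.Bundles using (_↔_; Inverse)

-- Finite fields (propositional equality), with a chosen enumeration
-- Fin size ↔ Carrier, so size = f = |F|.

record FiniteField : Set₁ where
  infixl 7 _*_
  infixl 6 _+_
  infixl 6 _-_
  field
    Carrier : Set
    _+_ _*_ : Carrier → Carrier → Carrier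
    -_      : Carrier → Carrier
    0# 1#   : Carrier
    isCommutativeRing : IsCommutativeRing _≡_ _+_ _*_ -_ 0# 1#
    0≢1     : 0# ≢ 1#
    inverse : ∀ x → x ≢ 0# → ∃ λ y → x * y ≡ 1#
    _≟_     : (x y : Carrier) → Dec (x ≡ y)
    size    : ℕ
    enum    : Fin size ↔ Carrier

  _-_ : Carrier → Carrier → Carrier
  x - y = x + (- y)

  Char2 : Set
  Char2 = 1# + 1# ≡ 0#

  V : Set
  V = Carrier × Carrier

  0V : V
  0V = 0# , 0#

  _+V_ : V → V → V
  (x₁ , x₂) +V (y₁ , y₂) = (x₁ + y₁) , (x₂ + y₂)

  _-V_ : V → V → V
  (x₁ , x₂) -V (y₁ , y₂) = (x₁ - y₁) , (x₂ - y₂)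

  _·_ : Carrier → V → V
  λ' · (x₁ , x₂) = (λ' * x₁) , (λ' * x₂)

  polar : (V → Carrier) → V → V → Carrier
  polar q x y = q (x +V y) - q x - q y

  record IsQuadraticForm (q : V → Carrier) : Set where
    field
      homog   : ∀ λ' x → q (λ' · x) ≡ λ' * λ' * q x
      addˡ    : ∀ x x' y → polar q (x +V x') y ≡ polar q x y + polar q x' y
      scaleˡ  : ∀ λ' x y → polar q (λ' · x) y ≡ λ' * polar q x y
      addʳ    : ∀ x y y' → polar q x (y +V y') ≡ polar q x y + polar q x y'
      scaleʳ  : ∀ λ' x y → polar q x (λ' · y) ≡ λ' * polar q x y

  NonDegenerate : (V → Carrier) → Set
  NonDegenerate q = ∀ x → (∀ y → polar q x y ≡ 0#) → x ≡ 0V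

  Isotropic : (V → Carrier) → Set
  Isotropic q = ∃ λ v → v ≢ 0V × q v ≡ 0#

  InD : (V → Carrier) → Carrier → Set
  InD q a = a ≢ 0# × ∃ λ v → q v ≡ a

  InD~ : (V → Carrier) → Carrier → Set
  InD~ q a = InD q a ⊎ (Isotropic q × a ≡ 0#)

  Adj : (V → Carrier) → Carrier → V → V → Set
  Adj q a x y = x ≢ y × q (x -V y) ≡ a

  elems : List Carrier
  elems = map (Inverse.to enum) (allFin size)

  allV : List V
  allV = concatMap (λ x → map (x ,_) elems) elems

  idx : V → ℕ
  idx (x , y) = Data.Fin.toℕ (Inverse.from enum x) ℕ.* size ℕ.+ Data.Fin.toℕ (Inverse.from enum y)

  -- A 4-cycle (as a subgraph) v0 v1 v2 v3 is counted once via its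
  -- canonical representative up to rotation and reversal:
  -- v0 has least index among the four, and idx v1 < idx v3.
  CanonicalCycle4 : (V → Carrier) → Carrier → V → V → V → V → Set
  CanonicalCycle4 q a v0 v1 v2 v3 =
      (v0 ≢ v1 × v0 ≢ v2 × v0 ≢ v3 × v1 ≢ v2 × v1 ≢ v3 × v2 ≢ v3)
    × (Adj q a v0 v1 × Adj q a v1 v2 × Adj q a v2 v3 × Adj q a v3 v0)
    × (idx v0 ℕ.< idx v1 × idx v0 ℕ.< idx v2 × idx v0 ℕ.< idx v3 × idx v1 ℕ.< idx v3)

  _≟V_ : (x y : V) → Dec (x ≡ y)
  _≟V_ = ≡-dec _≟_ _≟_

  private
    ≢? : (x y : V) → Dec (x ≢ y)
    ≢? x y = ¬? (x ≟V y)
    adj? : ∀ q a x y → Dec (Adj q a x y)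
    adj? q a x y = ≢? x y ×-dec (q (x -V y) ≟ a)

  canonicalCycle4? : ∀ q a v0 v1 v2 v3 → Dec (CanonicalCycle4 q a v0 v1 v2 v3)
  canonicalCycle4? q a v0 v1 v2 v3 =
      (≢? v0 v1 ×-dec ≢? v0 v2 ×-dec ≢? v0 v3 ×-dec ≢? v1 v2 ×-dec ≢? v1 v3 ×-dec ≢? v2 v3)
    ×-dec (adj? q a v0 v1 ×-dec adj? q a v1 v2 ×-dec adj? q a v2 v3 ×-dec adj? q a v3 v0)
    ×-dec (idx v0 ℕ.<? idx v1 ×-dec idx v0 ℕ.<? idx v2 ×-dec idx v0 ℕ.<? idx v3 ×-dec idx v1 ℕ.<? idx v3)

  quadruples : List (V × V × V × V)
  quadruples = concatMap (λ v0 → concatMap (λ v1 → concatMap (λ v2 → map (λ v3 → v0 , v1 , v2 , v3) allV) allV) allV) allV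

  numCycles4 : (V → Carrier) → Carrier → ℕ
  numCycles4 q a = length (filter (λ { (v0 , v1 , v2 , v3) → canonicalCycle4? q a v0 v1 v2 v3 }) quadruples)

open FiniteField public
  using (Carrier; 0#; V; IsQuadraticForm; NonDegenerate; Isotropic; InD~; Char2; numCycles4; size)

module Submission where

-- Count ordered 4-cycles (v₀, v₁, v₂, v₃) instead: every 4-cycle yields eight of them, and
-- their number is the sum, over v₀ ≠ v₂, of N (N - 1) where N counts the common
-- neighbours of v₀ and v₂.
--
-- For a ≠ 0, seen from v₀ the common neighbours of v₀ and v₂ lie on the conic q = a and
-- on a line, so there are at most two and then they are v₁ and v₀ + v₂ - v₁. The ordered
-- 4-cycles thus correspond to the triples (v₀, v₀ - v₁, v₁ - v₂) = (v₀, s₁, s₂) with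
-- q s₁ = q s₂ = a and s₂ ≠ ± s₁, giving f² n (n - 2), or f² n (n - 1) in characteristic 2,
-- where n is the number of points of the conic: n = f - 1 in hyperbolic coordinates
-- q (α d₁ + β d₂) = c α β when q is isotropic, and n = f + 1 when q is anisotropic,
-- since then every line through a point of the conic but the tangent meets it once more.
--
-- For a = 0, in hyperbolic coordinates G is the rook's graph on F × F: N = f - 2 when
-- v₀, v₂ share a row or a column and N = 2 otherwise.

open import Algebra.Structures using (IsCommutativeRing)
open import Defs using (FiniteField)
open import Relation.Binary.PropositionalEquality using (_≡_; _≢_)

module CommutativeRingSolver
  {A : Set} {add mul : A → A → A} {neg : A → A} {zr one : A}
  (isCommutativeRing : IsCommutativeRing _≡_ add mul neg zr one) where

  open import Algebra.Bundles using (CommutativeRing)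
  open import Relation.Binary.PropositionalEquality
  open import Data.Bool using (Bool; true; false; T)
  open import Data.Integer as ℤ using (ℤ; -[1+_]; _⊖_; sign; ∣_∣; _◃_)
  open import Data.Integer.Properties using ([1+m]⊖[1+n]≡m⊖n)
  open import Data.Maybe using (nothing)
  open import Data.Nat as ℕ using (ℕ; zero; suc)
  open import Data.Nat.Properties using (+-suc)
  open import Data.Sign as Sign using (Sign)
  open import Data.Vec using (Vec)
  import Algebra.Properties.CommutativeSemigroup as CommutativeSemigroupProperties
  import Algebra.Properties.Ring as RingProperties
  import Algebra.Properties.Semiring.Mult.TCOptimised as SemiringMult
  import Tactic.RingSolver.Core.AlmostCommutativeRing as ACR
  open import Tactic.RingSolver.Core.Polynomial.Parameters using (Homomorphism)
  open import Tactic.RingSolver.Core.Expression public using (Expr; Κ; Ι; _⊕_; _⊗_; ⊝_; _⊛_)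
  open ≡-Reasoning

  ring : CommutativeRing _ _
  ring = record { isCommutativeRing = isCommutativeRing }

  open CommutativeRing ring using (_+_; _*_; -_; 0#; 1#; semiring; +-comm; +-assoc; *-identityˡ; *-identityʳ; zeroʳ; -‿inverseʳ; +-identityˡ; +-identityʳ)
  open RingProperties (CommutativeRing.ring ring) using (-0#≈0#; -‿involutive; -‿+-comm; -1*x≈-x)
  open CommutativeSemigroupProperties (CommutativeRing.*-commutativeSemigroup ring) using (interchange)
  open SemiringMult semiring using (_×_; 1+×; ×-homo-+; ×1-homo-*)

  fromℕ : ℕ → A
  fromℕ n = n × 1#

  -- The solver's coefficients are integers, mapped into A by the canonical homomorphism, so
  -- that coefficient arithmetic and the test for zero compute.
  ⟦_⟧ℤ : ℤ → A
  ⟦ ℤ.+ n ⟧ℤ = fromℕ n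
  ⟦ -[1+ n ] ⟧ℤ = - (fromℕ (suc n))

  ⊖-homo : ∀ m n → ⟦ m ⊖ n ⟧ℤ ≡ fromℕ m + - (fromℕ n)
  ⊖-homo zero zero = sym (trans (cong (0# +_) -0#≈0#) (+-identityˡ 0#))
  ⊖-homo zero (suc n) = sym (+-identityˡ _)
  ⊖-homo (suc m) zero = sym (trans (cong (fromℕ (suc m) +_) -0#≈0#) (+-identityʳ _))
  ⊖-homo (suc m) (suc n) = begin
    ⟦ suc m ⊖ suc n ⟧ℤ               ≡⟨ cong ⟦_⟧ℤ ([1+m]⊖[1+n]≡m⊖n m n) ⟩
    ⟦ m ⊖ n ⟧ℤ                       ≡⟨ ⊖-homo m n ⟩
    fromℕ m + - (fromℕ n)              ≡⟨ cancelˡ 1# (fromℕ m) (fromℕ n) ⟨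
    (1# + fromℕ m) + - (1# + fromℕ n)  ≡⟨ cong₂ (λ s t → s + - t) (1+× m 1#) (1+× n 1#) ⟨
    fromℕ (suc m) + - fromℕ (suc n)    ∎
    where
    cancelˡ : ∀ x y z → (x + y) + - (x + z) ≡ y + - z
    cancelˡ x y z = begin
      (x + y) + - (x + z)    ≡⟨ cong ((x + y) +_) (-‿+-comm x z) ⟨
      (x + y) + (- x + - z)  ≡⟨ cong (_+ (- x + - z)) (+-comm x y) ⟩
      (y + x) + (- x + - z)  ≡⟨ +-assoc y x _ ⟩
      y + (x + (- x + - z))  ≡⟨ cong (y +_) (+-assoc x (- x) (- z)) ⟨
      y + ((x + - x) + - z)  ≡⟨ cong (λ t → y + (t + - z)) (-‿inverseʳ x) ⟩
      y + (0# + - z)         ≡⟨ cong (y +_) (+-identityˡ (- z)) ⟩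
      y + - z                ∎

  +-homo : ∀ i j → ⟦ i ℤ.+ j ⟧ℤ ≡ ⟦ i ⟧ℤ + ⟦ j ⟧ℤ
  +-homo (ℤ.+ m) (ℤ.+ n) = ×-homo-+ 1# m n
  +-homo (ℤ.+ m) -[1+ n ] = ⊖-homo m (suc n)
  +-homo -[1+ m ] (ℤ.+ n) = trans (⊖-homo n (suc m)) (+-comm _ _)
  +-homo -[1+ m ] -[1+ n ] = begin
    - (fromℕ (suc (suc (m ℕ.+ n))))         ≡⟨ cong (λ k → - (fromℕ (suc k))) (+-suc m n) ⟨
    - (fromℕ (suc m ℕ.+ suc n))           ≡⟨ cong -_ (×-homo-+ 1# (suc m) (suc n)) ⟩
    - (fromℕ (suc m) + fromℕ (suc n))      ≡⟨ -‿+-comm _ _ ⟨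
    - fromℕ (suc m) + - fromℕ (suc n)      ∎

  -‿homo : ∀ i → ⟦ ℤ.- i ⟧ℤ ≡ - ⟦ i ⟧ℤ
  -‿homo (ℤ.+ zero) = sym -0#≈0#
  -‿homo (ℤ.+ suc n) = refl
  -‿homo -[1+ n ] = sym (-‿involutive _)

  sgn : Sign → A
  sgn Sign.+ = 1#
  sgn Sign.- = - 1#

  sgn-homo : ∀ s t → sgn (s Sign.* t) ≡ sgn s * sgn t
  sgn-homo Sign.- Sign.- = sym (trans (-1*x≈-x _) (-‿involutive 1#))
  sgn-homo Sign.- Sign.+ = sym (*-identityʳ _)
  sgn-homo Sign.+ Sign.- = sym (*-identityˡ _)
  sgn-homo Sign.+ Sign.+ = sym (*-identityˡ _)

  ◃-homo : ∀ s n → ⟦ s ◃ n ⟧ℤ ≡ sgn s * (fromℕ n)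
  ◃-homo s zero = sym (zeroʳ _)
  ◃-homo Sign.+ (suc n) = sym (*-identityˡ _)
  ◃-homo Sign.- (suc n) = sym (-1*x≈-x _)

  sign-abs : ∀ i → ⟦ i ⟧ℤ ≡ sgn (sign i) * (fromℕ ∣ i ∣)
  sign-abs (ℤ.+ n) = sym (*-identityˡ _)
  sign-abs -[1+ n ] = sym (-1*x≈-x _)

  *-homo : ∀ i j → ⟦ i ℤ.* j ⟧ℤ ≡ ⟦ i ⟧ℤ * ⟦ j ⟧ℤ
  *-homo i j = begin
    ⟦ i ℤ.* j ⟧ℤ                                    ≡⟨ ◃-homo (sign i Sign.* sign j) (∣ i ∣ ℕ.* ∣ j ∣) ⟩
    sgn (sign i Sign.* sign j) * fromℕ (∣ i ∣ ℕ.* ∣ j ∣)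
                                                    ≡⟨ cong₂ _*_ (sgn-homo (sign i) (sign j)) (×1-homo-* ∣ i ∣ ∣ j ∣) ⟩
    (s * t) * (m * n)                               ≡⟨ interchange s t m n ⟩
    (s * m) * (t * n)                               ≡⟨ cong₂ _*_ (sign-abs i) (sign-abs j) ⟨
    ⟦ i ⟧ℤ * ⟦ j ⟧ℤ                                 ∎
    where
    s t m n : A
    s = sgn (sign i)
    t = sgn (sign j)
    m = fromℕ ∣ i ∣
    n = fromℕ ∣ j ∣

  isZero : ℤ → Bool
  isZero (ℤ.+ zero) = true
  isZero _ = false

  isZero-sound : ∀ i → T (isZero i) → 0# ≡ ⟦ i ⟧ℤ
  isZero-sound (ℤ.+ zero) _ = refl

  homomorphism : Homomorphism _ _ _ _
  homomorphism = record
    { from = record { rawRing = ℤ.+-*-rawRing ; isZero = isZero }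
    ; to = ACR.fromCommutativeRing ring (λ _ → nothing)
    ; morphism = record
      { ⟦_⟧ = ⟦_⟧ℤ ; +-homo = +-homo ; *-homo = *-homo ; -‿homo = -‿homo ; 0-homo = refl ; 1-homo = refl }
    ; Zero-C⟶Zero-R = isZero-sound
    }

  open import Tactic.RingSolver.Core.Expression using (module Eval)
  open Eval (ACR.AlmostCommutativeRing.rawRing (Homomorphism.to homomorphism)) ⟦_⟧ℤ using (⟦_⟧)
  open import Tactic.RingSolver.Core.Polynomial.Base (Homomorphism.from homomorphism)
    using (Poly; κ; ι; _⊞_; _⊠_; ⊟_; _⊡_)
  open import Tactic.RingSolver.Core.Polynomial.Semantics homomorphism using () renaming (⟦_⟧ to ⟦_⟧ₚ)
  open import Tactic.RingSolver.Core.Polynomial.Homomorphism homomorphism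
    using (κ-hom; ι-hom; ⊞-hom; ⊠-hom; ⊟-hom; ⊡-hom)
  open ACR.AlmostCommutativeRing (Homomorphism.to homomorphism) using (_^_)

  normalise : ∀ {n} → Expr ℤ n → Poly n
  normalise (Κ x)   = κ x
  normalise (Ι x)   = ι x
  normalise (x ⊕ y) = normalise x ⊞ normalise y
  normalise (x ⊗ y) = normalise x ⊠ normalise y
  normalise (⊝ x)   = ⊟ normalise x
  normalise (x ⊛ i) = normalise x ⊡ i

  ⟦_⇓⟧ : ∀ {n} → Expr ℤ n → Vec A n → A
  ⟦ e ⇓⟧ = ⟦ normalise e ⟧ₚ

  normalise-correct : ∀ {n} (e : Expr ℤ n) ρ → ⟦ e ⇓⟧ ρ ≡ ⟦ e ⟧ ρ
  normalise-correct (Κ x)   ρ = κ-hom x ρ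
  normalise-correct (Ι x)   ρ = ι-hom x ρ
  normalise-correct (x ⊕ y) ρ = trans (⊞-hom (normalise x) (normalise y) ρ) (cong₂ _+_ (normalise-correct x ρ) (normalise-correct y ρ))
  normalise-correct (x ⊗ y) ρ = trans (⊠-hom (normalise x) (normalise y) ρ) (cong₂ _*_ (normalise-correct x ρ) (normalise-correct y ρ))
  normalise-correct (⊝ x)   ρ = trans (⊟-hom (normalise x) ρ) (cong -_ (normalise-correct x ρ))
  normalise-correct (x ⊛ i) ρ = trans (⊡-hom (normalise x) i ρ) (cong (_^ i) (normalise-correct x ρ))

  open import Relation.Binary.Reflection (setoid A) Ι ⟦_⟧ ⟦_⇓⟧ normalise-correct public using (solve; _⊜_)

module FiniteSums where

  open import Data.Empty using (⊥; ⊥-elim)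
  open import Data.Fin as Fin using (Fin)
  import Data.Fin.Properties as Fin
  open import Data.List using (List; []; _∷_; _++_; map; concatMap; filter; length; allFin; tabulate)
  open import Data.List.Properties using (map-tabulate)
  open import Data.Nat using (ℕ; zero; suc; _+_; _*_)
  open import Data.Nat.Properties
  open import Algebra.Properties.CommutativeSemigroup +-commutativeSemigroup using (interchange)
  open import Data.Nat.Solver using (module +-*-Solver)
  open +-*-Solver using (_:+_; _:*_; con; _:=_)
  open import Function using (_∘_; id; _⇔_; mk⇔; Equivalence)
  open import Relation.Nullary using (¬_; Dec; yes; no; ¬?)
  open import Relation.Nullary.Decidable using (_×-dec_; _⊎-dec_)
  open import Relation.Binary.PropositionalEquality
  open ≡-Reasoning

  𝟙 : {P : Set} → Dec P → ℕ
  𝟙 (yes _) = 1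
  𝟙 (no _) = 0

  module _ {P : Set} where

    𝟙-yes : (p : Dec P) → P → 𝟙 p ≡ 1
    𝟙-yes (yes _) _ = refl
    𝟙-yes (no ¬p) x = ⊥-elim (¬p x)

    𝟙-no : (p : Dec P) → ¬ P → 𝟙 p ≡ 0
    𝟙-no (yes x) ¬p = ⊥-elim (¬p x)
    𝟙-no (no _) _ = refl

    𝟙-¬ : (p : Dec P) → 𝟙 p + 𝟙 (¬? p) ≡ 1
    𝟙-¬ (yes _) = refl
    𝟙-¬ (no _) = refl

    𝟙-idem : (p : Dec P) (n : ℕ) → 𝟙 p * (𝟙 p * n) ≡ 𝟙 p * n
    𝟙-idem (yes _) n = cong (_+ 0) (+-identityʳ n)
    𝟙-idem (no _) n = refl

  module _ {P Q : Set} where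

    𝟙-cong : (p : Dec P) (q : Dec Q) → P ⇔ Q → 𝟙 p ≡ 𝟙 q
    𝟙-cong (yes _) (yes _) _ = refl
    𝟙-cong (yes x) (no ¬y) P⇔Q = ⊥-elim (¬y (Equivalence.to P⇔Q x))
    𝟙-cong (no ¬x) (yes y) P⇔Q = ⊥-elim (¬x (Equivalence.from P⇔Q y))
    𝟙-cong (no _) (no _) _ = refl

    𝟙-× : (p : Dec P) (q : Dec Q) → 𝟙 (p ×-dec q) ≡ 𝟙 p * 𝟙 q
    𝟙-× (yes _) (yes _) = refl
    𝟙-× (yes _) (no _) = refl
    𝟙-× (no _) (yes _) = refl
    𝟙-× (no _) (no _) = refl

    𝟙-⊎ : (p : Dec P) (q : Dec Q) → (P → Q → ⊥) → 𝟙 (p ⊎-dec q) ≡ 𝟙 p + 𝟙 q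
    𝟙-⊎ (yes x) (yes y) excl = ⊥-elim (excl x y)
    𝟙-⊎ (yes _) (no _) _ = refl
    𝟙-⊎ (no _) (yes _) _ = refl
    𝟙-⊎ (no _) (no _) _ = refl


  ∑ : {A : Set} → List A → (A → ℕ) → ℕ
  ∑ [] g = 0
  ∑ (x ∷ xs) g = g x + ∑ xs g

  syntax ∑ xs (λ x → e) = ∑[ x ∈ xs ] e

  module _ {A : Set} where

    length-filter : {P : A → Set} (P? : ∀ x → Dec (P x)) (xs : List A) → length (filter P? xs) ≡ ∑[ x ∈ xs ] 𝟙 (P? x)
    length-filter P? [] = refl
    length-filter P? (x ∷ xs) with P? x
    ... | yes _ = cong suc (length-filter P? xs)
    ... | no _ = length-filter P? xs

    ∑-cong : (xs : List A) {g h : A → ℕ} → (∀ x → g x ≡ h x) → ∑ xs g ≡ ∑ xs h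
    ∑-cong [] e = refl
    ∑-cong (x ∷ xs) e = cong₂ _+_ (e x) (∑-cong xs e)

    ∑-+ : (xs : List A) (g h : A → ℕ) → ∑[ x ∈ xs ] (g x + h x) ≡ ∑ xs g + ∑ xs h
    ∑-+ [] g h = refl
    ∑-+ (x ∷ xs) g h = trans (cong ((g x + h x) +_) (∑-+ xs g h)) (interchange (g x) (h x) (∑ xs g) (∑ xs h))

    ∑-*ˡ : (xs : List A) (c : ℕ) (g : A → ℕ) → ∑[ x ∈ xs ] (c * g x) ≡ c * ∑ xs g
    ∑-*ˡ [] c g = sym (*-zeroʳ c)
    ∑-*ˡ (x ∷ xs) c g = trans (cong (c * g x +_) (∑-*ˡ xs c g)) (sym (*-distribˡ-+ c (g x) _))

    ∑-*ʳ : (xs : List A) (c : ℕ) (g : A → ℕ) → ∑[ x ∈ xs ] (g x * c) ≡ ∑ xs g * c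
    ∑-*ʳ xs c g = trans (∑-cong xs (λ x → *-comm (g x) c)) (trans (∑-*ˡ xs c g) (*-comm c _))

    ∑-const : (xs : List A) (c : ℕ) → ∑[ x ∈ xs ] c ≡ length xs * c
    ∑-const [] c = refl
    ∑-const (x ∷ xs) c = cong (c +_) (∑-const xs c)

    ∑-0 : (xs : List A) → ∑[ x ∈ xs ] 0 ≡ 0
    ∑-0 xs = trans (∑-const xs 0) (*-zeroʳ (length xs))

    ∑-++ : (xs ys : List A) (g : A → ℕ) → ∑ (xs ++ ys) g ≡ ∑ xs g + ∑ ys g
    ∑-++ [] ys g = refl
    ∑-++ (x ∷ xs) ys g = trans (cong (g x +_) (∑-++ xs ys g)) (sym (+-assoc (g x) _ _))

  module _ {A B : Set} where

    ∑-swap : (xs : List A) (ys : List B) (g : A → B → ℕ) →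
      ∑[ x ∈ xs ] ∑[ y ∈ ys ] g x y ≡ ∑[ y ∈ ys ] ∑[ x ∈ xs ] g x y
    ∑-swap [] ys g = sym (∑-0 ys)
    ∑-swap (x ∷ xs) ys g = trans (cong (∑ ys (g x) +_) (∑-swap xs ys g)) (sym (∑-+ ys (g x) (λ y → ∑[ x ∈ xs ] g x y)))

    ∑-map : (f : A → B) (xs : List A) (g : B → ℕ) → ∑ (map f xs) g ≡ ∑ xs (g ∘ f)
    ∑-map f [] g = refl
    ∑-map f (x ∷ xs) g = cong (g (f x) +_) (∑-map f xs g)

    ∑-concatMap : (f : A → List B) (xs : List A) (g : B → ℕ) → ∑ (concatMap f xs) g ≡ ∑[ x ∈ xs ] ∑ (f x) g
    ∑-concatMap f [] g = refl
    ∑-concatMap f (x ∷ xs) g = trans (∑-++ (f x) (concatMap f xs) g) (cong (∑ (f x) g +_) (∑-concatMap f xs g))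

  module _ {A : Set} where

    ∑⁴ : List A → (A → A → A → A → ℕ) → ℕ
    ∑⁴ xs h = ∑[ a ∈ xs ] ∑[ b ∈ xs ] ∑[ c ∈ xs ] ∑[ d ∈ xs ] h a b c d

    ∑⁴-cong : (xs : List A) {h k : A → A → A → A → ℕ} → (∀ a b c d → h a b c d ≡ k a b c d) → ∑⁴ xs h ≡ ∑⁴ xs k
    ∑⁴-cong xs e = ∑-cong xs (λ a → ∑-cong xs (λ b → ∑-cong xs (λ c → ∑-cong xs (e a b c))))

    ∑⁴-+ : (xs : List A) (h k : A → A → A → A → ℕ) → ∑⁴ xs (λ a b c d → h a b c d + k a b c d) ≡ ∑⁴ xs h + ∑⁴ xs k
    ∑⁴-+ xs h k = trans (∑-cong xs (λ a → trans (∑-cong xs (λ b → trans (∑-cong xs (λ c → ∑-+ xs _ _)) (∑-+ xs _ _))) (∑-+ xs _ _))) (∑-+ xs _ _)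

    ∑⁴-rotate : (xs : List A) (h : A → A → A → A → ℕ) → ∑⁴ xs (λ a b c d → h b c d a) ≡ ∑⁴ xs h
    ∑⁴-rotate xs h = trans (∑-swap xs xs _) (∑-cong xs (λ b → trans (∑-swap xs xs _) (∑-cong xs (λ c → ∑-swap xs xs _))))

    ∑⁴-reflect : (xs : List A) (h : A → A → A → A → ℕ) → ∑⁴ xs (λ a b c d → h a d c b) ≡ ∑⁴ xs h
    ∑⁴-reflect xs h = ∑-cong xs (λ a → trans (∑-swap xs xs _) (trans (∑-cong xs (λ c → ∑-swap xs xs _)) (∑-swap xs xs _)))

    dihedralSum : (A → A → A → A → ℕ) → A → A → A → A → ℕ
    dihedralSum h a b c d = (h a b c d + h a d c b) + ((h b c d a + h b a d c) + ((h c d a b + h c b a d) + (h d a b c + h d c b a)))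

    ∑⁴-dihedralSum : (xs : List A) (h : A → A → A → A → ℕ) → ∑⁴ xs (dihedralSum h) ≡ 8 * ∑⁴ xs h
    ∑⁴-dihedralSum xs h = begin
      ∑⁴ xs (dihedralSum h)                           ≡⟨ ∑⁴-+ xs (pair h) _ ⟩
      S (pair h) + ∑⁴ xs _                            ≡⟨ cong (S (pair h) +_) (∑⁴-+ xs (rotate (pair h)) _) ⟩
      S (pair h) + (S (rotate (pair h)) + ∑⁴ xs _)    ≡⟨ cong (λ n → S (pair h) + (S (rotate (pair h)) + n)) (∑⁴-+ xs (rotate (rotate (pair h))) _) ⟩
      S (pair h) + (S (rotate (pair h)) + (S (rotate (rotate (pair h))) + S (rotate (rotate (rotate (pair h))))))
                                                      ≡⟨ cong₂ (λ m n → S (pair h) + (m + n)) S-rotate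
                                                               (cong₂ _+_ (trans S-rotate S-rotate) (trans S-rotate (trans S-rotate S-rotate))) ⟩
      S (pair h) + (S (pair h) + (S (pair h) + S (pair h)))
                                                      ≡⟨ cong (λ n → n + (n + (n + n))) (trans (∑⁴-+ xs h (reflect h)) (cong (S h +_) (∑⁴-reflect xs h))) ⟩
      (S h + S h) + ((S h + S h) + ((S h + S h) + (S h + S h)))
                                                      ≡⟨ +-*-Solver.solve 1 (λ s → (s :+ s) :+ ((s :+ s) :+ ((s :+ s) :+ (s :+ s))) := con 8 :* s) refl (S h) ⟩
      8 * S h                                         ∎
      where
      S : (A → A → A → A → ℕ) → ℕ
      S = ∑⁴ xs
      rotate reflect pair : (A → A → A → A → ℕ) → A → A → A → A → ℕ
      rotate k a b c d = k b c d a
      reflect k a b c d = k a d c b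
      pair k a b c d = k a b c d + reflect k a b c d
      S-rotate : ∀ {k} → S (rotate k) ≡ S k
      S-rotate {k} = ∑⁴-rotate xs k

  module _ {A : Set} (h : A → A → A → A → ℕ)
           (h-rotate : ∀ a b c d → h b c d a ≡ h a b c d) (h-reflect : ∀ a b c d → h a d c b ≡ h a b c d) where

    dihedralSum-invariant-* : (k : A → A → A → A → ℕ) → ∀ a b c d →
      dihedralSum (λ a b c d → h a b c d * k a b c d) a b c d ≡ h a b c d * dihedralSum k a b c d
    dihedralSum-invariant-* k a b c d = begin
      dihedralSum (λ a b c d → h a b c d * k a b c d) a b c d
        ≡⟨ cong₂ _+_ (cong (H * k a b c d +_) (cong (_* k a d c b) f₀))
             (cong₂ _+_ (cong₂ _+_ (cong (_* k b c d a) e₁) (cong (_* k b a d c) f₁))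
               (cong₂ _+_ (cong₂ _+_ (cong (_* k c d a b) e₂) (cong (_* k c b a d) f₂))
                 (cong₂ _+_ (cong (_* k d a b c) e₃) (cong (_* k d c b a) f₃)))) ⟩
      (H * k a b c d + H * k a d c b) + ((H * k b c d a + H * k b a d c) + ((H * k c d a b + H * k c b a d) + (H * k d a b c + H * k d c b a)))
        ≡⟨ +-*-Solver.solve 9 (λ H x₀ y₀ x₁ y₁ x₂ y₂ x₃ y₃ →
             (H :* x₀ :+ H :* y₀) :+ ((H :* x₁ :+ H :* y₁) :+ ((H :* x₂ :+ H :* y₂) :+ (H :* x₃ :+ H :* y₃)))
             := H :* ((x₀ :+ y₀) :+ ((x₁ :+ y₁) :+ ((x₂ :+ y₂) :+ (x₃ :+ y₃))))) refl
             H (k a b c d) (k a d c b) (k b c d a) (k b a d c) (k c d a b) (k c b a d) (k d a b c) (k d c b a) ⟩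
      H * dihedralSum k a b c d
        ∎
      where
      H : ℕ
      H = h a b c d
      e₁ : h b c d a ≡ H
      e₁ = h-rotate a b c d
      e₂ : h c d a b ≡ H
      e₂ = trans (h-rotate b c d a) e₁
      e₃ : h d a b c ≡ H
      e₃ = trans (h-rotate c d a b) e₂
      f₀ : h a d c b ≡ H
      f₀ = h-reflect a b c d
      f₁ : h b a d c ≡ H
      f₁ = trans (h-reflect b c d a) e₁
      f₂ : h c b a d ≡ H
      f₂ = trans (h-reflect c d a b) e₂
      f₃ : h d c b a ≡ H
      f₃ = trans (h-reflect d a b c) e₃

  Exact : {A : Set} → ((x y : A) → Dec (x ≡ y)) → List A → Set
  Exact _≟_ xs = ∀ a → ∑[ x ∈ xs ] 𝟙 (x ≟ a) ≡ 1

  ∑-tabulate-suc : (n : ℕ) (g : Fin (suc n) → ℕ) → ∑ (tabulate Fin.suc) g ≡ ∑[ i ∈ allFin n ] g (Fin.suc i)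
  ∑-tabulate-suc n g = trans (cong (λ is → ∑ is g) (sym (map-tabulate id Fin.suc))) (∑-map Fin.suc (allFin n) g)

  allFin-exact : (n : ℕ) → Exact Fin._≟_ (allFin n)
  allFin-exact (suc n) Fin.zero = cong suc (begin
    ∑[ i ∈ tabulate {n = n} Fin.suc ] 𝟙 (i Fin.≟ Fin.zero)  ≡⟨ ∑-tabulate-suc n _ ⟩
    ∑[ i ∈ allFin n ] 𝟙 (Fin.suc i Fin.≟ Fin.zero)  ≡⟨ ∑-cong (allFin n) (λ i → 𝟙-no (Fin.suc i Fin.≟ Fin.zero) λ ()) ⟩
    ∑[ i ∈ allFin n ] 0                              ≡⟨ ∑-0 (allFin n) ⟩
    0                                                ∎)
  allFin-exact (suc n) (Fin.suc a) = begin
    ∑[ i ∈ tabulate {n = n} Fin.suc ] 𝟙 (i Fin.≟ Fin.suc a)   ≡⟨ ∑-tabulate-suc n _ ⟩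
    ∑[ i ∈ allFin n ] 𝟙 (Fin.suc i Fin.≟ Fin.suc a)  ≡⟨ ∑-cong (allFin n) (λ i → 𝟙-cong (Fin.suc i Fin.≟ Fin.suc a) (i Fin.≟ a) (mk⇔ Fin.suc-injective (cong Fin.suc))) ⟩
    ∑[ i ∈ allFin n ] 𝟙 (i Fin.≟ a)                   ≡⟨ allFin-exact n a ⟩
    1                                                 ∎

  module Enumeration {A : Set} (_≟_ : (x y : A) → Dec (x ≡ y)) (xs : List A) (exact : Exact _≟_ xs) where

    ∑-δ : (a : A) (g : A → ℕ) → ∑[ x ∈ xs ] (𝟙 (x ≟ a) * g x) ≡ g a
    ∑-δ a g = begin
      ∑[ x ∈ xs ] (𝟙 (x ≟ a) * g x)  ≡⟨ ∑-cong xs δ-at ⟩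
      ∑[ x ∈ xs ] (𝟙 (x ≟ a) * g a)  ≡⟨ ∑-*ʳ xs (g a) (λ x → 𝟙 (x ≟ a)) ⟩
      ∑[ x ∈ xs ] 𝟙 (x ≟ a) * g a    ≡⟨ cong (_* g a) (exact a) ⟩
      1 * g a                         ≡⟨ *-identityˡ (g a) ⟩
      g a                             ∎
      where
      δ-at : ∀ x → 𝟙 (x ≟ a) * g x ≡ 𝟙 (x ≟ a) * g a
      δ-at x with x ≟ a
      ... | yes refl = refl
      ... | no _ = refl

    ∑-split : (a : A) (g : A → ℕ) → ∑ xs g ≡ g a + ∑[ x ∈ xs ] (𝟙 (¬? (x ≟ a)) * g x)
    ∑-split a g = begin
      ∑ xs g                                                        ≡⟨ ∑-cong xs split-at ⟩
      ∑[ x ∈ xs ] (𝟙 (x ≟ a) * g x + 𝟙 (¬? (x ≟ a)) * g x)          ≡⟨ ∑-+ xs _ _ ⟩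
      ∑[ x ∈ xs ] (𝟙 (x ≟ a) * g x) + ∑[ x ∈ xs ] (𝟙 (¬? (x ≟ a)) * g x)
                                                                    ≡⟨ cong (_+ ∑[ x ∈ xs ] (𝟙 (¬? (x ≟ a)) * g x)) (∑-δ a g) ⟩
      g a + ∑[ x ∈ xs ] (𝟙 (¬? (x ≟ a)) * g x)                      ∎
      where
      split-at : ∀ x → g x ≡ 𝟙 (x ≟ a) * g x + 𝟙 (¬? (x ≟ a)) * g x
      split-at x = trans (sym (*-identityˡ (g x))) (trans (cong (_* g x) (sym (𝟙-¬ (x ≟ a)))) (*-distribʳ-+ (g x) (𝟙 (x ≟ a)) (𝟙 (¬? (x ≟ a)))))

    ∑-supported-at : (a : A) (g : A → ℕ) → (∀ x → x ≢ a → g x ≡ 0) → ∑ xs g ≡ g a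
    ∑-supported-at a g off-a = trans (∑-split a g) (trans (cong (g a +_) (trans (∑-cong xs vanish) (∑-0 xs))) (+-identityʳ (g a)))
      where
      vanish : ∀ x → 𝟙 (¬? (x ≟ a)) * g x ≡ 0
      vanish x with x ≟ a
      ... | yes _ = refl
      ... | no x≢a = trans (+-identityʳ (g x)) (off-a x x≢a)

    ∑-reindex : (σ τ : A → A) → (∀ x → τ (σ x) ≡ x) → (∀ x → σ (τ x) ≡ x) → (g : A → ℕ) →
      ∑[ x ∈ xs ] g (σ x) ≡ ∑ xs g
    ∑-reindex σ τ τσ στ g = begin
      ∑[ x ∈ xs ] g (σ x)                               ≡⟨ ∑-cong xs (λ x → sym (∑-δ (σ x) g)) ⟩
      ∑[ x ∈ xs ] ∑[ y ∈ xs ] (𝟙 (y ≟ σ x) * g y)       ≡⟨ ∑-swap xs xs _ ⟩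
      ∑[ y ∈ xs ] ∑[ x ∈ xs ] (𝟙 (y ≟ σ x) * g y)       ≡⟨ ∑-cong xs (λ y → ∑-*ʳ xs (g y) _) ⟩
      ∑[ y ∈ xs ] (∑[ x ∈ xs ] 𝟙 (y ≟ σ x) * g y)       ≡⟨ ∑-cong xs (λ y → cong (_* g y) (preimage-unique y)) ⟩
      ∑[ y ∈ xs ] (1 * g y)                             ≡⟨ ∑-cong xs (λ y → *-identityˡ (g y)) ⟩
      ∑ xs g                                            ∎
      where
      preimage-unique : ∀ y → ∑[ x ∈ xs ] 𝟙 (y ≟ σ x) ≡ 1
      preimage-unique y = trans (∑-cong xs (λ x → 𝟙-cong (y ≟ σ x) (x ≟ τ y) (mk⇔ (to x) (from x)))) (exact (τ y))
        where
        to : ∀ x → y ≡ σ x → x ≡ τ y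
        to x y≡σx = trans (sym (τσ x)) (cong τ (sym y≡σx))
        from : ∀ x → x ≡ τ y → y ≡ σ x
        from x x≡τy = trans (sym (στ y)) (cong σ (sym x≡τy))

    ∑⁴-reindex : (σ τ : A → A) → (∀ x → τ (σ x) ≡ x) → (∀ x → σ (τ x) ≡ x) → (h : A → A → A → A → ℕ) →
      ∑⁴ xs (λ a b c d → h (σ a) (σ b) (σ c) (σ d)) ≡ ∑⁴ xs h
    ∑⁴-reindex σ τ τσ στ h =
      trans (∑-cong xs (λ a → trans (∑-cong xs (λ b → trans (∑-cong xs (λ c → reindex (h (σ a) (σ b) (σ c)))) (reindex _))) (reindex _))) (reindex _)
      where
      reindex : (g : A → ℕ) → ∑[ x ∈ xs ] g (σ x) ≡ ∑ xs g
      reindex = ∑-reindex σ τ τσ στ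

module DihedralOrder where

  open import Data.Empty using (⊥; ⊥-elim)
  open import Data.Nat using (ℕ; _+_; _<_; _<?_)
  open import Data.Nat.Properties using (<-cmp; <-asym; <-trans)
  open import Data.Product using (_×_; _,_)
  open import Data.Sum using (_⊎_; inj₁; inj₂)
  open import Function using (mk⇔)
  open import Relation.Binary using (tri<; tri≈; tri>)
  open import Relation.Binary.PropositionalEquality using (_≡_; _≢_; trans; cong; cong₂; ≢-sym; module ≡-Reasoning)
  open import Relation.Nullary using (Dec)
  open import Relation.Nullary.Decidable using (_×-dec_; _⊎-dec_)
  open FiniteSums

  Distinct4 : {A : Set} → A → A → A → A → Set
  Distinct4 a b c d = a ≢ b × a ≢ c × a ≢ d × b ≢ c × b ≢ d × c ≢ d

  -- The order condition of CanonicalCycle4 (Defs), on the indices of the four vertices.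
  Canonical : ℕ → ℕ → ℕ → ℕ → Set
  Canonical a b c d = a < b × a < c × a < d × b < d

  canonical? : ∀ a b c d → Dec (Canonical a b c d)
  canonical? a b c d = a <? b ×-dec a <? c ×-dec a <? d ×-dec b <? d

  Least : ℕ → ℕ → ℕ → ℕ → Set
  Least a b c d = a < b × a < c × a < d

  least? : ∀ a b c d → Dec (Least a b c d)
  least? a b c d = a <? b ×-dec a <? c ×-dec a <? d

  <-or-> : ∀ {m n} → m ≢ n → m < n ⊎ n < m
  <-or-> {m} {n} m≢n with <-cmp m n
  ... | tri< m<n _ _ = inj₁ m<n
  ... | tri≈ _ m≡n _ = ⊥-elim (m≢n m≡n)
  ... | tri> _ _ n<m = inj₂ n<m

  canonical-or-reflected : ∀ {a b c d} → b ≢ d → 𝟙 (canonical? a b c d) + 𝟙 (canonical? a d c b) ≡ 𝟙 (least? a b c d)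
  canonical-or-reflected {a} {b} {c} {d} b≢d = begin
    𝟙 (canonical? a b c d) + 𝟙 (canonical? a d c b)  ≡⟨ 𝟙-⊎ (canonical? a b c d) (canonical? a d c b) exclusive ⟨
    𝟙 (canonical? a b c d ⊎-dec canonical? a d c b)  ≡⟨ 𝟙-cong _ (least? a b c d) (mk⇔ to from) ⟩
    𝟙 (least? a b c d)                               ∎
    where
    open ≡-Reasoning
    exclusive : Canonical a b c d → Canonical a d c b → ⊥
    exclusive (_ , _ , _ , b<d) (_ , _ , _ , d<b) = <-asym b<d d<b
    to : Canonical a b c d ⊎ Canonical a d c b → Least a b c d
    to (inj₁ (a<b , a<c , a<d , _)) = a<b , a<c , a<d
    to (inj₂ (a<d , a<c , a<b , _)) = a<b , a<c , a<d
    from : Least a b c d → Canonical a b c d ⊎ Canonical a d c b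
    from (a<b , a<c , a<d) with <-or-> b≢d
    ... | inj₁ b<d = inj₁ (a<b , a<c , a<d , b<d)
    ... | inj₂ d<b = inj₂ (a<d , a<c , a<b , d<b)

  least-of-rotations : ∀ {a b c d} → Distinct4 a b c d →
    Least a b c d ⊎ Least b c d a ⊎ Least c d a b ⊎ Least d a b c
  least-of-rotations (a≢b , a≢c , a≢d , b≢c , b≢d , c≢d) with <-or-> a≢b | <-or-> c≢d
  ... | inj₁ a<b | inj₁ c<d with <-or-> a≢c
  ...   | inj₁ a<c = inj₁ (a<b , a<c , <-trans a<c c<d)
  ...   | inj₂ c<a = inj₂ (inj₂ (inj₁ (c<d , c<a , <-trans c<a a<b)))
  least-of-rotations (a≢b , a≢c , a≢d , b≢c , b≢d , c≢d) | inj₁ a<b | inj₂ d<c with <-or-> a≢d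
  ...   | inj₁ a<d = inj₁ (a<b , <-trans a<d d<c , a<d)
  ...   | inj₂ d<a = inj₂ (inj₂ (inj₂ (d<a , <-trans d<a a<b , d<c)))
  least-of-rotations (a≢b , a≢c , a≢d , b≢c , b≢d , c≢d) | inj₂ b<a | inj₁ c<d with <-or-> b≢c
  ...   | inj₁ b<c = inj₂ (inj₁ (b<c , <-trans b<c c<d , b<a))
  ...   | inj₂ c<b = inj₂ (inj₂ (inj₁ (c<d , <-trans c<b b<a , c<b)))
  least-of-rotations (a≢b , a≢c , a≢d , b≢c , b≢d , c≢d) | inj₂ b<a | inj₂ d<c with <-or-> b≢d
  ...   | inj₁ b<d = inj₂ (inj₁ (<-trans b<d d<c , b<d , b<a))
  ...   | inj₂ d<b = inj₂ (inj₂ (inj₂ (<-trans d<b b<a , d<b , d<c)))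

  one-rotation-least : ∀ {a b c d} → Distinct4 a b c d →
    𝟙 (least? a b c d) + (𝟙 (least? b c d a) + (𝟙 (least? c d a b) + 𝟙 (least? d a b c))) ≡ 1
  one-rotation-least {a} {b} {c} {d} distinct = begin
    𝟙 L₁ + (𝟙 L₂ + (𝟙 L₃ + 𝟙 L₄))        ≡⟨ cong (λ n → 𝟙 L₁ + (𝟙 L₂ + n)) (𝟙-⊎ L₃ L₄ excl₃₄) ⟨
    𝟙 L₁ + (𝟙 L₂ + 𝟙 (L₃ ⊎-dec L₄))      ≡⟨ cong (𝟙 L₁ +_) (𝟙-⊎ L₂ (L₃ ⊎-dec L₄) excl₂) ⟨
    𝟙 L₁ + 𝟙 (L₂ ⊎-dec (L₃ ⊎-dec L₄))    ≡⟨ 𝟙-⊎ L₁ (L₂ ⊎-dec (L₃ ⊎-dec L₄)) excl₁ ⟨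
    𝟙 (L₁ ⊎-dec (L₂ ⊎-dec (L₃ ⊎-dec L₄))) ≡⟨ 𝟙-yes _ (least-of-rotations distinct) ⟩
    1                                    ∎
    where
    open ≡-Reasoning
    L₁ : Dec (Least a b c d)
    L₁ = least? a b c d
    L₂ : Dec (Least b c d a)
    L₂ = least? b c d a
    L₃ : Dec (Least c d a b)
    L₃ = least? c d a b
    L₄ : Dec (Least d a b c)
    L₄ = least? d a b c
    excl₁ : Least a b c d → Least b c d a ⊎ Least c d a b ⊎ Least d a b c → ⊥
    excl₁ (a<b , _ , _) (inj₁ (_ , _ , b<a)) = <-asym a<b b<a
    excl₁ (_ , a<c , _) (inj₂ (inj₁ (_ , c<a , _))) = <-asym a<c c<a
    excl₁ (_ , _ , a<d) (inj₂ (inj₂ (d<a , _ , _))) = <-asym a<d d<a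
    excl₂ : Least b c d a → Least c d a b ⊎ Least d a b c → ⊥
    excl₂ (b<c , _ , _) (inj₁ (_ , _ , c<b)) = <-asym b<c c<b
    excl₂ (_ , b<d , _) (inj₂ (_ , d<b , _)) = <-asym b<d d<b
    excl₃₄ : Least c d a b → Least d a b c → ⊥
    excl₃₄ (c<d , _ , _) (_ , _ , d<c) = <-asym c<d d<c

  one-canonical-in-orbit : ∀ {a b c d} → Distinct4 a b c d →
    dihedralSum (λ a b c d → 𝟙 (canonical? a b c d)) a b c d ≡ 1
  one-canonical-in-orbit distinct@(a≢b , a≢c , a≢d , b≢c , b≢d , c≢d) =
    trans (cong₂ _+_ (canonical-or-reflected b≢d)
            (cong₂ _+_ (canonical-or-reflected (≢-sym a≢c))
              (cong₂ _+_ (canonical-or-reflected (≢-sym b≢d)) (canonical-or-reflected a≢c))))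
          (one-rotation-least distinct)

module Field (F : FiniteField) where

  open import Algebra.Structures using (IsCommutativeRing)
  open import Data.Integer using (0ℤ)
  open import Data.Product using (_×_; _,_; proj₁; proj₂)
  open import Data.Sum using (_⊎_; inj₁; inj₂)
  open import Relation.Nullary using (Dec; yes; no; ¬?)
  open import Function using (id; _⇔_; mk⇔; Equivalence)
  open import Relation.Binary.PropositionalEquality

  open FiniteField F public
  open IsCommutativeRing isCommutativeRing public
    using (+-assoc; +-comm; +-identityˡ; +-identityʳ; -‿inverseˡ; -‿inverseʳ;
           *-assoc; *-comm; *-identityˡ; *-identityʳ; distribˡ; distribʳ; zeroˡ; zeroʳ)
  open CommutativeRingSolver isCommutativeRing public using (solve; _⊜_; Κ; _⊕_; _⊗_; ⊝_)
  open ≡-Reasoning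

  two : Carrier
  two = 1# + 1#

  x-y≡0⇒x≡y : ∀ {x y} → x - y ≡ 0# → x ≡ y
  x-y≡0⇒x≡y {x} {y} x-y≡0 = begin
    x              ≡⟨ solve 2 (λ x y → x ⊜ (x ⊕ ⊝ y) ⊕ y) refl x y ⟩
    (x - y) + y    ≡⟨ cong (_+ y) x-y≡0 ⟩
    0# + y         ≡⟨ +-identityˡ y ⟩
    y              ∎

  x≡x+y⇒y≡0 : ∀ {x y} → x ≡ x + y → y ≡ 0#
  x≡x+y⇒y≡0 {x} {y} x≡x+y = begin
    y              ≡⟨ solve 2 (λ x y → y ⊜ (x ⊕ y) ⊕ ⊝ x) refl x y ⟩
    (x + y) - x    ≡⟨ cong (_- x) x≡x+y ⟨
    x - x          ≡⟨ -‿inverseʳ x ⟩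
    0#             ∎

  ≡0-cong : ∀ {x y} → x ≡ y → (x ≡ 0# ⇔ y ≡ 0#)
  ≡0-cong refl = mk⇔ id id

  _⁻¹ : (x : Carrier) → {x ≢ 0#} → Carrier
  (x ⁻¹) {x≢0} = proj₁ (inverse x x≢0)

  x*x⁻¹≡1 : ∀ x (x≢0 : x ≢ 0#) → x * (x ⁻¹) {x≢0} ≡ 1#
  x*x⁻¹≡1 x x≢0 = proj₂ (inverse x x≢0)

  x⁻¹*[x*y]≡y : ∀ x (x≢0 : x ≢ 0#) y → (x ⁻¹) {x≢0} * (x * y) ≡ y
  x⁻¹*[x*y]≡y x x≢0 y = begin
    x⁻¹ * (x * y)   ≡⟨ solve 3 (λ i x y → i ⊗ (x ⊗ y) ⊜ (x ⊗ i) ⊗ y) refl x⁻¹ x y ⟩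
    (x * x⁻¹) * y   ≡⟨ cong (_* y) (x*x⁻¹≡1 x x≢0) ⟩
    1# * y          ≡⟨ *-identityˡ y ⟩
    y               ∎
    where
    x⁻¹ : Carrier
    x⁻¹ = (x ⁻¹) {x≢0}

  x*[x⁻¹*y]≡y : ∀ x (x≢0 : x ≢ 0#) y → x * ((x ⁻¹) {x≢0} * y) ≡ y
  x*[x⁻¹*y]≡y x x≢0 y = begin
    x * (x⁻¹ * y)   ≡⟨ solve 3 (λ x i y → x ⊗ (i ⊗ y) ⊜ (x ⊗ i) ⊗ y) refl x x⁻¹ y ⟩
    (x * x⁻¹) * y   ≡⟨ cong (_* y) (x*x⁻¹≡1 x x≢0) ⟩
    1# * y          ≡⟨ *-identityˡ y ⟩
    y               ∎
    where
    x⁻¹ : Carrier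
    x⁻¹ = (x ⁻¹) {x≢0}

  y≡[y*x⁻¹]*x : ∀ {x} (x≢0 : x ≢ 0#) y → y ≡ (y * (x ⁻¹) {x≢0}) * x
  y≡[y*x⁻¹]*x {x} x≢0 y = begin
    y                 ≡⟨ *-identityʳ y ⟨
    y * 1#            ≡⟨ cong (y *_) (x*x⁻¹≡1 x x≢0) ⟨
    y * (x * x⁻¹)     ≡⟨ solve 3 (λ y x i → y ⊗ (x ⊗ i) ⊜ (y ⊗ i) ⊗ x) refl y x x⁻¹ ⟩
    (y * x⁻¹) * x     ∎
    where
    x⁻¹ : Carrier
    x⁻¹ = (x ⁻¹) {x≢0}

  *-cancelˡ : ∀ {x y z} → x ≢ 0# → x * y ≡ x * z → y ≡ z
  *-cancelˡ {x} {y} {z} x≢0 xy≡xz =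
    trans (sym (x⁻¹*[x*y]≡y x x≢0 y)) (trans (cong ((x ⁻¹) {x≢0} *_) xy≡xz) (x⁻¹*[x*y]≡y x x≢0 z))

  x*y≡0⇒y≡0 : ∀ {x y} → x ≢ 0# → x * y ≡ 0# → y ≡ 0#
  x*y≡0⇒y≡0 {x} {y} x≢0 xy≡0 = *-cancelˡ x≢0 (trans xy≡0 (sym (zeroʳ x)))

  x*y≡0⇒x≡0∨y≡0 : ∀ {x y} → x * y ≡ 0# → x ≡ 0# ⊎ y ≡ 0#
  x*y≡0⇒x≡0∨y≡0 {x} xy≡0 with x ≟ 0#
  ... | yes x≡0 = inj₁ x≡0
  ... | no x≢0 = inj₂ (x*y≡0⇒y≡0 x≢0 xy≡0)

  x*y≢0 : ∀ {x y} → x ≢ 0# → y ≢ 0# → x * y ≢ 0#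
  x*y≢0 x≢0 y≢0 xy≡0 with x*y≡0⇒x≡0∨y≡0 xy≡0
  ... | inj₁ x≡0 = x≢0 x≡0
  ... | inj₂ y≡0 = y≢0 y≡0

  k*x≡y⇔x≡k⁻¹*y : ∀ {k} (k≢0 : k ≢ 0#) {x y} → k * x ≡ y ⇔ x ≡ (k ⁻¹) {k≢0} * y
  k*x≡y⇔x≡k⁻¹*y {k} k≢0 {x} {y} = mk⇔
    (λ kx≡y → trans (sym (x⁻¹*[x*y]≡y k k≢0 x)) (cong ((k ⁻¹) {k≢0} *_) kx≡y))
    (λ x≡k⁻¹y → trans (cong (k *_) x≡k⁻¹y) (x*[x⁻¹*y]≡y k k≢0 y))

  linear-root : ∀ {k} (k≢0 : k ≢ 0#) {t x} → t * k + x ≡ 0# ⇔ t ≡ (k ⁻¹) {k≢0} * (- x)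
  linear-root {k} k≢0 {t} {x} = mk⇔
    (λ tk+x≡0 → Equivalence.to (k*x≡y⇔x≡k⁻¹*y k≢0) (begin
      k * t                ≡⟨ solve 3 (λ k t x → k ⊗ t ⊜ (t ⊗ k ⊕ x) ⊕ ⊝ x) refl k t x ⟩
      (t * k + x) - x      ≡⟨ cong (_- x) tk+x≡0 ⟩
      0# - x               ≡⟨ +-identityˡ (- x) ⟩
      - x                  ∎))
    (λ t≡t₀ → begin
      t * k + x            ≡⟨ cong (_+ x) (*-comm t k) ⟩
      k * t + x            ≡⟨ cong (_+ x) (Equivalence.from (k*x≡y⇔x≡k⁻¹*y k≢0) t≡t₀) ⟩
      - x + x              ≡⟨ -‿inverseˡ x ⟩
      0#                   ∎)

  linear-two-roots : ∀ {s t κ β} → s ≢ t → s * κ + β ≡ 0# → t * κ + β ≡ 0# → κ ≡ 0# × β ≡ 0#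
  linear-two-roots {s} {t} {κ} {β} s≢t sκ+β≡0 tκ+β≡0 = κ≡0 , β≡0
    where
    κ≡0 : κ ≡ 0#
    κ≡0 = x*y≡0⇒y≡0 (λ s-t≡0 → s≢t (x-y≡0⇒x≡y s-t≡0)) (begin
      (s - t) * κ                   ≡⟨ solve 4 (λ s t κ β → (s ⊕ ⊝ t) ⊗ κ ⊜ (s ⊗ κ ⊕ β) ⊕ ⊝ (t ⊗ κ ⊕ β)) refl s t κ β ⟩
      (s * κ + β) - (t * κ + β)     ≡⟨ cong₂ _-_ sκ+β≡0 tκ+β≡0 ⟩
      0# - 0#                       ≡⟨ -‿inverseʳ 0# ⟩
      0#                            ∎)
    β≡0 : β ≡ 0#
    β≡0 = begin
      β                  ≡⟨ solve 3 (λ s κ β → β ⊜ (s ⊗ κ ⊕ β) ⊕ ⊝ (s ⊗ κ)) refl s κ β ⟩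
      (s * κ + β) - s * κ ≡⟨ cong₂ (λ u v → u - s * v) sκ+β≡0 κ≡0 ⟩
      0# - s * 0#        ≡⟨ solve 1 (λ s → Κ 0ℤ ⊕ ⊝ (s ⊗ Κ 0ℤ) ⊜ Κ 0ℤ) refl s ⟩
      0#                 ∎

  negV : V → V
  negV (x₁ , x₂) = - x₁ , - x₂

  -- Componentwise multiplication makes V a commutative ring. It only serves to normalise
  -- vector identities: λ · x is (λ , λ) *V x and x -V y is x +V negV y definitionally.
  _*V_ : V → V → V
  (x₁ , x₂) *V (y₁ , y₂) = x₁ * y₁ , x₂ * y₂

  V-isCommutativeRing : IsCommutativeRing _≡_ _+V_ _*V_ negV 0V (1# , 1#)
  V-isCommutativeRing = record
    { isRing = record
      { +-isAbelianGroup = record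
        { isGroup = record
          { isMonoid = record
            { isSemigroup = record
              { isMagma = record { isEquivalence = isEquivalence ; ∙-cong = cong₂ _+V_ }
              ; assoc = λ x y z → cong₂ _,_ (+-assoc _ _ _) (+-assoc _ _ _) }
            ; identity = (λ x → cong₂ _,_ (+-identityˡ _) (+-identityˡ _))
                       , (λ x → cong₂ _,_ (+-identityʳ _) (+-identityʳ _)) }
          ; inverse = (λ x → cong₂ _,_ (-‿inverseˡ _) (-‿inverseˡ _))
                    , (λ x → cong₂ _,_ (-‿inverseʳ _) (-‿inverseʳ _))
          ; ⁻¹-cong = cong negV }
        ; comm = λ x y → cong₂ _,_ (+-comm _ _) (+-comm _ _) }
      ; *-cong = cong₂ _*V_
      ; *-assoc = λ x y z → cong₂ _,_ (*-assoc _ _ _) (*-assoc _ _ _)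
      ; *-identity = (λ x → cong₂ _,_ (*-identityˡ _) (*-identityˡ _))
                   , (λ x → cong₂ _,_ (*-identityʳ _) (*-identityʳ _))
      ; distrib = (λ x y z → cong₂ _,_ (distribˡ _ _ _) (distribˡ _ _ _))
                , (λ x y z → cong₂ _,_ (distribʳ _ _ _) (distribʳ _ _ _)) }
    ; *-comm = λ x y → cong₂ _,_ (*-comm _ _) (*-comm _ _) }

  open CommutativeRingSolver V-isCommutativeRing public using () renaming (solve to solveV; _⊜_ to _⊜V_)

  _≢?_ : (x y : V) → Dec (x ≢ y)
  x ≢? y = ¬? (x ≟V y)

  x-y≡0V⇒x≡y : ∀ {x y} → x -V y ≡ 0V → x ≡ y
  x-y≡0V⇒x≡y {x} {y} x-y≡0 = begin
    x                 ≡⟨ solveV 2 (λ x y → x ⊜V (x ⊕ ⊝ y) ⊕ y) refl x y ⟩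
    (x -V y) +V y     ≡⟨ cong (_+V y) x-y≡0 ⟩
    0V +V y           ≡⟨ solveV 1 (λ y → Κ 0ℤ ⊕ y ⊜V y) refl y ⟩
    y                 ∎

  -V-cancelʳ : ∀ {x y z} → x -V z ≡ y -V z → x ≡ y
  -V-cancelʳ {x} {y} {z} x-z≡y-z = begin
    x                 ≡⟨ solveV 2 (λ x z → x ⊜V (x ⊕ ⊝ z) ⊕ z) refl x z ⟩
    (x -V z) +V z     ≡⟨ cong (_+V z) x-z≡y-z ⟩
    (y -V z) +V z     ≡⟨ solveV 2 (λ y z → (y ⊕ ⊝ z) ⊕ z ⊜V y) refl y z ⟩
    y                 ∎

  z-[z-x]≡x : ∀ z x → z -V (z -V x) ≡ x
  z-[z-x]≡x = solveV 2 (λ z x → z ⊕ ⊝ (z ⊕ ⊝ x) ⊜V x) refl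

  -V-cancelˡ : ∀ {x y z} → z -V x ≡ z -V y → x ≡ y
  -V-cancelˡ {x} {y} {z} z-x≡z-y = begin
    x                 ≡⟨ z-[z-x]≡x z x ⟨
    z -V (z -V x)     ≡⟨ cong (z -V_) z-x≡z-y ⟩
    z -V (z -V y)     ≡⟨ z-[z-x]≡x z y ⟩
    y                 ∎

module Enumerations (F : FiniteField) where

  open import Data.Fin as Fin using (Fin; toℕ)
  import Data.Fin.Properties as Fin
  open import Data.List using (allFin; length)
  open import Data.List.Properties using (length-map; length-tabulate)
  open import Data.Nat as ℕ using (ℕ)
  open import Data.Nat.Properties as ℕ using ()
  open import Data.Product using (_×_; _,_; proj₁; proj₂)
  open import Function using (_∘_; id; _⇔_; mk⇔; Equivalence; Inverse)
  open import Relation.Nullary using (Dec; yes; no; ¬?)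
  open import Relation.Nullary.Decidable using (_×-dec_)
  open import Relation.Binary.PropositionalEquality
  open ≡-Reasoning
  open FiniteSums
  open Field F

  private
    to : Fin size → Carrier
    to = Inverse.to enum
    from : Carrier → Fin size
    from = Inverse.from enum

  elems-exact : Exact _≟_ elems
  elems-exact a = begin
    ∑[ x ∈ elems ] 𝟙 (x ≟ a)                  ≡⟨ ∑-map to (allFin size) _ ⟩
    ∑[ i ∈ allFin size ] 𝟙 (to i ≟ a)         ≡⟨ ∑-cong (allFin size) (λ i → 𝟙-cong (to i ≟ a) (i Fin.≟ from a) (mk⇔ to⇒from from⇒to)) ⟩
    ∑[ i ∈ allFin size ] 𝟙 (i Fin.≟ from a)   ≡⟨ allFin-exact size (from a) ⟩
    1                                         ∎
    where
    to⇒from : ∀ {i} → to i ≡ a → i ≡ from a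
    to⇒from {i} refl = sym (Inverse.strictlyInverseʳ enum i)
    from⇒to : ∀ {i} → i ≡ from a → to i ≡ a
    from⇒to refl = Inverse.strictlyInverseˡ enum a

  ∑V-split : (g : V → ℕ) → ∑ allV g ≡ ∑[ x ∈ elems ] ∑[ y ∈ elems ] g (x , y)
  ∑V-split g = trans (∑-concatMap _ elems g) (∑-cong elems (λ x → ∑-map (x ,_) elems g))

  allV-exact : Exact _≟V_ allV
  allV-exact (a , b) = begin
    ∑[ v ∈ allV ] 𝟙 (v ≟V (a , b))                           ≡⟨ ∑V-split _ ⟩
    ∑[ x ∈ elems ] ∑[ y ∈ elems ] 𝟙 ((x , y) ≟V (a , b))     ≡⟨ ∑-cong elems (λ x → ∑-cong elems (λ y → componentwise x y)) ⟩
    ∑[ x ∈ elems ] ∑[ y ∈ elems ] (𝟙 (x ≟ a) ℕ.* 𝟙 (y ≟ b))  ≡⟨ ∑-cong elems (λ x → ∑-*ˡ elems (𝟙 (x ≟ a)) _) ⟩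
    ∑[ x ∈ elems ] (𝟙 (x ≟ a) ℕ.* ∑[ y ∈ elems ] 𝟙 (y ≟ b))  ≡⟨ ∑-cong elems (λ x → cong (𝟙 (x ≟ a) ℕ.*_) (elems-exact b)) ⟩
    ∑[ x ∈ elems ] (𝟙 (x ≟ a) ℕ.* 1)                          ≡⟨ ∑-cong elems (λ x → ℕ.*-identityʳ _) ⟩
    ∑[ x ∈ elems ] 𝟙 (x ≟ a)                                  ≡⟨ elems-exact a ⟩
    1                                                         ∎
    where
    componentwise : ∀ x y → 𝟙 ((x , y) ≟V (a , b)) ≡ 𝟙 (x ≟ a) ℕ.* 𝟙 (y ≟ b)
    componentwise x y = trans (𝟙-cong ((x , y) ≟V (a , b)) ((x ≟ a) ×-dec (y ≟ b))
                                 (mk⇔ (λ { refl → refl , refl }) (λ { (refl , refl) → refl })))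
                              (𝟙-× (x ≟ a) (y ≟ b))

  ∑-quadruples : (g : V × V × V × V → ℕ) → ∑ quadruples g ≡ ∑⁴ allV (λ v₀ v₁ v₂ v₃ → g (v₀ , v₁ , v₂ , v₃))
  ∑-quadruples g =
    trans (∑-concatMap _ allV g) (∑-cong allV λ v₀ →
      trans (∑-concatMap _ allV g) (∑-cong allV λ v₁ →
        trans (∑-concatMap _ allV g) (∑-cong allV λ v₂ →
          ∑-map _ allV g)))

  module ∑F = Enumeration _≟_ elems elems-exact
  module ∑V = Enumeration _≟V_ allV allV-exact

  length-elems : length elems ≡ size
  length-elems = trans (length-map to (allFin size)) (length-tabulate id)

  ∑F-const : (c : ℕ) → ∑[ x ∈ elems ] c ≡ size ℕ.* c
  ∑F-const c = trans (∑-const elems c) (cong (ℕ._* c) length-elems)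

  ∑V-const : (c : ℕ) → ∑[ v ∈ allV ] c ≡ size ℕ.* (size ℕ.* c)
  ∑V-const c = trans (∑V-split _) (trans (∑-cong elems (λ _ → ∑F-const c)) (∑F-const _))

  idx-injective : ∀ u v → idx u ≡ idx v → u ≡ v
  idx-injective (x , y) (x' , y') idx≡ = cong₂ _,_ (from-injective (cong proj₁ indices≡)) (from-injective (cong proj₂ indices≡))
    where
    pair : V → Fin (size ℕ.* size)
    pair (x , y) = Fin.combine (from x) (from y)
    toℕ-pair : ∀ x y → toℕ (pair (x , y)) ≡ idx (x , y)
    toℕ-pair x y = trans (Fin.toℕ-combine (from x) (from y)) (cong (ℕ._+ toℕ (from y)) (ℕ.*-comm size (toℕ (from x))))
    indices≡ : (from x , from y) ≡ (from x' , from y')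
    indices≡ = begin
      (from x , from y)                              ≡⟨ Fin.remQuot-combine (from x) (from y) ⟨
      Fin.remQuot size (pair (x , y))                ≡⟨ cong (Fin.remQuot size) (Fin.toℕ-injective (trans (toℕ-pair x y) (trans idx≡ (sym (toℕ-pair x' y'))))) ⟩
      Fin.remQuot size (pair (x' , y'))              ≡⟨ Fin.remQuot-combine (from x') (from y') ⟩
      (from x' , from y')                            ∎
    from-injective : ∀ {a b} → from a ≡ from b → a ≡ b
    from-injective {a} {b} e = trans (sym (Inverse.strictlyInverseˡ enum a)) (trans (cong to e) (Inverse.strictlyInverseˡ enum b))

  count-≢ : ∀ u → 1 ℕ.+ ∑[ x ∈ elems ] 𝟙 (¬? (x ≟ u)) ≡ size
  count-≢ u = sym (begin
    size                                          ≡⟨ trans (∑F-const 1) (ℕ.*-identityʳ size) ⟨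
    ∑[ x ∈ elems ] 1                              ≡⟨ ∑F.∑-split u (λ _ → 1) ⟩
    1 ℕ.+ ∑[ x ∈ elems ] (𝟙 (¬? (x ≟ u)) ℕ.* 1)  ≡⟨ cong (1 ℕ.+_) (∑-cong elems (λ x → ℕ.*-identityʳ _)) ⟩
    1 ℕ.+ ∑[ x ∈ elems ] 𝟙 (¬? (x ≟ u))          ∎)

  count-≢-≢ : ∀ {u w} → u ≢ w → 2 ℕ.+ ∑[ x ∈ elems ] (𝟙 (¬? (x ≟ u)) ℕ.* 𝟙 (¬? (x ≟ w))) ≡ size
  count-≢-≢ {u} {w} u≢w = begin
    2 ℕ.+ ∑[ x ∈ elems ] (𝟙 (¬? (x ≟ u)) ℕ.* 𝟙 (¬? (x ≟ w)))
      ≡⟨ cong (2 ℕ.+_) (∑-cong elems (λ x → ℕ.*-comm (𝟙 (¬? (x ≟ u))) _)) ⟩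
    1 ℕ.+ (1 ℕ.+ ∑[ x ∈ elems ] (𝟙 (¬? (x ≟ w)) ℕ.* 𝟙 (¬? (x ≟ u))))
      ≡⟨ cong (λ n → 1 ℕ.+ (n ℕ.+ ∑[ x ∈ elems ] (𝟙 (¬? (x ≟ w)) ℕ.* 𝟙 (¬? (x ≟ u))))) (𝟙-yes (¬? (w ≟ u)) (≢-sym u≢w)) ⟨
    1 ℕ.+ (𝟙 (¬? (w ≟ u)) ℕ.+ ∑[ x ∈ elems ] (𝟙 (¬? (x ≟ w)) ℕ.* 𝟙 (¬? (x ≟ u))))
      ≡⟨ cong (1 ℕ.+_) (∑F.∑-split w (λ x → 𝟙 (¬? (x ≟ u)))) ⟨
    1 ℕ.+ ∑[ x ∈ elems ] 𝟙 (¬? (x ≟ u))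
      ≡⟨ count-≢ u ⟩
    size
      ∎

  ∑-≢-const : ∀ u {g : Carrier → ℕ} k → (∀ y → y ≢ u → g y ≡ k) → ∑[ y ∈ elems ] (𝟙 (¬? (y ≟ u)) ℕ.* g y) ≡ (size ℕ.∸ 1) ℕ.* k
  ∑-≢-const u {g} k g≡k = begin
    ∑[ y ∈ elems ] (𝟙 (¬? (y ≟ u)) ℕ.* g y)   ≡⟨ ∑-cong elems (λ y → by-cases y (¬? (y ≟ u))) ⟩
    ∑[ y ∈ elems ] (𝟙 (¬? (y ≟ u)) ℕ.* k)     ≡⟨ ∑-*ʳ elems k _ ⟩
    ∑[ y ∈ elems ] 𝟙 (¬? (y ≟ u)) ℕ.* k       ≡⟨ cong (ℕ._* k) (trans (sym (ℕ.m+n∸m≡n 1 _)) (cong (ℕ._∸ 1) (count-≢ u))) ⟩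
    (size ℕ.∸ 1) ℕ.* k                        ∎
    where
    by-cases : ∀ y (y≢u? : Dec (y ≢ u)) → 𝟙 y≢u? ℕ.* g y ≡ 𝟙 y≢u? ℕ.* k
    by-cases y (no _) = refl
    by-cases y (yes y≢u) = cong (1 ℕ.*_) (g≡k y y≢u)

  ∑-nonzero-solutions : ∀ {P : Carrier → Set} (P? : ∀ l → Dec (P l)) l₀ → (∀ {l} → l ≢ 0# → P l ⇔ l ≡ l₀) →
    ∑[ l ∈ elems ] (𝟙 (¬? (l ≟ 0#)) ℕ.* 𝟙 (P? l)) ≡ 𝟙 (¬? (l₀ ≟ 0#))
  ∑-nonzero-solutions P? l₀ P⇔l≡l₀ = trans (∑F.∑-supported-at l₀ _ off-l₀) (at-l₀ (¬? (l₀ ≟ 0#)))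
    where
    at-l₀ : (l₀≢0? : Dec (l₀ ≢ 0#)) → 𝟙 l₀≢0? ℕ.* 𝟙 (P? l₀) ≡ 𝟙 l₀≢0?
    at-l₀ (no _) = refl
    at-l₀ (yes l₀≢0) = cong (1 ℕ.*_) (𝟙-yes (P? l₀) (Equivalence.from (P⇔l≡l₀ l₀≢0) refl))
    off-l₀ : ∀ l → l ≢ l₀ → 𝟙 (¬? (l ≟ 0#)) ℕ.* 𝟙 (P? l) ≡ 0
    off-l₀ l l≢l₀ = by-cases (¬? (l ≟ 0#))
      where
      by-cases : (l≢0? : Dec (l ≢ 0#)) → 𝟙 l≢0? ℕ.* 𝟙 (P? l) ≡ 0
      by-cases (no _) = refl
      by-cases (yes l≢0) = cong (1 ℕ.*_) (𝟙-no (P? l) (l≢l₀ ∘ Equivalence.to (P⇔l≡l₀ l≢0)))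

module Plane (F : FiniteField) where

  open import Data.Empty using (⊥-elim)
  open import Data.Integer as ℤ using (0ℤ)
  open import Data.Product using (_,_; ∃; proj₁; proj₂)
  open import Data.Sum using (inj₁; inj₂)
  open import Relation.Nullary using (¬_; yes; no)
  open import Relation.Binary.PropositionalEquality
  open ≡-Reasoning
  open Field F

  e₁ e₂ : V
  e₁ = 1# , 0#
  e₂ = 0# , 1#

  ⟨_,_⟩ : V → V → Carrier
  ⟨ (x₁ , x₂) , (y₁ , y₂) ⟩ = x₁ * y₁ + x₂ * y₂

  det : V → V → Carrier
  det (u₁ , u₂) (v₁ , v₂) = u₁ * v₂ - v₁ * u₂

  det≡0⇒proportional : ∀ {u v} → u ≢ 0V → det u v ≡ 0# → ∃ λ μ → v ≡ μ · u
  det≡0⇒proportional {u₁ , u₂} {v₁ , v₂} u≢0 det≡0 with u₁ ≟ 0# | u₂ ≟ 0#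
  ... | yes refl | yes refl = ⊥-elim (u≢0 refl)
  ... | no u₁≢0 | _ = v₁ * u₁⁻¹ , cong₂ _,_ (y≡[y*x⁻¹]*x u₁≢0 v₁) v₂≡μ*u₂
    where
    u₁⁻¹ : Carrier
    u₁⁻¹ = (u₁ ⁻¹) {u₁≢0}
    v₂≡μ*u₂ : v₂ ≡ (v₁ * u₁⁻¹) * u₂
    v₂≡μ*u₂ = begin
      v₂                   ≡⟨ x⁻¹*[x*y]≡y u₁ u₁≢0 v₂ ⟨
      u₁⁻¹ * (u₁ * v₂)     ≡⟨ cong (u₁⁻¹ *_) (x-y≡0⇒x≡y det≡0) ⟩
      u₁⁻¹ * (v₁ * u₂)     ≡⟨ solve 3 (λ i v u → i ⊗ (v ⊗ u) ⊜ (v ⊗ i) ⊗ u) refl u₁⁻¹ v₁ u₂ ⟩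
      (v₁ * u₁⁻¹) * u₂     ∎
  ... | yes refl | no u₂≢0 = v₂ * (u₂ ⁻¹) {u₂≢0} , cong₂ _,_ v₁≡μ*0 (y≡[y*x⁻¹]*x u₂≢0 v₂)
    where
    v₁*u₂≡0 : v₁ * u₂ ≡ 0#
    v₁*u₂≡0 = begin
      v₁ * u₂                  ≡⟨ solve 3 (λ v₁ u₂ v₂ → v₁ ⊗ u₂ ⊜ ⊝ ((Κ 0ℤ ⊗ v₂) ⊕ ⊝ (v₁ ⊗ u₂))) refl v₁ u₂ v₂ ⟩
      - det (0# , u₂) (v₁ , v₂) ≡⟨ cong -_ det≡0 ⟩
      - 0#                     ≡⟨ solve 0 (⊝ Κ 0ℤ ⊜ Κ 0ℤ) refl ⟩
      0#                       ∎
    v₁≡μ*0 : v₁ ≡ (v₂ * (u₂ ⁻¹) {u₂≢0}) * 0#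
    v₁≡μ*0 with x*y≡0⇒x≡0∨y≡0 v₁*u₂≡0
    ... | inj₁ v₁≡0 = trans v₁≡0 (sym (zeroʳ _))
    ... | inj₂ u₂≡0 = ⊥-elim (u₂≢0 u₂≡0)

  kernel-is-line : ∀ {ℓ u v} → ℓ ≢ 0V → u ≢ 0V → ⟨ u , ℓ ⟩ ≡ 0# → ⟨ v , ℓ ⟩ ≡ 0# → ∃ λ μ → v ≡ μ · u
  kernel-is-line {ℓ₁ , ℓ₂} {u₁ , u₂} {v₁ , v₂} ℓ≢0 u≢0 ℓu≡0 ℓv≡0 = det≡0⇒proportional u≢0 det≡0
    where
    δ : Carrier
    δ = det (u₁ , u₂) (v₁ , v₂)
    ℓ₁δ≡0 : ℓ₁ * δ ≡ 0#
    ℓ₁δ≡0 = begin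
      ℓ₁ * δ
        ≡⟨ solve 6 (λ ℓ₁ ℓ₂ u₁ u₂ v₁ v₂ → ℓ₁ ⊗ (u₁ ⊗ v₂ ⊕ ⊝ (v₁ ⊗ u₂))
                                        ⊜ v₂ ⊗ (u₁ ⊗ ℓ₁ ⊕ u₂ ⊗ ℓ₂) ⊕ ⊝ (u₂ ⊗ (v₁ ⊗ ℓ₁ ⊕ v₂ ⊗ ℓ₂))) refl ℓ₁ ℓ₂ u₁ u₂ v₁ v₂ ⟩
      v₂ * ⟨ (u₁ , u₂) , (ℓ₁ , ℓ₂) ⟩ - u₂ * ⟨ (v₁ , v₂) , (ℓ₁ , ℓ₂) ⟩  ≡⟨ cong₂ (λ s t → v₂ * s - u₂ * t) ℓu≡0 ℓv≡0 ⟩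
      v₂ * 0# - u₂ * 0#                               ≡⟨ solve 2 (λ v₂ u₂ → (v₂ ⊗ Κ 0ℤ) ⊕ ⊝ (u₂ ⊗ Κ 0ℤ) ⊜ Κ 0ℤ) refl v₂ u₂ ⟩
      0#                                              ∎
    ℓ₂δ≡0 : ℓ₂ * δ ≡ 0#
    ℓ₂δ≡0 = begin
      ℓ₂ * δ
        ≡⟨ solve 6 (λ ℓ₁ ℓ₂ u₁ u₂ v₁ v₂ → ℓ₂ ⊗ (u₁ ⊗ v₂ ⊕ ⊝ (v₁ ⊗ u₂))
                                        ⊜ u₁ ⊗ (v₁ ⊗ ℓ₁ ⊕ v₂ ⊗ ℓ₂) ⊕ ⊝ (v₁ ⊗ (u₁ ⊗ ℓ₁ ⊕ u₂ ⊗ ℓ₂))) refl ℓ₁ ℓ₂ u₁ u₂ v₁ v₂ ⟩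
      u₁ * ⟨ (v₁ , v₂) , (ℓ₁ , ℓ₂) ⟩ - v₁ * ⟨ (u₁ , u₂) , (ℓ₁ , ℓ₂) ⟩  ≡⟨ cong₂ (λ s t → u₁ * s - v₁ * t) ℓv≡0 ℓu≡0 ⟩
      u₁ * 0# - v₁ * 0#                               ≡⟨ solve 2 (λ u₁ v₁ → (u₁ ⊗ Κ 0ℤ) ⊕ ⊝ (v₁ ⊗ Κ 0ℤ) ⊜ Κ 0ℤ) refl u₁ v₁ ⟩
      0#                                              ∎
    det≡0 : δ ≡ 0#
    det≡0 with ℓ₁ ≟ 0# | ℓ₂ ≟ 0#
    ... | yes refl | yes refl = ⊥-elim (ℓ≢0 refl)
    ... | no ℓ₁≢0 | _ = x*y≡0⇒y≡0 ℓ₁≢0 ℓ₁δ≡0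
    ... | _ | no ℓ₂≢0 = x*y≡0⇒y≡0 ℓ₂≢0 ℓ₂δ≡0

  fixed-by-reflection : ∀ {w p} → p ≡ w -V p → w ≡ two · p
  fixed-by-reflection {w} {p} p≡w-p = begin
    w                 ≡⟨ solveV 2 (λ w p → w ⊜V (w ⊕ ⊝ p) ⊕ p) refl w p ⟩
    (w -V p) +V p     ≡⟨ cong (_+V p) p≡w-p ⟨
    p +V p            ≡⟨ solveV 1 (λ p → p ⊕ p ⊜V Κ (ℤ.+ 2) ⊗ p) refl p ⟩
    two · p           ∎

  -- In characteristic 2 the reflection p ↦ w - p (w ≠ 0) has no fixed point at all.
  reflection-fixes-at-most-one : ∀ {w p p′} → w ≢ 0V → p ≡ w -V p → p′ ≡ w -V p′ → p ≡ p′
  reflection-fixes-at-most-one {w} {p} {p′} w≢0 p-fixed p′-fixed with two ≟ 0#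
  ... | yes two≡0 = ⊥-elim (w≢0 (begin
    w                  ≡⟨ fixed-by-reflection p-fixed ⟩
    two · p            ≡⟨ cong (_· p) two≡0 ⟩
    0# · p             ≡⟨ solveV 1 (λ p → Κ 0ℤ ⊗ p ⊜V Κ 0ℤ) refl p ⟩
    0V                 ∎))
  ... | no two≢0 = cong₂ _,_ (*-cancelˡ two≢0 (cong proj₁ two·p≡two·p′)) (*-cancelˡ two≢0 (cong proj₂ two·p≡two·p′))
    where
    two·p≡two·p′ : two · p ≡ two · p′
    two·p≡two·p′ = trans (sym (fixed-by-reflection p-fixed)) (fixed-by-reflection p′-fixed)

  two·x≡0V⇒x≡0V : ∀ {x} → ¬ Char2 → two · x ≡ 0V → x ≡ 0V
  two·x≡0V⇒x≡0V ¬char2 two·x≡0 = cong₂ _,_ (x*y≡0⇒y≡0 ¬char2 (cong proj₁ two·x≡0)) (x*y≡0⇒y≡0 ¬char2 (cong proj₂ two·x≡0))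

  negV-char2 : Char2 → ∀ x → negV x ≡ x
  negV-char2 char2 x = begin
    negV x             ≡⟨ solveV 1 (λ x → ⊝ x ⊜V x ⊕ ⊝ (Κ (ℤ.+ 2) ⊗ x)) refl x ⟩
    x -V (two · x)     ≡⟨ cong (λ t → x -V (t · x)) char2 ⟩
    x -V (0# · x)      ≡⟨ solveV 1 (λ x → x ⊕ ⊝ (Κ 0ℤ ⊗ x) ⊜V x) refl x ⟩
    x                  ∎

module QuadraticForm (F : FiniteField) (q : FiniteField.V F → FiniteField.Carrier F)
                     (isQ : FiniteField.IsQuadraticForm F q) where

  open import Data.Empty using (⊥)
  open import Data.Integer as ℤ using (0ℤ; 1ℤ; -1ℤ)
  open import Data.Product using (_×_; _,_; ∃; proj₁; proj₂)
  open import Relation.Binary.PropositionalEquality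
  open ≡-Reasoning
  open Field F
  open Plane F

  open IsQuadraticForm isQ

  b : V → V → Carrier
  b = polar q

  q-+ : ∀ x y → q (x +V y) ≡ q x + q y + b x y
  q-+ x y = solve 3 (λ Q X Y → Q ⊜ X ⊕ Y ⊕ (Q ⊕ ⊝ X ⊕ ⊝ Y)) refl (q (x +V y)) (q x) (q y)

  b-sym : ∀ x y → b x y ≡ b y x
  b-sym x y = begin
    q (x +V y) - q x - q y  ≡⟨ cong (λ v → q v - q x - q y) (solveV 2 (λ x y → x ⊕ y ⊜V y ⊕ x) refl x y) ⟩
    q (y +V x) - q x - q y  ≡⟨ solve 3 (λ Q X Y → Q ⊕ ⊝ X ⊕ ⊝ Y ⊜ Q ⊕ ⊝ Y ⊕ ⊝ X) refl (q (y +V x)) (q x) (q y) ⟩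
    q (y +V x) - q y - q x  ∎

  q-0V : q 0V ≡ 0#
  q-0V = begin
    q 0V              ≡⟨ cong q (solveV 1 (λ x → Κ 0ℤ ⊜V Κ 0ℤ ⊗ x) refl 0V) ⟩
    q (0# · 0V)       ≡⟨ homog 0# 0V ⟩
    0# * 0# * q 0V    ≡⟨ solve 1 (λ Q → Κ 0ℤ ⊗ Κ 0ℤ ⊗ Q ⊜ Κ 0ℤ) refl (q 0V) ⟩
    0#                ∎

  q-negV : ∀ x → q (negV x) ≡ q x
  q-negV x = begin
    q (negV x)               ≡⟨ cong q (solveV 1 (λ x → ⊝ x ⊜V Κ -1ℤ ⊗ x) refl x) ⟩
    q ((- 1#) · x)           ≡⟨ homog (- 1#) x ⟩
    (- 1#) * (- 1#) * q x    ≡⟨ solve 1 (λ Q → Κ -1ℤ ⊗ Κ -1ℤ ⊗ Q ⊜ Q) refl (q x) ⟩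
    q x                      ∎

  q-sub-comm : ∀ x y → q (x -V y) ≡ q (y -V x)
  q-sub-comm x y = begin
    q (x -V y)               ≡⟨ q-negV (x -V y) ⟨
    q (negV (x -V y))        ≡⟨ cong q (solveV 2 (λ x y → ⊝ (x ⊕ ⊝ y) ⊜V y ⊕ ⊝ x) refl x y) ⟩
    q (y -V x)               ∎

  b-self : ∀ x → b x x ≡ two * q x
  b-self x = begin
    q (x +V x) - q x - q x         ≡⟨ cong (λ v → q v - q x - q x) (solveV 1 (λ x → x ⊕ x ⊜V Κ (ℤ.+ 2) ⊗ x) refl x) ⟩
    q (two · x) - q x - q x        ≡⟨ cong (λ t → t - q x - q x) (homog two x) ⟩
    two * two * q x - q x - q x    ≡⟨ solve 1 (λ Q → Κ (ℤ.+ 2) ⊗ Κ (ℤ.+ 2) ⊗ Q ⊕ ⊝ Q ⊕ ⊝ Q ⊜ Κ (ℤ.+ 2) ⊗ Q) refl (q x) ⟩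
    two * q x                      ∎

  b-isotropic-self : ∀ {d} → q d ≡ 0# → b d d ≡ 0#
  b-isotropic-self {d} qd≡0 = trans (b-self d) (trans (cong (two *_) qd≡0) (zeroʳ two))

  b-subʳ : ∀ x y z → b x (y -V z) ≡ b x y - b x z
  b-subʳ x y z = begin
    b x (y -V z)                   ≡⟨ cong (b x) (solveV 2 (λ y z → y ⊕ ⊝ z ⊜V y ⊕ Κ -1ℤ ⊗ z) refl y z) ⟩
    b x (y +V ((- 1#) · z))        ≡⟨ addʳ x y _ ⟩
    b x y + b x ((- 1#) · z)       ≡⟨ cong (b x y +_) (scaleʳ (- 1#) x z) ⟩
    b x y + (- 1#) * b x z         ≡⟨ solve 2 (λ B C → B ⊕ Κ -1ℤ ⊗ C ⊜ B ⊕ ⊝ C) refl (b x y) (b x z) ⟩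
    b x y - b x z                  ∎

  b-subˡ : ∀ x y z → b (x -V y) z ≡ b x z - b y z
  b-subˡ x y z = trans (b-sym (x -V y) z) (trans (b-subʳ z x y) (cong₂ _-_ (b-sym z x) (b-sym z y)))

  q-sub : ∀ x y → q (x -V y) ≡ q x + q y - b x y
  q-sub x y = begin
    q (x -V y)                                       ≡⟨ solve 3 (λ Z Y B → Z ⊜ Z ⊕ Y ⊕ B ⊕ ⊝ Y ⊕ ⊝ B) refl (q (x -V y)) (q y) (b (x -V y) y) ⟩
    q (x -V y) + q y + b (x -V y) y - q y - b (x -V y) y
                                                     ≡⟨ cong (λ t → t - q y - b (x -V y) y) (q-+ (x -V y) y) ⟨
    q ((x -V y) +V y) - q y - b (x -V y) y           ≡⟨ cong₂ (λ u t → q u - q y - t) (solveV 2 (λ x y → (x ⊕ ⊝ y) ⊕ y ⊜V x) refl x y) (b-subˡ x y y) ⟩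
    q x - q y - (b x y - b y y)                      ≡⟨ cong (λ t → q x - q y - (b x y - t)) (b-self y) ⟩
    q x - q y - (b x y - two * q y)                  ≡⟨ solve 3 (λ X Y B → X ⊕ ⊝ Y ⊕ ⊝ (B ⊕ ⊝ (Κ (ℤ.+ 2) ⊗ Y)) ⊜ X ⊕ Y ⊕ ⊝ B) refl (q x) (q y) (b x y) ⟩
    q x + q y - b x y                                ∎

  q-along-line : ∀ p t d → q (p +V (t · d)) ≡ q p + t * (t * q d + b p d)
  q-along-line p t d = begin
    q (p +V (t · d))                    ≡⟨ q-+ p (t · d) ⟩
    q p + q (t · d) + b p (t · d)       ≡⟨ cong₂ (λ s u → q p + s + u) (homog t d) (scaleʳ t p d) ⟩
    q p + t * t * q d + t * b p d       ≡⟨ solve 4 (λ Q t D B → Q ⊕ t ⊗ t ⊗ D ⊕ t ⊗ B ⊜ Q ⊕ t ⊗ (t ⊗ D ⊕ B)) refl (q p) t (q d) (b p d) ⟩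
    q p + t * (t * q d + b p d)         ∎

  dual : V → V
  dual x = b x e₁ , b x e₂

  b-coordinates : ∀ x y → b x y ≡ ⟨ y , dual x ⟩
  b-coordinates x (y₁ , y₂) = begin
    b x (y₁ , y₂)                      ≡⟨ cong (b x) (cong₂ _,_ (solve 2 (λ y₁ y₂ → y₁ ⊜ y₁ ⊗ Κ 1ℤ ⊕ y₂ ⊗ Κ 0ℤ) refl y₁ y₂)
                                                                (solve 2 (λ y₁ y₂ → y₂ ⊜ y₁ ⊗ Κ 0ℤ ⊕ y₂ ⊗ Κ 1ℤ) refl y₁ y₂)) ⟩
    b x ((y₁ · e₁) +V (y₂ · e₂))       ≡⟨ addʳ x _ _ ⟩
    b x (y₁ · e₁) + b x (y₂ · e₂)      ≡⟨ cong₂ _+_ (scaleʳ y₁ x e₁) (scaleʳ y₂ x e₂) ⟩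
    y₁ * b x e₁ + y₂ * b x e₂          ∎

  on-conic-along-line : ∀ {a p d t} → q p ≡ a → q (p +V (t · d)) ≡ a → t * (t * q d + b p d) ≡ 0#
  on-conic-along-line {a} {p} {d} {t} qp≡a qp+td≡a =
    x≡x+y⇒y≡0 (trans (sym qp+td≡a) (trans (q-along-line p t d) (cong (_+ t * (t * q d + b p d)) qp≡a)))

  module _ (nd : NonDegenerate q) where

    dual-nonzero : ∀ {x} → x ≢ 0V → dual x ≢ 0V
    dual-nonzero {x} x≢0 dual≡0 = x≢0 (nd x (λ y → begin
      b x y                 ≡⟨ b-coordinates x y ⟩
      ⟨ y , dual x ⟩        ≡⟨ cong ⟨ y ,_⟩ dual≡0 ⟩
      ⟨ y , 0V ⟩            ≡⟨ solve 2 (λ y₁ y₂ → y₁ ⊗ Κ 0ℤ ⊕ y₂ ⊗ Κ 0ℤ ⊜ Κ 0ℤ) refl _ _ ⟩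
      0#                    ∎))

    -- Both p and d lie in the kernel of b d, a line, so p is a multiple of d.
    orthogonal-to-isotropic : ∀ {d p} → d ≢ 0V → q d ≡ 0# → b p d ≡ 0# → q p ≡ 0#
    orthogonal-to-isotropic {d} {p} d≢0 qd≡0 bpd≡0
      with kernel-is-line (dual-nonzero d≢0) d≢0 (trans (sym (b-coordinates d d)) (b-isotropic-self qd≡0))
                                                 (trans (sym (b-coordinates d p)) (trans (b-sym d p) bpd≡0))
    ... | μ , refl = trans (homog μ d) (trans (cong (μ * μ *_) qd≡0) (zeroʳ _))

    ¬three-on-conic∩line : ∀ {a c w p₁ p₂ p₃} → a ≢ 0# → w ≢ 0V → p₁ ≢ p₂ → p₁ ≢ p₃ → p₂ ≢ p₃ →
      q p₁ ≡ a → q p₂ ≡ a → q p₃ ≡ a → b w p₁ ≡ c → b w p₂ ≡ c → b w p₃ ≡ c → ⊥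
    ¬three-on-conic∩line {a} {c} {w} {p₁} {p₂} {p₃} a≢0 w≢0 p₁≢p₂ p₁≢p₃ p₂≢p₃ q₁ q₂ q₃ b₁ b₂ b₃ = a≢0 (begin
      a      ≡⟨ q₁ ⟨
      q p₁   ≡⟨ orthogonal-to-isotropic d≢0 (proj₁ κ≡0×β≡0) (proj₂ κ≡0×β≡0) ⟩
      0#     ∎)
      where
      d : V
      d = p₂ -V p₁
      d≢0 : d ≢ 0V
      d≢0 d≡0 = p₁≢p₂ (sym (x-y≡0V⇒x≡y d≡0))
      in-kernel : ∀ {p} → b w p ≡ c → ⟨ p -V p₁ , dual w ⟩ ≡ 0#
      in-kernel {p} bwp≡c = begin
        ⟨ p -V p₁ , dual w ⟩   ≡⟨ b-coordinates w (p -V p₁) ⟨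
        b w (p -V p₁)          ≡⟨ b-subʳ w p p₁ ⟩
        b w p - b w p₁         ≡⟨ cong₂ _-_ bwp≡c b₁ ⟩
        c - c                  ≡⟨ -‿inverseʳ c ⟩
        0#                     ∎
      p₃-on-line : ∃ λ μ → p₃ -V p₁ ≡ μ · d
      p₃-on-line = kernel-is-line (dual-nonzero w≢0) d≢0 (in-kernel b₂) (in-kernel b₃)
      μ : Carrier
      μ = proj₁ p₃-on-line
      -- Each further point p₁ + t d of the conic gives a root t of t (t q d + b p₁ d) = 0.
      root : ∀ {p t} → p ≢ p₁ → q p ≡ a → p -V p₁ ≡ t · d → t * q d + b p₁ d ≡ 0#
      root {p} {t} p≢p₁ qp≡a p-p₁≡td = x*y≡0⇒y≡0 t≢0 (on-conic-along-line q₁ (subst (λ x → q x ≡ a) p≡p₁+td qp≡a))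
        where
        p≡p₁+td : p ≡ p₁ +V (t · d)
        p≡p₁+td = trans (solveV 2 (λ p p₁ → p ⊜V p₁ ⊕ (p ⊕ ⊝ p₁)) refl p p₁) (cong (p₁ +V_) p-p₁≡td)
        t≢0 : t ≢ 0#
        t≢0 t≡0 = p≢p₁ (x-y≡0V⇒x≡y (trans p-p₁≡td (trans (cong (_· d) t≡0) (solveV 1 (λ d → Κ 0ℤ ⊗ d ⊜V Κ 0ℤ) refl d))))
      p₂-p₁≡1d : p₂ -V p₁ ≡ 1# · d
      p₂-p₁≡1d = solveV 1 (λ d → d ⊜V Κ 1ℤ ⊗ d) refl d
      1≢μ : 1# ≢ μ
      1≢μ 1≡μ = p₂≢p₃ (-V-cancelʳ (trans p₂-p₁≡1d (trans (cong (_· d) 1≡μ) (sym (proj₂ p₃-on-line)))))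
      κ≡0×β≡0 : q d ≡ 0# × b p₁ d ≡ 0#
      κ≡0×β≡0 = linear-two-roots 1≢μ (root (≢-sym p₁≢p₂) q₂ p₂-p₁≡1d) (root (≢-sym p₁≢p₃) q₃ (proj₂ p₃-on-line))

module FourCycles (F : FiniteField) (q : FiniteField.V F → FiniteField.Carrier F) (a : FiniteField.Carrier F)
                  (q-sub-comm : ∀ x y → q (FiniteField._-V_ F x y) ≡ q (FiniteField._-V_ F y x)) where

  open import Data.Nat as ℕ using (ℕ; _*_; _∸_)
  open import Data.Nat.Properties as ℕ using ()
  open import Data.Product using (_×_; _,_; proj₁)
  open import Function using (_⇔_; mk⇔)
  open import Relation.Nullary using (Dec; yes; no)
  open import Relation.Nullary.Decidable using (_×-dec_)
  open import Relation.Binary.PropositionalEquality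
  open ≡-Reasoning
  open FiniteSums
  open DihedralOrder using (Distinct4; canonical?; one-canonical-in-orbit)
  open Field F hiding (_*_)
  open Enumerations F

  adj? : ∀ x y → Dec (Adj q a x y)
  adj? x y = (x ≢? y) ×-dec (q (x -V y) ≟ a)

  adj-sym : ∀ {x y} → Adj q a x y → Adj q a y x
  adj-sym (x≢y , qx-y≡a) = ≢-sym x≢y , trans (q-sub-comm _ _) qx-y≡a

  Cycle : V → V → V → V → Set
  Cycle v₀ v₁ v₂ v₃ = Distinct4 v₀ v₁ v₂ v₃ × (Adj q a v₀ v₁ × Adj q a v₁ v₂ × Adj q a v₂ v₃ × Adj q a v₃ v₀)

  cycle? : ∀ v₀ v₁ v₂ v₃ → Dec (Cycle v₀ v₁ v₂ v₃)
  cycle? v₀ v₁ v₂ v₃ =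
    (v₀ ≢? v₁ ×-dec v₀ ≢? v₂ ×-dec v₀ ≢? v₃ ×-dec v₁ ≢? v₂ ×-dec v₁ ≢? v₃ ×-dec v₂ ≢? v₃)
    ×-dec (adj? v₀ v₁ ×-dec adj? v₁ v₂ ×-dec adj? v₂ v₃ ×-dec adj? v₃ v₀)

  cycle : V → V → V → V → ℕ
  cycle v₀ v₁ v₂ v₃ = 𝟙 (cycle? v₀ v₁ v₂ v₃)

  orderedCycles : ℕ
  orderedCycles = ∑⁴ allV cycle

  cycle-rotate : ∀ {v₀ v₁ v₂ v₃} → Cycle v₀ v₁ v₂ v₃ → Cycle v₁ v₂ v₃ v₀
  cycle-rotate ((≢₀₁ , ≢₀₂ , ≢₀₃ , ≢₁₂ , ≢₁₃ , ≢₂₃) , (~₀₁ , ~₁₂ , ~₂₃ , ~₃₀)) =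
    (≢₁₂ , ≢₁₃ , ≢-sym ≢₀₁ , ≢₂₃ , ≢-sym ≢₀₂ , ≢-sym ≢₀₃) , (~₁₂ , ~₂₃ , ~₃₀ , ~₀₁)

  cycle-reflect : ∀ {v₀ v₁ v₂ v₃} → Cycle v₀ v₁ v₂ v₃ → Cycle v₀ v₃ v₂ v₁
  cycle-reflect ((≢₀₁ , ≢₀₂ , ≢₀₃ , ≢₁₂ , ≢₁₃ , ≢₂₃) , (~₀₁ , ~₁₂ , ~₂₃ , ~₃₀)) =
    (≢₀₃ , ≢₀₂ , ≢₀₁ , ≢-sym ≢₂₃ , ≢-sym ≢₁₃ , ≢-sym ≢₁₂) , (adj-sym ~₃₀ , adj-sym ~₂₃ , adj-sym ~₁₂ , adj-sym ~₀₁)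

  cycle-rotate-invariant : ∀ v₀ v₁ v₂ v₃ → cycle v₁ v₂ v₃ v₀ ≡ cycle v₀ v₁ v₂ v₃
  cycle-rotate-invariant v₀ v₁ v₂ v₃ =
    𝟙-cong (cycle? v₁ v₂ v₃ v₀) (cycle? v₀ v₁ v₂ v₃) (mk⇔ (λ c → cycle-rotate (cycle-rotate (cycle-rotate c))) cycle-rotate)

  cycle-reflect-invariant : ∀ v₀ v₁ v₂ v₃ → cycle v₀ v₃ v₂ v₁ ≡ cycle v₀ v₁ v₂ v₃
  cycle-reflect-invariant v₀ v₁ v₂ v₃ = 𝟙-cong (cycle? v₀ v₃ v₂ v₁) (cycle? v₀ v₁ v₂ v₃) (mk⇔ cycle-reflect cycle-reflect)

  canonical : V → V → V → V → ℕ
  canonical v₀ v₁ v₂ v₃ = 𝟙 (canonical? (idx v₀) (idx v₁) (idx v₂) (idx v₃))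

  canonicalCycle : V → V → V → V → ℕ
  canonicalCycle v₀ v₁ v₂ v₃ = cycle v₀ v₁ v₂ v₃ * canonical v₀ v₁ v₂ v₃

  numCycles4≡∑canonicalCycle : numCycles4 q a ≡ ∑⁴ allV canonicalCycle
  numCycles4≡∑canonicalCycle = begin
    numCycles4 q a                                                   ≡⟨ length-filter _ quadruples ⟩
    ∑ quadruples _                                                   ≡⟨ ∑-quadruples _ ⟩
    ∑⁴ allV (λ v₀ v₁ v₂ v₃ → 𝟙 (canonicalCycle4? q a v₀ v₁ v₂ v₃))  ≡⟨ ∑⁴-cong allV reassociate ⟩
    ∑⁴ allV canonicalCycle                                           ∎
    where
    reassociate : ∀ v₀ v₁ v₂ v₃ → 𝟙 (canonicalCycle4? q a v₀ v₁ v₂ v₃) ≡ canonicalCycle v₀ v₁ v₂ v₃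
    reassociate v₀ v₁ v₂ v₃ = trans
      (𝟙-cong (canonicalCycle4? q a v₀ v₁ v₂ v₃) (cycle? v₀ v₁ v₂ v₃ ×-dec canonical? (idx v₀) (idx v₁) (idx v₂) (idx v₃))
        (mk⇔ (λ (dist , adj , ord) → (dist , adj) , ord) (λ ((dist , adj) , ord) → dist , adj , ord)))
      (𝟙-× (cycle? v₀ v₁ v₂ v₃) _)

  cycle≡dihedralSum : ∀ v₀ v₁ v₂ v₃ → cycle v₀ v₁ v₂ v₃ ≡ dihedralSum canonicalCycle v₀ v₁ v₂ v₃
  cycle≡dihedralSum v₀ v₁ v₂ v₃ = sym (trans
    (dihedralSum-invariant-* cycle cycle-rotate-invariant cycle-reflect-invariant canonical v₀ v₁ v₂ v₃)
    (one-canonical-if-cycle (cycle? v₀ v₁ v₂ v₃)))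
    where
    one-canonical-if-cycle : (c : Dec (Cycle v₀ v₁ v₂ v₃)) → 𝟙 c * dihedralSum canonical v₀ v₁ v₂ v₃ ≡ 𝟙 c
    one-canonical-if-cycle (no _) = refl
    one-canonical-if-cycle (yes ((≢₀₁ , ≢₀₂ , ≢₀₃ , ≢₁₂ , ≢₁₃ , ≢₂₃) , _)) =
      trans (ℕ.+-identityʳ _) (one-canonical-in-orbit (idx≢ ≢₀₁ , idx≢ ≢₀₂ , idx≢ ≢₀₃ , idx≢ ≢₁₂ , idx≢ ≢₁₃ , idx≢ ≢₂₃))
      where
      idx≢ : ∀ {u v} → u ≢ v → idx u ≢ idx v
      idx≢ {u} {v} u≢v e = u≢v (idx-injective u v e)

  orderedCycles≡8*numCycles4 : orderedCycles ≡ 8 * numCycles4 q a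
  orderedCycles≡8*numCycles4 = begin
    ∑⁴ allV cycle                         ≡⟨ ∑⁴-cong allV cycle≡dihedralSum ⟩
    ∑⁴ allV (dihedralSum canonicalCycle)  ≡⟨ ∑⁴-dihedralSum allV canonicalCycle ⟩
    8 * ∑⁴ allV canonicalCycle            ≡⟨ cong (8 *_) numCycles4≡∑canonicalCycle ⟨
    8 * numCycles4 q a                    ∎

  CommonNeighbour : V → V → V → Set
  CommonNeighbour x z y = Adj q a x y × Adj q a y z

  commonNeighbour? : ∀ x z y → Dec (CommonNeighbour x z y)
  commonNeighbour? x z y = adj? x y ×-dec adj? y z

  commonNeighbours : V → V → ℕ
  commonNeighbours x z = ∑[ y ∈ allV ] 𝟙 (commonNeighbour? x z y)

  otherCommonNeighbours : V → V → V → ℕ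
  otherCommonNeighbours x z y = ∑[ y′ ∈ allV ] (𝟙 (y′ ≢? y) * 𝟙 (commonNeighbour? x z y′))

  cyclesThrough : V → V → ℕ
  cyclesThrough x z = ∑[ y ∈ allV ] (𝟙 (commonNeighbour? x z y) * otherCommonNeighbours x z y)

  cycle⇔diagonal : ∀ {v₀ v₁ v₂ v₃} →
    Cycle v₀ v₁ v₂ v₃ ⇔ (v₀ ≢ v₂ × CommonNeighbour v₀ v₂ v₁ × v₃ ≢ v₁ × CommonNeighbour v₀ v₂ v₃)
  cycle⇔diagonal = mk⇔
    (λ { ((_ , ≢₀₂ , _ , _ , ≢₁₃ , _) , (~₀₁ , ~₁₂ , ~₂₃ , ~₃₀)) → ≢₀₂ , (~₀₁ , ~₁₂) , ≢-sym ≢₁₃ , (adj-sym ~₃₀ , adj-sym ~₂₃) })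
    (λ { (≢₀₂ , (~₀₁ , ~₁₂) , ≢₃₁ , (~₀₃ , ~₃₂)) →
         (proj₁ ~₀₁ , ≢₀₂ , proj₁ ~₀₃ , proj₁ ~₁₂ , ≢-sym ≢₃₁ , ≢-sym (proj₁ ~₃₂)) , (~₀₁ , ~₁₂ , adj-sym ~₃₂ , adj-sym ~₀₃) })

  orderedCycles≡∑cyclesThrough : orderedCycles ≡ ∑[ v₀ ∈ allV ] ∑[ v₂ ∈ allV ] (𝟙 (v₀ ≢? v₂) * cyclesThrough v₀ v₂)
  orderedCycles≡∑cyclesThrough = ∑-cong allV λ v₀ → begin
    ∑[ v₁ ∈ allV ] ∑[ v₂ ∈ allV ] ∑[ v₃ ∈ allV ] cycle v₀ v₁ v₂ v₃
      ≡⟨ ∑-cong allV (λ v₁ → ∑-cong allV (λ v₂ → sum-over-v₃ v₀ v₁ v₂)) ⟩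
    ∑[ v₁ ∈ allV ] ∑[ v₂ ∈ allV ] (𝟙 (v₀ ≢? v₂) * (𝟙 (commonNeighbour? v₀ v₂ v₁) * otherCommonNeighbours v₀ v₂ v₁))
      ≡⟨ ∑-swap allV allV _ ⟩
    ∑[ v₂ ∈ allV ] ∑[ v₁ ∈ allV ] (𝟙 (v₀ ≢? v₂) * (𝟙 (commonNeighbour? v₀ v₂ v₁) * otherCommonNeighbours v₀ v₂ v₁))
      ≡⟨ ∑-cong allV (λ v₂ → ∑-*ˡ allV (𝟙 (v₀ ≢? v₂)) _) ⟩
    ∑[ v₂ ∈ allV ] (𝟙 (v₀ ≢? v₂) * cyclesThrough v₀ v₂)
      ∎
    where
    sum-over-v₃ : ∀ v₀ v₁ v₂ → ∑[ v₃ ∈ allV ] cycle v₀ v₁ v₂ v₃ ≡ 𝟙 (v₀ ≢? v₂) * (𝟙 (commonNeighbour? v₀ v₂ v₁) * otherCommonNeighbours v₀ v₂ v₁)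
    sum-over-v₃ v₀ v₁ v₂ = begin
      ∑[ v₃ ∈ allV ] cycle v₀ v₁ v₂ v₃
        ≡⟨ ∑-cong allV (λ v₃ → 𝟙-cong (cycle? v₀ v₁ v₂ v₃) (v₀ ≢? v₂ ×-dec N₁ ×-dec v₃ ≢? v₁ ×-dec commonNeighbour? v₀ v₂ v₃) cycle⇔diagonal) ⟩
      ∑[ v₃ ∈ allV ] 𝟙 (v₀ ≢? v₂ ×-dec N₁ ×-dec v₃ ≢? v₁ ×-dec commonNeighbour? v₀ v₂ v₃)
        ≡⟨ ∑-cong allV (λ v₃ → trans (𝟙-× (v₀ ≢? v₂) _) (cong (𝟙 (v₀ ≢? v₂) *_) (trans (𝟙-× N₁ _) (cong (𝟙 N₁ *_) (𝟙-× (v₃ ≢? v₁) _))))) ⟩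
      ∑[ v₃ ∈ allV ] (𝟙 (v₀ ≢? v₂) * (𝟙 N₁ * (𝟙 (v₃ ≢? v₁) * 𝟙 (commonNeighbour? v₀ v₂ v₃))))
        ≡⟨ ∑-*ˡ allV (𝟙 (v₀ ≢? v₂)) _ ⟩
      𝟙 (v₀ ≢? v₂) * ∑[ v₃ ∈ allV ] (𝟙 N₁ * (𝟙 (v₃ ≢? v₁) * 𝟙 (commonNeighbour? v₀ v₂ v₃)))
        ≡⟨ cong (𝟙 (v₀ ≢? v₂) *_) (∑-*ˡ allV (𝟙 N₁) _) ⟩
      𝟙 (v₀ ≢? v₂) * (𝟙 N₁ * otherCommonNeighbours v₀ v₂ v₁)
        ∎
      where
      N₁ : Dec (CommonNeighbour v₀ v₂ v₁)
      N₁ = commonNeighbour? v₀ v₂ v₁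

  otherCommonNeighbours≡commonNeighbours∸1 : ∀ {x z y} → CommonNeighbour x z y → otherCommonNeighbours x z y ≡ commonNeighbours x z ∸ 1
  otherCommonNeighbours≡commonNeighbours∸1 {x} {z} {y} y∈N = sym (begin
    commonNeighbours x z ∸ 1                                         ≡⟨ cong (_∸ 1) (∑V.∑-split y (λ y′ → 𝟙 (commonNeighbour? x z y′))) ⟩
    (𝟙 (commonNeighbour? x z y) ℕ.+ otherCommonNeighbours x z y) ∸ 1  ≡⟨ cong (λ n → (n ℕ.+ otherCommonNeighbours x z y) ∸ 1) (𝟙-yes (commonNeighbour? x z y) y∈N) ⟩
    otherCommonNeighbours x z y                                      ∎)

  orderedCycles≡∑N[N-1] : orderedCycles ≡
    ∑[ v₀ ∈ allV ] ∑[ v₂ ∈ allV ] (𝟙 (v₀ ≢? v₂) * (commonNeighbours v₀ v₂ * (commonNeighbours v₀ v₂ ∸ 1)))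
  orderedCycles≡∑N[N-1] = trans orderedCycles≡∑cyclesThrough
    (∑-cong allV λ v₀ → ∑-cong allV λ v₂ → cong (𝟙 (v₀ ≢? v₂) *_) (trans (∑-cong allV (each v₀ v₂)) (∑-*ʳ allV _ _)))
    where
    each : ∀ v₀ v₂ v₁ → 𝟙 (commonNeighbour? v₀ v₂ v₁) * otherCommonNeighbours v₀ v₂ v₁
                      ≡ 𝟙 (commonNeighbour? v₀ v₂ v₁) * (commonNeighbours v₀ v₂ ∸ 1)
    each v₀ v₂ v₁ with commonNeighbour? v₀ v₂ v₁
    ... | yes v₁∈N = cong (1 *_) (otherCommonNeighbours≡commonNeighbours∸1 v₁∈N)
    ... | no _ = refl

module NonzeroLevel (F : FiniteField) (q : FiniteField.V F → FiniteField.Carrier F)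
                    (isQ : FiniteField.IsQuadraticForm F q) (nd : FiniteField.NonDegenerate F q)
                    (a : FiniteField.Carrier F) (a≢0 : a ≢ FiniteField.0# F) where

  open import Data.Empty using (⊥; ⊥-elim)
  open import Data.Integer as ℤ using (0ℤ)
  open import Data.Nat as ℕ using (ℕ; _∸_)
  open import Data.Nat.Properties as ℕ using ()
  open import Data.Product using (_×_; _,_)
  open import Function using (_⇔_; mk⇔)
  open import Relation.Nullary using (¬_; Dec; yes; no)
  open import Relation.Nullary.Decidable using (_×-dec_)
  open import Relation.Binary.PropositionalEquality
  open ≡-Reasoning
  open FiniteSums
  open Field F
  open Enumerations F
  open Plane F
  open QuadraticForm F q isQ
  open FourCycles F q a q-sub-comm

  adjacent : ∀ {x y} → q (x -V y) ≡ a → Adj q a x y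
  adjacent {x} {y} qx-y≡a = x≢y , qx-y≡a
    where
    x≢y : x ≢ y
    x≢y refl = a≢0 (trans (sym qx-y≡a) (trans (cong q (solveV 1 (λ x → x ⊕ ⊝ x ⊜V Κ 0ℤ) refl x)) q-0V))

  OnConic∩Line : V → V → Set
  OnConic∩Line w p = q p ≡ a × b w p ≡ q w

  common-neighbour-on-conic∩line : ∀ {v₀ v₂ x} → CommonNeighbour v₀ v₂ x → OnConic∩Line (v₂ -V v₀) (x -V v₀)
  common-neighbour-on-conic∩line {v₀} {v₂} {x} ((_ , qv₀-x≡a) , (_ , qx-v₂≡a)) = qp≡a , bwp≡qw
    where
    w p : V
    w = v₂ -V v₀
    p = x -V v₀
    qp≡a : q p ≡ a
    qp≡a = trans (q-sub-comm x v₀) qv₀-x≡a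
    a≡a+[qw-bpw] : a ≡ a + (q w - b p w)
    a≡a+[qw-bpw] = begin
      a                     ≡⟨ qx-v₂≡a ⟨
      q (x -V v₂)           ≡⟨ cong q (solveV 3 (λ x v₀ v₂ → x ⊕ ⊝ v₂ ⊜V (x ⊕ ⊝ v₀) ⊕ ⊝ (v₂ ⊕ ⊝ v₀)) refl x v₀ v₂) ⟩
      q (p -V w)            ≡⟨ q-sub p w ⟩
      q p + q w - b p w     ≡⟨ cong (λ t → t + q w - b p w) qp≡a ⟩
      a + q w - b p w       ≡⟨ +-assoc a (q w) (- b p w) ⟩
      a + (q w - b p w)     ∎
    bwp≡qw : b w p ≡ q w
    bwp≡qw = trans (b-sym w p) (sym (x-y≡0⇒x≡y (x≡x+y⇒y≡0 a≡a+[qw-bpw])))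

  reflect-on-conic∩line : ∀ {w p} → OnConic∩Line w p → OnConic∩Line w (w -V p)
  reflect-on-conic∩line {w} {p} (qp≡a , bwp≡qw) = q[w-p]≡a , bw[w-p]≡qw
    where
    q[w-p]≡a : q (w -V p) ≡ a
    q[w-p]≡a = begin
      q (w -V p)            ≡⟨ q-sub w p ⟩
      q w + q p - b w p     ≡⟨ cong₂ (λ s t → q w + s - t) qp≡a bwp≡qw ⟩
      q w + a - q w         ≡⟨ solve 2 (λ Q a → Q ⊕ a ⊕ ⊝ Q ⊜ a) refl (q w) a ⟩
      a                     ∎
    bw[w-p]≡qw : b w (w -V p) ≡ q w
    bw[w-p]≡qw = begin
      b w (w -V p)          ≡⟨ b-subʳ w w p ⟩
      b w w - b w p         ≡⟨ cong₂ _-_ (b-self w) bwp≡qw ⟩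
      two * q w - q w       ≡⟨ solve 1 (λ Q → Κ (ℤ.+ 2) ⊗ Q ⊕ ⊝ Q ⊜ Q) refl (q w) ⟩
      q w                   ∎

  opposite : V → V → V → V
  opposite v₀ v₂ v₁ = (v₀ +V v₂) -V v₁

  opposite-common-neighbour : ∀ {v₀ v₂ v₁} → CommonNeighbour v₀ v₂ v₁ → CommonNeighbour v₀ v₂ (opposite v₀ v₂ v₁)
  opposite-common-neighbour {v₀} {v₂} {v₁} ((_ , qv₀-v₁≡a) , (_ , qv₁-v₂≡a)) =
      adjacent (trans (cong q (solveV 3 (λ v₀ v₁ v₂ → v₀ ⊕ ⊝ ((v₀ ⊕ v₂) ⊕ ⊝ v₁) ⊜V v₁ ⊕ ⊝ v₂) refl v₀ v₁ v₂)) qv₁-v₂≡a)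
    , adjacent (trans (cong q (solveV 3 (λ v₀ v₁ v₂ → ((v₀ ⊕ v₂) ⊕ ⊝ v₁) ⊕ ⊝ v₂ ⊜V v₀ ⊕ ⊝ v₁) refl v₀ v₁ v₂)) qv₀-v₁≡a)

  module _ {v₀ v₂ v₁ v₃ : V} (v₀≢v₂ : v₀ ≢ v₂) (N₁ : CommonNeighbour v₀ v₂ v₁) (N₃ : CommonNeighbour v₀ v₂ v₃)
           (v₃≢v₁ : v₃ ≢ v₁) where

    private
      w p₁ p₃ : V
      w = v₂ -V v₀
      p₁ = v₁ -V v₀
      p₃ = v₃ -V v₀
      σ : V → V
      σ p = w -V p
      w≢0 : w ≢ 0V
      w≢0 w≡0 = v₀≢v₂ (sym (x-y≡0V⇒x≡y w≡0))
      p₁≢p₃ : p₁ ≢ p₃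
      p₁≢p₃ p₁≡p₃ = v₃≢v₁ (sym (-V-cancelʳ p₁≡p₃))
      on₁ : OnConic∩Line w p₁
      on₁ = common-neighbour-on-conic∩line N₁
      on₃ : OnConic∩Line w p₃
      on₃ = common-neighbour-on-conic∩line N₃
      at-most-two : ∀ {x y z} → x ≢ y → x ≢ z → y ≢ z → OnConic∩Line w x → OnConic∩Line w y → OnConic∩Line w z → ⊥
      at-most-two x≢y x≢z y≢z (qx , bx) (qy , by) (qz , bz) = ¬three-on-conic∩line nd a≢0 w≢0 x≢y x≢z y≢z qx qy qz bx by bz

    -- Relative to v₀, the common neighbours lie on conic ∩ line, which has at most two points
    -- and is stable under σ.
    common-neighbours-opposite : v₃ ≡ opposite v₀ v₂ v₁
    common-neighbours-opposite with p₃ ≟V σ p₁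
    ... | yes p₃≡σp₁ = begin
      v₃                   ≡⟨ solveV 2 (λ v₀ v₃ → v₃ ⊜V v₀ ⊕ (v₃ ⊕ ⊝ v₀)) refl v₀ v₃ ⟩
      v₀ +V p₃             ≡⟨ cong (v₀ +V_) p₃≡σp₁ ⟩
      v₀ +V σ p₁           ≡⟨ solveV 3 (λ v₀ v₁ v₂ → v₀ ⊕ ((v₂ ⊕ ⊝ v₀) ⊕ ⊝ (v₁ ⊕ ⊝ v₀)) ⊜V (v₀ ⊕ v₂) ⊕ ⊝ v₁) refl v₀ v₁ v₂ ⟩
      opposite v₀ v₂ v₁    ∎
    ... | no p₃≢σp₁ with p₁ ≟V σ p₁
    ...   | no p₁≢σp₁ = ⊥-elim (at-most-two p₁≢p₃ p₁≢σp₁ p₃≢σp₁ on₁ on₃ (reflect-on-conic∩line on₁))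
    ...   | yes p₁≡σp₁ = ⊥-elim (at-most-two p₁≢p₃ p₁≢σp₃ p₃≢σp₃ on₁ on₃ (reflect-on-conic∩line on₃))
      where
      p₁≢σp₃ : p₁ ≢ σ p₃
      p₁≢σp₃ p₁≡σp₃ = p₃≢σp₁ (trans (sym (z-[z-x]≡x w p₃)) (cong σ (sym p₁≡σp₃)))
      p₃≢σp₃ : p₃ ≢ σ p₃
      p₃≢σp₃ p₃≡σp₃ = p₁≢p₃ (reflection-fixes-at-most-one w≢0 p₁≡σp₁ p₃≡σp₃)

  otherCommonNeighbours-nonzero-level : ∀ {v₀ v₂ v₁} → v₀ ≢ v₂ → CommonNeighbour v₀ v₂ v₁ →
    otherCommonNeighbours v₀ v₂ v₁ ≡ 𝟙 (opposite v₀ v₂ v₁ ≢? v₁)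
  otherCommonNeighbours-nonzero-level {v₀} {v₂} {v₁} v₀≢v₂ N₁ = begin
    otherCommonNeighbours v₀ v₂ v₁
      ≡⟨ ∑V.∑-supported-at v₁′ (λ v₃ → 𝟙 (v₃ ≢? v₁) ℕ.* 𝟙 (commonNeighbour? v₀ v₂ v₃)) only-opposite ⟩
    𝟙 (v₁′ ≢? v₁) ℕ.* 𝟙 (commonNeighbour? v₀ v₂ v₁′)
      ≡⟨ cong (𝟙 (v₁′ ≢? v₁) ℕ.*_) (𝟙-yes (commonNeighbour? v₀ v₂ v₁′) (opposite-common-neighbour N₁)) ⟩
    𝟙 (v₁′ ≢? v₁) ℕ.* 1
      ≡⟨ ℕ.*-identityʳ _ ⟩
    𝟙 (v₁′ ≢? v₁)
      ∎
    where
    v₁′ : V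
    v₁′ = opposite v₀ v₂ v₁
    only-opposite : ∀ v₃ → v₃ ≢ v₁′ → 𝟙 (v₃ ≢? v₁) ℕ.* 𝟙 (commonNeighbour? v₀ v₂ v₃) ≡ 0
    only-opposite v₃ v₃≢v₁′ with v₃ ≢? v₁ | commonNeighbour? v₀ v₂ v₃
    ... | no _ | _ = refl
    ... | yes _ | no _ = refl
    ... | yes v₃≢v₁ | yes N₃ = ⊥-elim (v₃≢v₁′ (common-neighbours-opposite v₀≢v₂ N₁ N₃ v₃≢v₁))

  Path : V → V → V → Set
  Path v₀ v₁ v₂ = q (v₀ -V v₁) ≡ a × q (v₁ -V v₂) ≡ a × v₀ ≢ v₂ × v₁ ≢ opposite v₀ v₂ v₁

  path? : ∀ v₀ v₁ v₂ → Dec (Path v₀ v₁ v₂)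
  path? v₀ v₁ v₂ = q (v₀ -V v₁) ≟ a ×-dec q (v₁ -V v₂) ≟ a ×-dec v₀ ≢? v₂ ×-dec v₁ ≢? opposite v₀ v₂ v₁

  cyclesThrough-nonzero-level : ∀ v₀ v₂ → 𝟙 (v₀ ≢? v₂) ℕ.* cyclesThrough v₀ v₂ ≡ ∑[ v₁ ∈ allV ] 𝟙 (path? v₀ v₁ v₂)
  cyclesThrough-nonzero-level v₀ v₂ = by-cases (v₀ ≢? v₂)
    where
    by-cases : (d : Dec (v₀ ≢ v₂)) → 𝟙 d ℕ.* cyclesThrough v₀ v₂ ≡ ∑[ v₁ ∈ allV ] 𝟙 (path? v₀ v₁ v₂)
    by-cases (no v₀≡v₂) = sym (trans (∑-cong allV (λ v₁ → 𝟙-no (path? v₀ v₁ v₂) (λ (_ , _ , v₀≢v₂ , _) → v₀≡v₂ v₀≢v₂))) (∑-0 allV))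
    by-cases (yes v₀≢v₂) = trans (ℕ.+-identityʳ _) (∑-cong allV through)
      where
      through : ∀ v₁ → 𝟙 (commonNeighbour? v₀ v₂ v₁) ℕ.* otherCommonNeighbours v₀ v₂ v₁ ≡ 𝟙 (path? v₀ v₁ v₂)
      through v₁ with commonNeighbour? v₀ v₂ v₁
      ... | no ¬N₁ = sym (𝟙-no (path? v₀ v₁ v₂) (λ (qv₀-v₁≡a , qv₁-v₂≡a , _) → ¬N₁ (adjacent qv₀-v₁≡a , adjacent qv₁-v₂≡a)))
      ... | yes N₁@((_ , qv₀-v₁≡a) , (_ , qv₁-v₂≡a)) = begin
        1 ℕ.* otherCommonNeighbours v₀ v₂ v₁   ≡⟨ ℕ.*-identityˡ _ ⟩
        otherCommonNeighbours v₀ v₂ v₁         ≡⟨ otherCommonNeighbours-nonzero-level v₀≢v₂ N₁ ⟩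
        𝟙 (opposite v₀ v₂ v₁ ≢? v₁)            ≡⟨ 𝟙-cong _ (path? v₀ v₁ v₂) (mk⇔ (λ v₁′≢v₁ → qv₀-v₁≡a , qv₁-v₂≡a , v₀≢v₂ , ≢-sym v₁′≢v₁)
                                                                            (λ (_ , _ , _ , v₁≢v₁′) → ≢-sym v₁≢v₁′)) ⟩
        𝟙 (path? v₀ v₁ v₂)                     ∎

  Steps : V → V → Set
  Steps s₁ s₂ = q s₁ ≡ a × q s₂ ≡ a × s₂ ≢ negV s₁ × s₂ ≢ s₁

  steps? : ∀ s₁ s₂ → Dec (Steps s₁ s₂)
  steps? s₁ s₂ = q s₁ ≟ a ×-dec q s₂ ≟ a ×-dec s₂ ≢? negV s₁ ×-dec s₂ ≢? s₁

  path⇔steps : ∀ v₀ s₁ s₂ → Path v₀ (v₀ -V s₁) ((v₀ -V s₁) -V s₂) ⇔ Steps s₁ s₂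
  path⇔steps v₀ s₁ s₂ = mk⇔
    (λ (q₁ , q₂ , v₀≢v₂ , v₁≢v₁′) →
         trans (cong q (sym v₀-v₁≡s₁)) q₁ , trans (cong q (sym v₁-v₂≡s₂)) q₂
       , (λ s₂≡-s₁ → v₀≢v₂ (sym (v₂≡v₀ s₂≡-s₁))) , (λ s₂≡s₁ → v₁≢v₁′ (trans (cong (v₀ -V_) (sym s₂≡s₁)) (sym opposite≡))))
    (λ (q₁ , q₂ , s₂≢-s₁ , s₂≢s₁) →
         trans (cong q v₀-v₁≡s₁) q₁ , trans (cong q v₁-v₂≡s₂) q₂
       , (λ v₀≡v₂ → s₂≢-s₁ (s₂≡-s₁ v₀≡v₂)) , (λ v₁≡v₁′ → s₂≢s₁ (sym (-V-cancelˡ (trans v₁≡v₁′ opposite≡)))))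
    where
    v₁ v₂ : V
    v₁ = v₀ -V s₁
    v₂ = v₁ -V s₂
    v₀-v₁≡s₁ : v₀ -V v₁ ≡ s₁
    v₀-v₁≡s₁ = z-[z-x]≡x v₀ s₁
    v₁-v₂≡s₂ : v₁ -V v₂ ≡ s₂
    v₁-v₂≡s₂ = z-[z-x]≡x v₁ s₂
    v₂≡v₀ : s₂ ≡ negV s₁ → v₂ ≡ v₀
    v₂≡v₀ refl = solveV 2 (λ v₀ s₁ → (v₀ ⊕ ⊝ s₁) ⊕ ⊝ (⊝ s₁) ⊜V v₀) refl v₀ s₁
    opposite≡ : opposite v₀ v₂ v₁ ≡ v₀ -V s₂
    opposite≡ = solveV 3 (λ v₀ s₁ s₂ → (v₀ ⊕ ((v₀ ⊕ ⊝ s₁) ⊕ ⊝ s₂)) ⊕ ⊝ (v₀ ⊕ ⊝ s₁) ⊜V v₀ ⊕ ⊝ s₂) refl v₀ s₁ s₂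
    s₂≡-s₁ : v₀ ≡ v₂ → s₂ ≡ negV s₁
    s₂≡-s₁ v₀≡v₂ = begin
      s₂                        ≡⟨ solveV 3 (λ v₀ s₁ s₂ → s₂ ⊜V (⊝ s₁) ⊕ (v₀ ⊕ ⊝ ((v₀ ⊕ ⊝ s₁) ⊕ ⊝ s₂))) refl v₀ s₁ s₂ ⟩
      negV s₁ +V (v₀ -V v₂)     ≡⟨ cong (λ x → negV s₁ +V (x -V v₂)) v₀≡v₂ ⟩
      negV s₁ +V (v₂ -V v₂)     ≡⟨ solveV 2 (λ s₁ v₂ → (⊝ s₁) ⊕ (v₂ ⊕ ⊝ v₂) ⊜V ⊝ s₁) refl s₁ v₂ ⟩
      negV s₁                   ∎

  ∑paths≡∑steps : ∀ v₀ → ∑[ v₁ ∈ allV ] ∑[ v₂ ∈ allV ] 𝟙 (path? v₀ v₁ v₂) ≡ ∑[ s₁ ∈ allV ] ∑[ s₂ ∈ allV ] 𝟙 (steps? s₁ s₂)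
  ∑paths≡∑steps v₀ = begin
    ∑[ v₁ ∈ allV ] ∑[ v₂ ∈ allV ] 𝟙 (path? v₀ v₁ v₂)
      ≡⟨ ∑V.∑-reindex (v₀ -V_) (v₀ -V_) (z-[z-x]≡x v₀) (z-[z-x]≡x v₀) _ ⟨
    ∑[ s₁ ∈ allV ] ∑[ v₂ ∈ allV ] 𝟙 (path? v₀ (v₀ -V s₁) v₂)
      ≡⟨ ∑-cong allV (λ s₁ → ∑V.∑-reindex ((v₀ -V s₁) -V_) ((v₀ -V s₁) -V_) (z-[z-x]≡x _) (z-[z-x]≡x _) _) ⟨
    ∑[ s₁ ∈ allV ] ∑[ s₂ ∈ allV ] 𝟙 (path? v₀ (v₀ -V s₁) ((v₀ -V s₁) -V s₂))
      ≡⟨ ∑-cong allV (λ s₁ → ∑-cong allV (λ s₂ → 𝟙-cong _ (steps? s₁ s₂) (path⇔steps v₀ s₁ s₂))) ⟩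
    ∑[ s₁ ∈ allV ] ∑[ s₂ ∈ allV ] 𝟙 (steps? s₁ s₂)
      ∎

  pointsOnConic : ℕ
  pointsOnConic = ∑[ s ∈ allV ] 𝟙 (q s ≟ a)

  otherPoints : V → ℕ
  otherPoints s = ∑[ s′ ∈ allV ] (𝟙 (s′ ≢? s) ℕ.* (𝟙 (s′ ≢? negV s) ℕ.* 𝟙 (q s′ ≟ a)))

  ∑steps : (k : ℕ) → (∀ s → q s ≡ a → k ℕ.+ otherPoints s ≡ pointsOnConic) →
    ∑[ s₁ ∈ allV ] ∑[ s₂ ∈ allV ] 𝟙 (steps? s₁ s₂) ≡ pointsOnConic ℕ.* (pointsOnConic ∸ k)
  ∑steps k others = trans (∑-cong allV (λ s₁ → trans (second-steps s₁) (by-cases s₁ (q s₁ ≟ a)))) (∑-*ʳ allV _ _)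
    where
    second-steps : ∀ s₁ → ∑[ s₂ ∈ allV ] 𝟙 (steps? s₁ s₂) ≡ 𝟙 (q s₁ ≟ a) ℕ.* otherPoints s₁
    second-steps s₁ = trans (∑-cong allV reorder) (∑-*ˡ allV (𝟙 (q s₁ ≟ a)) _)
      where
      reorder : ∀ s₂ → 𝟙 (steps? s₁ s₂) ≡ 𝟙 (q s₁ ≟ a) ℕ.* (𝟙 (s₂ ≢? s₁) ℕ.* (𝟙 (s₂ ≢? negV s₁) ℕ.* 𝟙 (q s₂ ≟ a)))
      reorder s₂ = begin
        𝟙 (steps? s₁ s₂)
          ≡⟨ 𝟙-cong (steps? s₁ s₂) (q s₁ ≟ a ×-dec s₂ ≢? s₁ ×-dec s₂ ≢? negV s₁ ×-dec q s₂ ≟ a)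
               (mk⇔ (λ (q₁ , q₂ , n₁ , n₂) → q₁ , n₂ , n₁ , q₂) (λ (q₁ , n₂ , n₁ , q₂) → q₁ , q₂ , n₁ , n₂)) ⟩
        𝟙 (q s₁ ≟ a ×-dec s₂ ≢? s₁ ×-dec s₂ ≢? negV s₁ ×-dec q s₂ ≟ a)
          ≡⟨ trans (𝟙-× (q s₁ ≟ a) _) (cong (𝟙 (q s₁ ≟ a) ℕ.*_) (trans (𝟙-× (s₂ ≢? s₁) _) (cong (𝟙 (s₂ ≢? s₁) ℕ.*_) (𝟙-× (s₂ ≢? negV s₁) _)))) ⟩
        𝟙 (q s₁ ≟ a) ℕ.* (𝟙 (s₂ ≢? s₁) ℕ.* (𝟙 (s₂ ≢? negV s₁) ℕ.* 𝟙 (q s₂ ≟ a)))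
          ∎
    by-cases : ∀ s₁ (d : Dec (q s₁ ≡ a)) → 𝟙 d ℕ.* otherPoints s₁ ≡ 𝟙 d ℕ.* (pointsOnConic ∸ k)
    by-cases s₁ (no _) = refl
    by-cases s₁ (yes qs₁≡a) = cong (1 ℕ.*_) (trans (sym (ℕ.m+n∸m≡n k (otherPoints s₁))) (cong (_∸ k) (others s₁ qs₁≡a)))

  orderedCycles-nonzero-level : (k : ℕ) → (∀ s → q s ≡ a → k ℕ.+ otherPoints s ≡ pointsOnConic) →
    orderedCycles ≡ size ℕ.* (size ℕ.* (pointsOnConic ℕ.* (pointsOnConic ∸ k)))
  orderedCycles-nonzero-level k others = begin
    orderedCycles
      ≡⟨ orderedCycles≡∑cyclesThrough ⟩
    ∑[ v₀ ∈ allV ] ∑[ v₂ ∈ allV ] (𝟙 (v₀ ≢? v₂) ℕ.* cyclesThrough v₀ v₂)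
      ≡⟨ ∑-cong allV (λ v₀ → trans (∑-cong allV (cyclesThrough-nonzero-level v₀)) (∑-swap allV allV _)) ⟩
    ∑[ v₀ ∈ allV ] ∑[ v₁ ∈ allV ] ∑[ v₂ ∈ allV ] 𝟙 (path? v₀ v₁ v₂)
      ≡⟨ ∑-cong allV (λ v₀ → trans (∑paths≡∑steps v₀) (∑steps k others)) ⟩
    ∑[ v₀ ∈ allV ] (pointsOnConic ℕ.* (pointsOnConic ∸ k))
      ≡⟨ ∑V-const _ ⟩
    size ℕ.* (size ℕ.* (pointsOnConic ℕ.* (pointsOnConic ∸ k)))
      ∎

  on-conic⇒≢0V : ∀ {s} → q s ≡ a → s ≢ 0V
  on-conic⇒≢0V qs≡a refl = a≢0 (trans (sym qs≡a) q-0V)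

  otherPoints-char≢2 : ¬ Char2 → ∀ s → q s ≡ a → 2 ℕ.+ otherPoints s ≡ pointsOnConic
  otherPoints-char≢2 ¬char2 s qs≡a = sym (begin
    pointsOnConic
      ≡⟨ ∑V.∑-split (negV s) _ ⟩
    𝟙 (q (negV s) ≟ a) ℕ.+ ∑[ s′ ∈ allV ] (𝟙 (s′ ≢? negV s) ℕ.* 𝟙 (q s′ ≟ a))
      ≡⟨ cong₂ ℕ._+_ (𝟙-yes (q (negV s) ≟ a) (trans (q-negV s) qs≡a)) (∑V.∑-split s _) ⟩
    1 ℕ.+ (𝟙 (s ≢? negV s) ℕ.* 𝟙 (q s ≟ a) ℕ.+ otherPoints s)
      ≡⟨ cong (λ n → 1 ℕ.+ (n ℕ.+ otherPoints s)) (cong₂ ℕ._*_ (𝟙-yes (s ≢? negV s) s≢-s) (𝟙-yes (q s ≟ a) qs≡a)) ⟩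
    2 ℕ.+ otherPoints s
      ∎)
    where
    s≢-s : s ≢ negV s
    s≢-s s≡-s = on-conic⇒≢0V qs≡a (two·x≡0V⇒x≡0V ¬char2 (sym (fixed-by-reflection (trans s≡-s (solveV 1 (λ s → ⊝ s ⊜V Κ 0ℤ ⊕ ⊝ s) refl s)))))

  otherPoints-char2 : Char2 → ∀ s → q s ≡ a → 1 ℕ.+ otherPoints s ≡ pointsOnConic
  otherPoints-char2 char2 s qs≡a = sym (begin
    pointsOnConic
      ≡⟨ ∑V.∑-split s _ ⟩
    𝟙 (q s ≟ a) ℕ.+ ∑[ s′ ∈ allV ] (𝟙 (s′ ≢? s) ℕ.* 𝟙 (q s′ ≟ a))
      ≡⟨ cong₂ ℕ._+_ (𝟙-yes (q s ≟ a) qs≡a) (∑-cong allV (λ s′ → sym (𝟙-idem (s′ ≢? s) _))) ⟩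
    1 ℕ.+ ∑[ s′ ∈ allV ] (𝟙 (s′ ≢? s) ℕ.* (𝟙 (s′ ≢? s) ℕ.* 𝟙 (q s′ ≟ a)))
      ≡⟨ cong (λ t → 1 ℕ.+ ∑[ s′ ∈ allV ] (𝟙 (s′ ≢? s) ℕ.* (𝟙 (s′ ≢? t) ℕ.* 𝟙 (q s′ ≟ a)))) (sym (negV-char2 char2 s)) ⟩
    1 ℕ.+ otherPoints s
      ∎)

  8*numCycles4-char≢2 : ¬ Char2 → 8 ℕ.* numCycles4 q a ≡ size ℕ.* (size ℕ.* (pointsOnConic ℕ.* (pointsOnConic ∸ 2)))
  8*numCycles4-char≢2 ¬char2 = trans (sym orderedCycles≡8*numCycles4) (orderedCycles-nonzero-level 2 (otherPoints-char≢2 ¬char2))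

  8*numCycles4-char2 : Char2 → 8 ℕ.* numCycles4 q a ≡ size ℕ.* (size ℕ.* (pointsOnConic ℕ.* (pointsOnConic ∸ 1)))
  8*numCycles4-char2 char2 = trans (sym orderedCycles≡8*numCycles4) (orderedCycles-nonzero-level 1 (otherPoints-char2 char2))

-- An isotropic vector d₁ ≠ 0 of a non-degenerate plane has an isotropic partner d₂ with
-- b d₁ d₂ ≠ 0; in the basis d₁, d₂ the form becomes q (α d₁ + β d₂) = c α β.
module HyperbolicCoordinates (F : FiniteField) (q : FiniteField.V F → FiniteField.Carrier F)
                             (isQ : FiniteField.IsQuadraticForm F q) (nd : FiniteField.NonDegenerate F q)
                             (d₁ : FiniteField.V F) (d₁≢0 : d₁ ≢ FiniteField.0V F) (qd₁≡0 : q d₁ ≡ FiniteField.0# F) where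

  open import Data.Nat as ℕ using (ℕ)
  open import Function using (_⇔_; mk⇔; Equivalence)
  open import Data.Integer as ℤ using (0ℤ; 1ℤ)
  open import Data.Product using (Σ; _,_; proj₁; proj₂)
  open import Relation.Nullary using (yes; no; ¬?)
  open import Relation.Binary.PropositionalEquality hiding (_≡_; _≢_)
  open ≡-Reasoning
  open FiniteSums
  open Field F
  open Enumerations F
  open Plane F
  open QuadraticForm F q isQ
  open IsQuadraticForm isQ

  partner-candidate : Σ V λ y → b d₁ y ≢ 0#
  partner-candidate with b d₁ e₁ ≟ 0#
  ... | no b₁≢0 = e₁ , b₁≢0
  ... | yes b₁≡0 = e₂ , λ b₂≡0 → dual-nonzero nd d₁≢0 (cong₂ _,_ b₁≡0 b₂≡0)

  y : V
  y = proj₁ partner-candidate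

  c : Carrier
  c = b d₁ y

  c≢0 : c ≢ 0#
  c≢0 = proj₂ partner-candidate

  c⁻¹ : Carrier
  c⁻¹ = (c ⁻¹) {c≢0}

  private
    k : Carrier
    k = q y * c⁻¹

  d₂ : V
  d₂ = y -V (k · d₁)

  qd₂≡0 : q d₂ ≡ 0#
  qd₂≡0 = begin
    q (y -V (k · d₁))                         ≡⟨ q-sub y (k · d₁) ⟩
    q y + q (k · d₁) - b y (k · d₁)           ≡⟨ cong₂ (λ s t → q y + s - t) (homog k d₁) (scaleʳ k y d₁) ⟩
    q y + k * k * q d₁ - k * b y d₁           ≡⟨ cong₂ (λ s t → q y + k * k * s - k * t) qd₁≡0 (b-sym y d₁) ⟩
    q y + k * k * 0# - k * c                  ≡⟨ solve 3 (λ Q i c → Q ⊕ (Q ⊗ i) ⊗ (Q ⊗ i) ⊗ Κ 0ℤ ⊕ ⊝ ((Q ⊗ i) ⊗ c) ⊜ Q ⊕ ⊝ (Q ⊗ (c ⊗ i))) refl (q y) c⁻¹ c ⟩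
    q y - q y * (c * c⁻¹)                     ≡⟨ cong (λ t → q y - q y * t) (x*x⁻¹≡1 c c≢0) ⟩
    q y - q y * 1#                            ≡⟨ solve 1 (λ Q → Q ⊕ ⊝ (Q ⊗ Κ 1ℤ) ⊜ Κ 0ℤ) refl (q y) ⟩
    0#                                        ∎

  bd₁d₂≡c : b d₁ d₂ ≡ c
  bd₁d₂≡c = begin
    b d₁ (y -V (k · d₁))          ≡⟨ b-subʳ d₁ y (k · d₁) ⟩
    c - b d₁ (k · d₁)             ≡⟨ cong (λ t → c - t) (scaleʳ k d₁ d₁) ⟩
    c - k * b d₁ d₁               ≡⟨ cong (λ t → c - k * t) (b-isotropic-self qd₁≡0) ⟩
    c - k * 0#                    ≡⟨ solve 2 (λ c k → c ⊕ ⊝ (k ⊗ Κ 0ℤ) ⊜ c) refl c k ⟩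
    c                             ∎

  φ : V → V
  φ (α , β) = (α · d₁) +V (β · d₂)

  q∘φ : ∀ w → q (φ w) ≡ c * (proj₁ w * proj₂ w)
  q∘φ (α , β) = begin
    q ((α · d₁) +V (β · d₂))                               ≡⟨ q-+ (α · d₁) (β · d₂) ⟩
    q (α · d₁) + q (β · d₂) + b (α · d₁) (β · d₂)          ≡⟨ cong₂ (λ s t → s + t + b (α · d₁) (β · d₂)) (homog α d₁) (homog β d₂) ⟩
    α * α * q d₁ + β * β * q d₂ + b (α · d₁) (β · d₂)      ≡⟨ cong₂ (λ s t → α * α * s + β * β * t + b (α · d₁) (β · d₂)) qd₁≡0 qd₂≡0 ⟩
    α * α * 0# + β * β * 0# + b (α · d₁) (β · d₂)          ≡⟨ cong (α * α * 0# + β * β * 0# +_) (trans (scaleˡ α d₁ (β · d₂)) (cong (α *_) (scaleʳ β d₁ d₂))) ⟩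
    α * α * 0# + β * β * 0# + α * (β * b d₁ d₂)            ≡⟨ cong (λ t → α * α * 0# + β * β * 0# + α * (β * t)) bd₁d₂≡c ⟩
    α * α * 0# + β * β * 0# + α * (β * c)
      ≡⟨ solve 3 (λ α β c → α ⊗ α ⊗ Κ 0ℤ ⊕ β ⊗ β ⊗ Κ 0ℤ ⊕ α ⊗ (β ⊗ c) ⊜ c ⊗ (α ⊗ β)) refl α β c ⟩
    c * (α * β)                                            ∎

  b-φ-d₁ : ∀ w → b (φ w) d₁ ≡ proj₂ w * c
  b-φ-d₁ (α , β) = begin
    b ((α · d₁) +V (β · d₂)) d₁           ≡⟨ addˡ (α · d₁) (β · d₂) d₁ ⟩
    b (α · d₁) d₁ + b (β · d₂) d₁         ≡⟨ cong₂ _+_ (scaleˡ α d₁ d₁) (scaleˡ β d₂ d₁) ⟩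
    α * b d₁ d₁ + β * b d₂ d₁             ≡⟨ cong₂ (λ s t → α * s + β * t) (b-isotropic-self qd₁≡0) (trans (b-sym d₂ d₁) bd₁d₂≡c) ⟩
    α * 0# + β * c                        ≡⟨ solve 3 (λ α β c → α ⊗ Κ 0ℤ ⊕ β ⊗ c ⊜ β ⊗ c) refl α β c ⟩
    β * c                                 ∎

  b-φ-d₂ : ∀ w → b (φ w) d₂ ≡ proj₁ w * c
  b-φ-d₂ (α , β) = begin
    b ((α · d₁) +V (β · d₂)) d₂           ≡⟨ addˡ (α · d₁) (β · d₂) d₂ ⟩
    b (α · d₁) d₂ + b (β · d₂) d₂         ≡⟨ cong₂ _+_ (scaleˡ α d₁ d₂) (scaleˡ β d₂ d₂) ⟩
    α * b d₁ d₂ + β * b d₂ d₂             ≡⟨ cong₂ (λ s t → α * s + β * t) bd₁d₂≡c (b-isotropic-self qd₂≡0) ⟩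
    α * c + β * 0#                        ≡⟨ solve 3 (λ α β c → α ⊗ c ⊕ β ⊗ Κ 0ℤ ⊜ α ⊗ c) refl α β c ⟩
    α * c                                 ∎

  ψ : V → V
  ψ v = b v d₂ * c⁻¹ , b v d₁ * c⁻¹

  x*c*c⁻¹≡x : ∀ x → x * c * c⁻¹ ≡ x
  x*c*c⁻¹≡x x = begin
    x * c * c⁻¹       ≡⟨ *-assoc x c c⁻¹ ⟩
    x * (c * c⁻¹)     ≡⟨ cong (x *_) (x*x⁻¹≡1 c c≢0) ⟩
    x * 1#            ≡⟨ *-identityʳ x ⟩
    x                 ∎

  ψ∘φ : ∀ w → ψ (φ w) ≡ w
  ψ∘φ (α , β) = cong₂ _,_ (trans (cong (_* c⁻¹) (b-φ-d₂ (α , β))) (x*c*c⁻¹≡x α))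
                          (trans (cong (_* c⁻¹) (b-φ-d₁ (α , β))) (x*c*c⁻¹≡x β))

  φ∘ψ : ∀ v → φ (ψ v) ≡ v
  φ∘ψ v = sym (x-y≡0V⇒x≡y u≡0)
    where
    u : V
    u = v -V φ (ψ v)
    orthogonal : ∀ {d} → b (φ (ψ v)) d ≡ b v d * c⁻¹ * c → b u d ≡ 0#
    orthogonal {d} bφψvd≡ = begin
      b u d                      ≡⟨ b-subˡ v (φ (ψ v)) d ⟩
      b v d - b (φ (ψ v)) d      ≡⟨ cong (λ t → b v d - t) (trans bφψvd≡ (sym (y≡[y*x⁻¹]*x c≢0 (b v d)))) ⟩
      b v d - b v d              ≡⟨ -‿inverseʳ (b v d) ⟩
      0#                         ∎
    bud₁≡0 : b u d₁ ≡ 0#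
    bud₁≡0 = orthogonal (b-φ-d₁ (ψ v))
    bud₂≡0 : b u d₂ ≡ 0#
    bud₂≡0 = orthogonal (b-φ-d₂ (ψ v))
    u∈d₁⊥ : ∀ {x} → b x d₁ ≡ 0# → ⟨ x , dual d₁ ⟩ ≡ 0#
    u∈d₁⊥ {x} bxd₁≡0 = trans (sym (b-coordinates d₁ x)) (trans (b-sym d₁ x) bxd₁≡0)
    u≡0 : u ≡ 0V
    u≡0 = begin
      u          ≡⟨ u≡μd₁ ⟩
      μ · d₁     ≡⟨ cong (_· d₁) μ≡0 ⟩
      0# · d₁    ≡⟨ solveV 1 (λ d → Κ 0ℤ ⊗ d ⊜V Κ 0ℤ) refl d₁ ⟩
      0V         ∎
      where
      u-on-d₁ : Σ Carrier λ μ → u ≡ μ · d₁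
      u-on-d₁ = kernel-is-line (dual-nonzero nd d₁≢0) d₁≢0 (u∈d₁⊥ (b-isotropic-self qd₁≡0)) (u∈d₁⊥ bud₁≡0)
      μ : Carrier
      μ = proj₁ u-on-d₁
      u≡μd₁ : u ≡ μ · d₁
      u≡μd₁ = proj₂ u-on-d₁
      μ≡0 : μ ≡ 0#
      μ≡0 = x*y≡0⇒y≡0 c≢0 (begin
        c * μ          ≡⟨ *-comm c μ ⟩
        μ * c          ≡⟨ cong (μ *_) bd₁d₂≡c ⟨
        μ * b d₁ d₂    ≡⟨ scaleˡ μ d₁ d₂ ⟨
        b (μ · d₁) d₂  ≡⟨ cong (λ x → b x d₂) u≡μd₁ ⟨
        b u d₂         ≡⟨ bud₂≡0 ⟩
        0#             ∎)

  φ-sub : ∀ x z → φ x -V φ z ≡ φ (x -V z)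
  φ-sub (x₁ , x₂) (z₁ , z₂) =
    solveV 6 (λ X₁ X₂ Z₁ Z₂ D₁ D₂ → (X₁ ⊗ D₁ ⊕ X₂ ⊗ D₂) ⊕ ⊝ (Z₁ ⊗ D₁ ⊕ Z₂ ⊗ D₂) ⊜V (X₁ ⊕ ⊝ Z₁) ⊗ D₁ ⊕ (X₂ ⊕ ⊝ Z₂) ⊗ D₂)
      refl (x₁ , x₁) (x₂ , x₂) (z₁ , z₁) (z₂ , z₂) d₁ d₂

  ∑-by-coordinates : (g : V → ℕ) → ∑[ v ∈ allV ] g v ≡ ∑[ w ∈ allV ] g (φ w)
  ∑-by-coordinates g = sym (∑V.∑-reindex φ ψ ψ∘φ φ∘ψ g)

  level-count : ∀ {a} → a ≢ 0# → 1 ℕ.+ ∑[ v ∈ allV ] 𝟙 (q v ≟ a) ≡ size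
  level-count {a} a≢0 = begin
    1 ℕ.+ ∑[ v ∈ allV ] 𝟙 (q v ≟ a)                                ≡⟨ cong (1 ℕ.+_) (trans (∑-by-coordinates _) (∑V-split _)) ⟩
    1 ℕ.+ ∑[ x ∈ elems ] ∑[ y ∈ elems ] 𝟙 (q (φ (x , y)) ≟ a)      ≡⟨ cong (1 ℕ.+_) (∑-cong elems (λ x → ∑-cong elems (λ y →
                                                                        𝟙-cong (q (φ (x , y)) ≟ a) ((c * (x * y)) ≟ a) (mk⇔ (trans (sym (q∘φ (x , y)))) (trans (q∘φ (x , y))))))) ⟩
    1 ℕ.+ ∑[ x ∈ elems ] ∑[ y ∈ elems ] 𝟙 ((c * (x * y)) ≟ a)        ≡⟨ cong (1 ℕ.+_) (∑-cong elems one-solution) ⟩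
    1 ℕ.+ ∑[ x ∈ elems ] 𝟙 (¬? (x ≟ 0#))                           ≡⟨ count-≢ 0# ⟩
    size                                                            ∎
    where
    one-solution : ∀ x → ∑[ y ∈ elems ] 𝟙 ((c * (x * y)) ≟ a) ≡ 𝟙 (¬? (x ≟ 0#))
    one-solution x with x ≟ 0#
    ... | yes refl = trans (∑-cong elems (λ y → 𝟙-no ((c * (0# * y)) ≟ a) (λ e → a≢0 (trans (sym e) (trans (cong (c *_) (zeroˡ y)) (zeroʳ c))))))
                           (∑-0 elems)
    ... | no x≢0 = trans (∑F.∑-supported-at y₀ _ off-y₀) (𝟙-yes ((c * (x * y₀)) ≟ a) (Equivalence.from (cxy≡a⇔y≡y₀ {y₀}) refl))
      where
      cx≢0 : c * x ≢ 0#
      cx≢0 = x*y≢0 c≢0 x≢0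
      y₀ : Carrier
      y₀ = ((c * x) ⁻¹) {cx≢0} * a
      cxy≡a⇔y≡y₀ : ∀ {y} → c * (x * y) ≡ a ⇔ y ≡ y₀
      cxy≡a⇔y≡y₀ {y} = mk⇔ (λ e → Equivalence.to (k*x≡y⇔x≡k⁻¹*y cx≢0) (trans (*-assoc c x y) e))
                           (λ e → trans (sym (*-assoc c x y)) (Equivalence.from (k*x≡y⇔x≡k⁻¹*y cx≢0) e))
      off-y₀ : ∀ y → y ≢ y₀ → 𝟙 ((c * (x * y)) ≟ a) ≡ 0
      off-y₀ y y≢y₀ = 𝟙-no ((c * (x * y)) ≟ a) (λ e → y≢y₀ (Equivalence.to cxy≡a⇔y≡y₀ e))

module Lines (F : FiniteField) where

  open import Data.Nat as ℕ using (ℕ)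
  import Data.Nat.Properties as ℕ
  open import Algebra.Properties.CommutativeSemigroup ℕ.+-commutativeSemigroup using (interchange)
  open import Data.Product using (_,_; proj₁; proj₂)
  open import Data.Integer using (0ℤ; 1ℤ)
  open import Function using (_∘_; _⇔_; mk⇔; Equivalence)
  open import Function.Properties.Equivalence using () renaming (trans to ⇔-trans)
  open import Relation.Nullary using (Dec; yes; no; ¬?)
  open import Relation.Binary.PropositionalEquality hiding (_≡_; _≢_)
  open ≡-Reasoning
  open FiniteSums
  open Field F
  open Plane F
  open Enumerations F

  -- Lines through the origin are represented by (1 , t) and e₂.
  ∑ℙ : (V → ℕ) → ℕ
  ∑ℙ g = ∑[ t ∈ elems ] g (1# , t) ℕ.+ g e₂

  ∑ℙ-cong : ∀ {g h} → (∀ d → d ≢ 0V → g d ≡ h d) → ∑ℙ g ≡ ∑ℙ h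
  ∑ℙ-cong g≡h = cong₂ ℕ._+_ (∑-cong elems (λ t → g≡h (1# , t) (λ e → 0≢1 (sym (cong proj₁ e)))))
                             (g≡h e₂ (λ e → 0≢1 (sym (cong proj₂ e))))

  ∑ℙ-+ : ∀ g h → ∑ℙ (λ d → g d ℕ.+ h d) ≡ ∑ℙ g ℕ.+ ∑ℙ h
  ∑ℙ-+ g h = trans (cong (ℕ._+ (g e₂ ℕ.+ h e₂)) (∑-+ elems _ _))
                   (interchange (∑[ t ∈ elems ] g (1# , t)) (∑[ t ∈ elems ] h (1# , t)) (g e₂) (h e₂))

  ∑ℙ-1 : ∑ℙ (λ _ → 1) ≡ size ℕ.+ 1
  ∑ℙ-1 = cong (ℕ._+ 1) (trans (∑F-const 1) (ℕ.*-identityʳ size))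

  ∑-nonzero-by-lines : (g : V → ℕ) →
    ∑[ u ∈ allV ] (𝟙 (u ≢? 0V) ℕ.* g u) ≡ ∑ℙ (λ d → ∑[ l ∈ elems ] (𝟙 (¬? (l ≟ 0#)) ℕ.* g (l · d)))
  ∑-nonzero-by-lines g = begin
    ∑[ u ∈ allV ] (𝟙 (u ≢? 0V) ℕ.* g u)
      ≡⟨ ∑V-split _ ⟩
    ∑[ x ∈ elems ] ∑[ y ∈ elems ] (𝟙 ((x , y) ≢? 0V) ℕ.* g (x , y))
      ≡⟨ ∑F.∑-split 0# _ ⟩
    ∑[ y ∈ elems ] (𝟙 ((0# , y) ≢? 0V) ℕ.* g (0# , y)) ℕ.+ ∑[ x ∈ elems ] (𝟙 (¬? (x ≟ 0#)) ℕ.* ∑[ y ∈ elems ] (𝟙 ((x , y) ≢? 0V) ℕ.* g (x , y)))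
      ≡⟨ cong₂ ℕ._+_ (∑-cong elems vertical) (trans (∑-cong elems slanted) (∑-swap elems elems _)) ⟩
    ∑[ l ∈ elems ] (𝟙 (¬? (l ≟ 0#)) ℕ.* g (l · e₂)) ℕ.+ ∑[ t ∈ elems ] ∑[ l ∈ elems ] (𝟙 (¬? (l ≟ 0#)) ℕ.* g (l · (1# , t)))
      ≡⟨ ℕ.+-comm (∑[ l ∈ elems ] (𝟙 (¬? (l ≟ 0#)) ℕ.* g (l · e₂))) _ ⟩
    ∑ℙ (λ d → ∑[ l ∈ elems ] (𝟙 (¬? (l ≟ 0#)) ℕ.* g (l · d)))
      ∎
    where
    vertical : ∀ y → 𝟙 ((0# , y) ≢? 0V) ℕ.* g (0# , y) ≡ 𝟙 (¬? (y ≟ 0#)) ℕ.* g (y · e₂)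
    vertical y = cong₂ ℕ._*_ (𝟙-cong ((0# , y) ≢? 0V) (¬? (y ≟ 0#)) (mk⇔ (λ ne e → ne (cong (0# ,_) e)) (λ ne e → ne (cong proj₂ e))))
                             (cong g (cong₂ _,_ (sym (zeroʳ y)) (sym (*-identityʳ y))))
    slanted : ∀ x → 𝟙 (¬? (x ≟ 0#)) ℕ.* ∑[ y ∈ elems ] (𝟙 ((x , y) ≢? 0V) ℕ.* g (x , y))
                  ≡ ∑[ t ∈ elems ] (𝟙 (¬? (x ≟ 0#)) ℕ.* g (x · (1# , t)))
    slanted x = by-cases (¬? (x ≟ 0#))
      where
      by-cases : (d : Dec (x ≢ 0#)) → 𝟙 d ℕ.* ∑[ y ∈ elems ] (𝟙 ((x , y) ≢? 0V) ℕ.* g (x , y)) ≡ ∑[ t ∈ elems ] (𝟙 d ℕ.* g (x · (1# , t)))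
      by-cases (no _) = sym (∑-0 elems)
      by-cases (yes x≢0) = begin
        1 ℕ.* ∑[ y ∈ elems ] (𝟙 ((x , y) ≢? 0V) ℕ.* g (x , y))   ≡⟨ ℕ.*-identityˡ _ ⟩
        ∑[ y ∈ elems ] (𝟙 ((x , y) ≢? 0V) ℕ.* g (x , y))         ≡⟨ ∑-cong elems (λ y → cong (ℕ._* g (x , y)) (𝟙-yes ((x , y) ≢? 0V) (λ e → x≢0 (cong proj₁ e)))) ⟩
        ∑[ y ∈ elems ] (1 ℕ.* g (x , y))                          ≡⟨ ∑F.∑-reindex (x *_) ((x ⁻¹) {x≢0} *_) (x⁻¹*[x*y]≡y x x≢0) (x*[x⁻¹*y]≡y x x≢0) _ ⟨
        ∑[ t ∈ elems ] (1 ℕ.* g (x , x * t))                      ≡⟨ ∑-cong elems (λ t → cong (λ s → 1 ℕ.* g (s , x * t)) (sym (*-identityʳ x))) ⟩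
        ∑[ t ∈ elems ] (1 ℕ.* g (x · (1# , t)))                   ∎

  ∑ℙ-kernel : ∀ {ℓ} → ℓ ≢ 0V → ∑ℙ (λ d → 𝟙 (⟨ d , ℓ ⟩ ≟ 0#)) ≡ 1
  ∑ℙ-kernel {ℓ₁ , ℓ₂} ℓ≢0 with ℓ₂ ≟ 0#
  ... | yes refl = cong₂ ℕ._+_ (trans (∑-cong elems (λ t → 𝟙-no (⟨ (1# , t) , (ℓ₁ , 0#) ⟩ ≟ 0#) (ℓ₁≢0 ∘ ⟨1t,ℓ₁0⟩≡0⇒ℓ₁≡0 t)))
                                      (∑-0 elems))
                               (𝟙-yes (⟨ e₂ , (ℓ₁ , 0#) ⟩ ≟ 0#) (solve 1 (λ ℓ₁ → Κ 0ℤ ⊗ ℓ₁ ⊕ Κ 1ℤ ⊗ Κ 0ℤ ⊜ Κ 0ℤ) refl ℓ₁))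
    where
    ℓ₁≢0 : ℓ₁ ≢ 0#
    ℓ₁≢0 refl = ℓ≢0 refl
    ⟨1t,ℓ₁0⟩≡0⇒ℓ₁≡0 : ∀ t → ⟨ (1# , t) , (ℓ₁ , 0#) ⟩ ≡ 0# → ℓ₁ ≡ 0#
    ⟨1t,ℓ₁0⟩≡0⇒ℓ₁≡0 t e = trans (solve 2 (λ ℓ₁ t → ℓ₁ ⊜ Κ 1ℤ ⊗ ℓ₁ ⊕ t ⊗ Κ 0ℤ) refl ℓ₁ t) e
  ... | no ℓ₂≢0 = cong₂ ℕ._+_ (trans (∑F.∑-supported-at t₀ _ off-t₀) (𝟙-yes (⟨ (1# , t₀) , (ℓ₁ , ℓ₂) ⟩ ≟ 0#) (Equivalence.from root refl)))
                              (𝟙-no (⟨ e₂ , (ℓ₁ , ℓ₂) ⟩ ≟ 0#) (λ e → ℓ₂≢0 (trans (solve 2 (λ ℓ₁ ℓ₂ → ℓ₂ ⊜ Κ 0ℤ ⊗ ℓ₁ ⊕ Κ 1ℤ ⊗ ℓ₂) refl ℓ₁ ℓ₂) e)))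
    where
    t₀ : Carrier
    t₀ = (ℓ₂ ⁻¹) {ℓ₂≢0} * (- ℓ₁)
    root : ∀ {t} → ⟨ (1# , t) , (ℓ₁ , ℓ₂) ⟩ ≡ 0# ⇔ t ≡ t₀
    root {t} = ⇔-trans (≡0-cong (solve 3 (λ ℓ₁ ℓ₂ t → Κ 1ℤ ⊗ ℓ₁ ⊕ t ⊗ ℓ₂ ⊜ t ⊗ ℓ₂ ⊕ ℓ₁) refl ℓ₁ ℓ₂ t)) (linear-root ℓ₂≢0)
    off-t₀ : ∀ t → t ≢ t₀ → 𝟙 (⟨ (1# , t) , (ℓ₁ , ℓ₂) ⟩ ≟ 0#) ≡ 0
    off-t₀ t t≢t₀ = 𝟙-no (⟨ (1# , t) , (ℓ₁ , ℓ₂) ⟩ ≟ 0#) (t≢t₀ ∘ Equivalence.to root)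

-- Every line through a point s₀ of an anisotropic conic meets it in exactly one further
-- point, except the tangent line.
module AnisotropicLevel (F : FiniteField) (q : FiniteField.V F → FiniteField.Carrier F)
                        (isQ : FiniteField.IsQuadraticForm F q) (nd : FiniteField.NonDegenerate F q)
                        (anisotropic : ∀ d → d ≢ FiniteField.0V F → q d ≢ FiniteField.0# F)
                        {a : FiniteField.Carrier F} (a≢0 : a ≢ FiniteField.0# F)
                        {s₀ : FiniteField.V F} (qs₀≡a : q s₀ ≡ a) where

  open import Data.Integer using (0ℤ)
  open import Data.Nat as ℕ using (ℕ)
  import Data.Nat.Properties as ℕ
  open import Data.Product using (_,_)
  open import Function using (_∘_; _⇔_; mk⇔; Equivalence)
  open import Relation.Nullary using (¬?)
  open import Relation.Binary.PropositionalEquality hiding (_≡_; _≢_)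
  open ≡-Reasoning
  open FiniteSums
  open Field F
  open Plane F
  open Enumerations F
  open QuadraticForm F q isQ
  open Lines F

  secants : V → ℕ
  secants d = ∑[ l ∈ elems ] (𝟙 (¬? (l ≟ 0#)) ℕ.* 𝟙 (q (s₀ +V (l · d)) ≟ a))

  level≡1+∑ℙsecants : ∑[ s ∈ allV ] 𝟙 (q s ≟ a) ≡ 1 ℕ.+ ∑ℙ secants
  level≡1+∑ℙsecants = begin
    ∑[ s ∈ allV ] 𝟙 (q s ≟ a)
      ≡⟨ ∑V.∑-split s₀ _ ⟩
    𝟙 (q s₀ ≟ a) ℕ.+ ∑[ s ∈ allV ] (𝟙 (s ≢? s₀) ℕ.* 𝟙 (q s ≟ a))
      ≡⟨ cong₂ ℕ._+_ (𝟙-yes (q s₀ ≟ a) qs₀≡a) (sym (∑V.∑-reindex (s₀ +V_) (_-V s₀) s₀+u-s₀≡u s₀+[s-s₀]≡s _)) ⟩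
    1 ℕ.+ ∑[ u ∈ allV ] (𝟙 ((s₀ +V u) ≢? s₀) ℕ.* 𝟙 (q (s₀ +V u) ≟ a))
      ≡⟨ cong (1 ℕ.+_) (∑-cong allV (λ u → cong (ℕ._* 𝟙 (q (s₀ +V u) ≟ a))
                         (𝟙-cong ((s₀ +V u) ≢? s₀) (u ≢? 0V) (mk⇔ (λ ne → ne ∘ s₀+u≡s₀) (λ ne → ne ∘ u≡0))))) ⟩
    1 ℕ.+ ∑[ u ∈ allV ] (𝟙 (u ≢? 0V) ℕ.* 𝟙 (q (s₀ +V u) ≟ a))
      ≡⟨ cong (1 ℕ.+_) (∑-nonzero-by-lines _) ⟩
    1 ℕ.+ ∑ℙ secants
      ∎
    where
    s₀+u-s₀≡u : ∀ u → (s₀ +V u) -V s₀ ≡ u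
    s₀+u-s₀≡u u = solveV 2 (λ s u → (s ⊕ u) ⊕ ⊝ s ⊜V u) refl s₀ u
    s₀+[s-s₀]≡s : ∀ s → s₀ +V (s -V s₀) ≡ s
    s₀+[s-s₀]≡s s = solveV 2 (λ s₀ s → s₀ ⊕ (s ⊕ ⊝ s₀) ⊜V s) refl s₀ s
    s₀+u≡s₀ : ∀ {u} → u ≡ 0V → s₀ +V u ≡ s₀
    s₀+u≡s₀ refl = solveV 1 (λ s → s ⊕ Κ 0ℤ ⊜V s) refl s₀
    u≡0 : ∀ {u} → s₀ +V u ≡ s₀ → u ≡ 0V
    u≡0 {u} e = trans (sym (s₀+u-s₀≡u u)) (trans (cong (_-V s₀) e) (solveV 1 (λ s → s ⊕ ⊝ s ⊜V Κ 0ℤ) refl s₀))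

  secants-nonzero : ∀ {d} → d ≢ 0V → secants d ≡ 𝟙 (¬? (b s₀ d ≟ 0#))
  secants-nonzero {d} d≢0 = trans (∑-nonzero-solutions (λ l → q (s₀ +V (l · d)) ≟ a) l₀ on-conic⇔l≡l₀)
                                  (𝟙-cong (¬? (l₀ ≟ 0#)) (¬? (β ≟ 0#)) (mk⇔ (λ l₀≢0 → l₀≢0 ∘ l₀≡0) (λ β≢0 → β≢0 ∘ β≡0)))
    where
    κ β l₀ : Carrier
    κ = q d
    β = b s₀ d
    κ≢0 : κ ≢ 0#
    κ≢0 = anisotropic d d≢0
    l₀ = (κ ⁻¹) {κ≢0} * (- β)
    on-conic⇔l≡l₀ : ∀ {l} → l ≢ 0# → q (s₀ +V (l · d)) ≡ a ⇔ l ≡ l₀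
    on-conic⇔l≡l₀ {l} l≢0 = mk⇔
      (λ e → Equivalence.to (linear-root κ≢0) (x*y≡0⇒y≡0 l≢0 (on-conic-along-line qs₀≡a e)))
      (λ e → begin
        q (s₀ +V (l · d))          ≡⟨ q-along-line s₀ l d ⟩
        q s₀ + l * (l * κ + β)     ≡⟨ cong₂ (λ s t → s + l * t) qs₀≡a (Equivalence.from (linear-root κ≢0) e) ⟩
        a + l * 0#                 ≡⟨ solve 2 (λ a l → a ⊕ l ⊗ Κ 0ℤ ⊜ a) refl a l ⟩
        a                          ∎)
    l₀≡0 : β ≡ 0# → l₀ ≡ 0#
    l₀≡0 β≡0 = trans (cong (λ t → (κ ⁻¹) {κ≢0} * (- t)) β≡0) (solve 1 (λ i → i ⊗ ⊝ Κ 0ℤ ⊜ Κ 0ℤ) refl ((κ ⁻¹) {κ≢0}))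
    β≡0 : l₀ ≡ 0# → β ≡ 0#
    β≡0 l₀≡0 = begin
      β                  ≡⟨ solve 2 (λ κ β → β ⊜ Κ 0ℤ ⊗ κ ⊕ β) refl κ β ⟩
      0# * κ + β         ≡⟨ cong (λ t → t * κ + β) l₀≡0 ⟨
      l₀ * κ + β         ≡⟨ Equivalence.from (linear-root κ≢0) refl ⟩
      0#                 ∎

  secant-or-tangent : ∀ {d} → d ≢ 0V → secants d ℕ.+ 𝟙 (b s₀ d ≟ 0#) ≡ 1
  secant-or-tangent {d} d≢0 = begin
    secants d ℕ.+ 𝟙 (b s₀ d ≟ 0#)                 ≡⟨ cong (ℕ._+ 𝟙 (b s₀ d ≟ 0#)) (secants-nonzero d≢0) ⟩
    𝟙 (¬? (b s₀ d ≟ 0#)) ℕ.+ 𝟙 (b s₀ d ≟ 0#)      ≡⟨ ℕ.+-comm (𝟙 (¬? (b s₀ d ≟ 0#))) _ ⟩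
    𝟙 (b s₀ d ≟ 0#) ℕ.+ 𝟙 (¬? (b s₀ d ≟ 0#))      ≡⟨ 𝟙-¬ (b s₀ d ≟ 0#) ⟩
    1                                             ∎

  one-tangent : ∑ℙ (λ d → 𝟙 (b s₀ d ≟ 0#)) ≡ 1
  one-tangent = trans (∑ℙ-cong (λ d _ → 𝟙-cong (b s₀ d ≟ 0#) (⟨ d , dual s₀ ⟩ ≟ 0#) (≡0-cong (b-coordinates s₀ d))))
                      (∑ℙ-kernel (dual-nonzero nd s₀≢0))
    where
    s₀≢0 : s₀ ≢ 0V
    s₀≢0 refl = a≢0 (trans (sym qs₀≡a) q-0V)

  level-count : ∑[ s ∈ allV ] 𝟙 (q s ≟ a) ≡ size ℕ.+ 1
  level-count = begin
    ∑[ s ∈ allV ] 𝟙 (q s ≟ a)   ≡⟨ level≡1+∑ℙsecants ⟩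
    1 ℕ.+ ∑ℙ secants            ≡⟨ cong (1 ℕ.+_) ∑ℙsecants≡size ⟩
    1 ℕ.+ size                  ≡⟨ ℕ.+-comm 1 size ⟩
    size ℕ.+ 1                  ∎
    where
    ∑ℙsecants≡size : ∑ℙ secants ≡ size
    ∑ℙsecants≡size = ℕ.+-cancelʳ-≡ 1 _ _ (begin
      ∑ℙ secants ℕ.+ 1                                     ≡⟨ cong (∑ℙ secants ℕ.+_) one-tangent ⟨
      ∑ℙ secants ℕ.+ ∑ℙ (λ d → 𝟙 (b s₀ d ≟ 0#))            ≡⟨ ∑ℙ-+ secants (λ d → 𝟙 (b s₀ d ≟ 0#)) ⟨
      ∑ℙ (λ d → secants d ℕ.+ 𝟙 (b s₀ d ≟ 0#))             ≡⟨ ∑ℙ-cong (λ d → secant-or-tangent) ⟩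
      ∑ℙ (λ _ → 1)                                         ≡⟨ ∑ℙ-1 ⟩
      size ℕ.+ 1                                           ∎)

-- In hyperbolic coordinates q (x - y) = 0 says that x and y share a row or a column, so
-- G_{q,0} is the rook's graph on F × F.
module ZeroLevel (F : FiniteField) (q : FiniteField.V F → FiniteField.Carrier F)
                 (isQ : FiniteField.IsQuadraticForm F q) (nd : FiniteField.NonDegenerate F q)
                 (d₁ : FiniteField.V F) (d₁≢0 : d₁ ≢ FiniteField.0V F) (qd₁≡0 : q d₁ ≡ FiniteField.0# F) where

  open import Data.Empty using (⊥-elim)
  open import Data.Nat as ℕ using (ℕ; _∸_)
  import Data.Nat.Properties as ℕ
  open import Data.Product using (_×_; _,_; proj₁; proj₂)
  open import Data.Sum using (_⊎_; inj₁; inj₂)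
  open import Function using (_∘_; _⇔_; mk⇔; Equivalence)
  open import Function.Properties.Equivalence using () renaming (trans to ⇔-trans)
  open import Relation.Nullary using (¬?)
  open import Relation.Nullary.Decidable using (_×-dec_; _⊎-dec_)
  open import Relation.Binary.PropositionalEquality hiding (_≡_; _≢_)
  open ≡-Reasoning
  open FiniteSums
  open Field F
  open Enumerations F
  open QuadraticForm F q isQ using (q-sub-comm)
  open HyperbolicCoordinates F q isQ nd d₁ d₁≢0 qd₁≡0

  rook : V → Carrier
  rook w = q (φ w)

  rook-sub-comm : ∀ x y → rook (x -V y) ≡ rook (y -V x)
  rook-sub-comm x y = trans (cong q (sym (φ-sub x y))) (trans (q-sub-comm (φ x) (φ y)) (cong q (φ-sub y x)))

  module G = FourCycles F q 0# q-sub-comm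
  module R = FourCycles F rook 0# rook-sub-comm

  φ-injective : ∀ {x y} → φ x ≡ φ y → x ≡ y
  φ-injective {x} {y} φx≡φy = trans (sym (ψ∘φ x)) (trans (cong ψ φx≡φy) (ψ∘φ y))

  φ-adj⇔ : ∀ {x y} → Adj q 0# (φ x) (φ y) ⇔ Adj rook 0# x y
  φ-adj⇔ {x} {y} = mk⇔ (λ (φx≢φy , e) → φx≢φy ∘ cong φ , trans (cong q (sym (φ-sub x y))) e)
                       (λ (x≢y , e) → x≢y ∘ φ-injective , trans (cong q (φ-sub x y)) e)

  orderedCycles-rook : G.orderedCycles ≡ R.orderedCycles
  orderedCycles-rook = trans (sym (∑V.∑⁴-reindex φ ψ ψ∘φ φ∘ψ G.cycle)) (∑⁴-cong allV same-cycles)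
    where
    same-cycles : ∀ v₀ v₁ v₂ v₃ → G.cycle (φ v₀) (φ v₁) (φ v₂) (φ v₃) ≡ R.cycle v₀ v₁ v₂ v₃
    same-cycles v₀ v₁ v₂ v₃ = 𝟙-cong (G.cycle? (φ v₀) (φ v₁) (φ v₂) (φ v₃)) (R.cycle? v₀ v₁ v₂ v₃) (mk⇔
      (λ ((≢₀₁ , ≢₀₂ , ≢₀₃ , ≢₁₂ , ≢₁₃ , ≢₂₃) , (~₀₁ , ~₁₂ , ~₂₃ , ~₃₀)) →
          (≢₀₁ ∘ cong φ , ≢₀₂ ∘ cong φ , ≢₀₃ ∘ cong φ , ≢₁₂ ∘ cong φ , ≢₁₃ ∘ cong φ , ≢₂₃ ∘ cong φ)
        , (to ~₀₁ , to ~₁₂ , to ~₂₃ , to ~₃₀))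
      (λ ((≢₀₁ , ≢₀₂ , ≢₀₃ , ≢₁₂ , ≢₁₃ , ≢₂₃) , (~₀₁ , ~₁₂ , ~₂₃ , ~₃₀)) →
          (≢₀₁ ∘ φ-injective , ≢₀₂ ∘ φ-injective , ≢₀₃ ∘ φ-injective , ≢₁₂ ∘ φ-injective , ≢₁₃ ∘ φ-injective , ≢₂₃ ∘ φ-injective)
        , (from ~₀₁ , from ~₁₂ , from ~₂₃ , from ~₃₀)))
      where
      to : ∀ {x y} → Adj q 0# (φ x) (φ y) → Adj rook 0# x y
      to = Equivalence.to φ-adj⇔
      from : ∀ {x y} → Adj rook 0# x y → Adj q 0# (φ x) (φ y)
      from = Equivalence.from φ-adj⇔

  Aligned : V → V → Set
  Aligned u v = proj₁ u ≡ proj₁ v ⊎ proj₂ u ≡ proj₂ v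

  rook-adj⇔ : ∀ {x y} → Adj rook 0# x y ⇔ (x ≢ y × Aligned x y)
  rook-adj⇔ {x₁ , x₂} {y₁ , y₂} = mk⇔
    (λ (x≢y , e) → x≢y , same-line (x*y≡0⇒x≡0∨y≡0 (x*y≡0⇒y≡0 c≢0 (trans (sym (q∘φ ((x₁ , x₂) -V (y₁ , y₂)))) e))))
    (λ (x≢y , s) → x≢y , trans (q∘φ ((x₁ , x₂) -V (y₁ , y₂))) (trans (cong (c *_) (product≡0 s)) (zeroʳ c)))
    where
    same-line : x₁ - y₁ ≡ 0# ⊎ x₂ - y₂ ≡ 0# → x₁ ≡ y₁ ⊎ x₂ ≡ y₂
    same-line (inj₁ e) = inj₁ (x-y≡0⇒x≡y e)
    same-line (inj₂ e) = inj₂ (x-y≡0⇒x≡y e)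
    product≡0 : x₁ ≡ y₁ ⊎ x₂ ≡ y₂ → (x₁ - y₁) * (x₂ - y₂) ≡ 0#
    product≡0 (inj₁ refl) = trans (cong (_* (x₂ - y₂)) (-‿inverseʳ x₁)) (zeroˡ _)
    product≡0 (inj₂ refl) = trans (cong ((x₁ - y₁) *_) (-‿inverseʳ x₂)) (zeroʳ _)

  rook-common⇔ : ∀ {u w v} → R.CommonNeighbour u w v ⇔ ((u ≢ v × Aligned u v) × (v ≢ w × Aligned v w))
  rook-common⇔ = mk⇔ (λ (u~v , v~w) → Equivalence.to rook-adj⇔ u~v , Equivalence.to rook-adj⇔ v~w)
                     (λ (u~v , v~w) → Equivalence.from rook-adj⇔ u~v , Equivalence.from rook-adj⇔ v~w)

  aligned-in-column : ∀ {x₀ y₀ y₂ x y} → y₀ ≢ y₂ → Aligned (x₀ , y₀) (x , y) → Aligned (x , y) (x₀ , y₂) → x ≡ x₀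
  aligned-in-column _ (inj₁ x₀≡x) _ = sym x₀≡x
  aligned-in-column _ (inj₂ _) (inj₁ x≡x₀) = x≡x₀
  aligned-in-column y₀≢y₂ (inj₂ y₀≡y) (inj₂ y≡y₂) = ⊥-elim (y₀≢y₂ (trans y₀≡y y≡y₂))

  aligned-in-row : ∀ {x₀ y₀ x₂ x y} → x₀ ≢ x₂ → Aligned (x₀ , y₀) (x , y) → Aligned (x , y) (x₂ , y₀) → y ≡ y₀
  aligned-in-row _ (inj₂ y₀≡y) _ = sym y₀≡y
  aligned-in-row _ (inj₁ _) (inj₂ y≡y₀) = y≡y₀
  aligned-in-row x₀≢x₂ (inj₁ x₀≡x) (inj₁ x≡x₂) = ⊥-elim (x₀≢x₂ (trans x₀≡x x≡x₂))

  aligned-with-both : ∀ {x₀ y₀ x₂ y₂ x y} → x₀ ≢ x₂ → y₀ ≢ y₂ → Aligned (x₀ , y₀) (x , y) → Aligned (x , y) (x₂ , y₂) →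
    (x , y) ≡ (x₀ , y₂) ⊎ (x , y) ≡ (x₂ , y₀)
  aligned-with-both x₀≢x₂ _ (inj₁ x₀≡x) (inj₁ x≡x₂) = ⊥-elim (x₀≢x₂ (trans x₀≡x x≡x₂))
  aligned-with-both _ _ (inj₁ x₀≡x) (inj₂ y≡y₂) = inj₁ (cong₂ _,_ (sym x₀≡x) y≡y₂)
  aligned-with-both _ _ (inj₂ y₀≡y) (inj₁ x≡x₂) = inj₂ (cong₂ _,_ x≡x₂ (sym y₀≡y))
  aligned-with-both _ y₀≢y₂ (inj₂ y₀≡y) (inj₂ y≡y₂) = ⊥-elim (y₀≢y₂ (trans y₀≡y y≡y₂))

  module _ {x₀ y₀ : Carrier} where

    common-in-column : ∀ {y₂} → y₀ ≢ y₂ → R.commonNeighbours (x₀ , y₀) (x₀ , y₂) ≡ size ∸ 2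
    common-in-column {y₂} y₀≢y₂ = begin
      R.commonNeighbours (x₀ , y₀) (x₀ , y₂)
        ≡⟨ ∑V-split _ ⟩
      ∑[ x ∈ elems ] ∑[ y ∈ elems ] 𝟙 (R.commonNeighbour? (x₀ , y₀) (x₀ , y₂) (x , y))
        ≡⟨ ∑-cong elems (λ x → trans (∑-cong elems (λ y → on-column x y)) (∑-*ˡ elems (𝟙 (x ≟ x₀)) _)) ⟩
      ∑[ x ∈ elems ] (𝟙 (x ≟ x₀) ℕ.* ∑[ y ∈ elems ] (𝟙 (¬? (y ≟ y₀)) ℕ.* 𝟙 (¬? (y ≟ y₂))))
        ≡⟨ ∑F.∑-δ x₀ _ ⟩
      ∑[ y ∈ elems ] (𝟙 (¬? (y ≟ y₀)) ℕ.* 𝟙 (¬? (y ≟ y₂)))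
        ≡⟨ trans (sym (ℕ.m+n∸m≡n 2 _)) (cong (_∸ 2) (count-≢-≢ y₀≢y₂)) ⟩
      size ∸ 2
        ∎
      where
      on-column : ∀ x y → 𝟙 (R.commonNeighbour? (x₀ , y₀) (x₀ , y₂) (x , y)) ≡ 𝟙 (x ≟ x₀) ℕ.* (𝟙 (¬? (y ≟ y₀)) ℕ.* 𝟙 (¬? (y ≟ y₂)))
      on-column x y = trans (𝟙-cong _ (x ≟ x₀ ×-dec ¬? (y ≟ y₀) ×-dec ¬? (y ≟ y₂)) (⇔-trans rook-common⇔ (mk⇔ to from)))
                            (trans (𝟙-× (x ≟ x₀) _) (cong (𝟙 (x ≟ x₀) ℕ.*_) (𝟙-× (¬? (y ≟ y₀)) _)))
        where
        to : ((x₀ , y₀) ≢ (x , y) × Aligned (x₀ , y₀) (x , y)) × ((x , y) ≢ (x₀ , y₂) × Aligned (x , y) (x₀ , y₂)) →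
             x ≡ x₀ × y ≢ y₀ × y ≢ y₂
        to ((v₀≢v , l₀) , (v≢v₂ , l₂)) = x≡x₀ , (λ y≡y₀ → v₀≢v (cong₂ _,_ (sym x≡x₀) (sym y≡y₀))) , (λ y≡y₂ → v≢v₂ (cong₂ _,_ x≡x₀ y≡y₂))
          where
          x≡x₀ : x ≡ x₀
          x≡x₀ = aligned-in-column y₀≢y₂ l₀ l₂
        from : x ≡ x₀ × y ≢ y₀ × y ≢ y₂ →
               ((x₀ , y₀) ≢ (x , y) × Aligned (x₀ , y₀) (x , y)) × ((x , y) ≢ (x₀ , y₂) × Aligned (x , y) (x₀ , y₂))
        from (refl , y≢y₀ , y≢y₂) = ((λ e → y≢y₀ (sym (cong proj₂ e))) , inj₁ refl) , ((λ e → y≢y₂ (cong proj₂ e)) , inj₁ refl)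

    common-in-row : ∀ {x₂} → x₀ ≢ x₂ → R.commonNeighbours (x₀ , y₀) (x₂ , y₀) ≡ size ∸ 2
    common-in-row {x₂} x₀≢x₂ = begin
      R.commonNeighbours (x₀ , y₀) (x₂ , y₀)
        ≡⟨ ∑V-split _ ⟩
      ∑[ x ∈ elems ] ∑[ y ∈ elems ] 𝟙 (R.commonNeighbour? (x₀ , y₀) (x₂ , y₀) (x , y))
        ≡⟨ ∑-cong elems (λ x → trans (∑-cong elems (λ y → on-row x y)) (∑F.∑-δ y₀ _)) ⟩
      ∑[ x ∈ elems ] (𝟙 (¬? (x ≟ x₀)) ℕ.* 𝟙 (¬? (x ≟ x₂)))
        ≡⟨ trans (sym (ℕ.m+n∸m≡n 2 _)) (cong (_∸ 2) (count-≢-≢ x₀≢x₂)) ⟩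
      size ∸ 2
        ∎
      where
      on-row : ∀ x y → 𝟙 (R.commonNeighbour? (x₀ , y₀) (x₂ , y₀) (x , y)) ≡ 𝟙 (y ≟ y₀) ℕ.* (𝟙 (¬? (x ≟ x₀)) ℕ.* 𝟙 (¬? (x ≟ x₂)))
      on-row x y = trans (𝟙-cong _ (y ≟ y₀ ×-dec ¬? (x ≟ x₀) ×-dec ¬? (x ≟ x₂)) (⇔-trans rook-common⇔ (mk⇔ to from)))
                         (trans (𝟙-× (y ≟ y₀) _) (cong (𝟙 (y ≟ y₀) ℕ.*_) (𝟙-× (¬? (x ≟ x₀)) _)))
        where
        to : ((x₀ , y₀) ≢ (x , y) × Aligned (x₀ , y₀) (x , y)) × ((x , y) ≢ (x₂ , y₀) × Aligned (x , y) (x₂ , y₀)) →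
             y ≡ y₀ × x ≢ x₀ × x ≢ x₂
        to ((v₀≢v , l₀) , (v≢v₂ , l₂)) = y≡y₀ , (λ x≡x₀ → v₀≢v (cong₂ _,_ (sym x≡x₀) (sym y≡y₀))) , (λ x≡x₂ → v≢v₂ (cong₂ _,_ x≡x₂ y≡y₀))
          where
          y≡y₀ : y ≡ y₀
          y≡y₀ = aligned-in-row x₀≢x₂ l₀ l₂
        from : y ≡ y₀ × x ≢ x₀ × x ≢ x₂ →
               ((x₀ , y₀) ≢ (x , y) × Aligned (x₀ , y₀) (x , y)) × ((x , y) ≢ (x₂ , y₀) × Aligned (x , y) (x₂ , y₀))
        from (refl , x≢x₀ , x≢x₂) = ((λ e → x≢x₀ (sym (cong proj₁ e))) , inj₂ refl) , ((λ e → x≢x₂ (cong proj₁ e)) , inj₂ refl)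

    common-in-general-position : ∀ {x₂ y₂} → x₀ ≢ x₂ → y₀ ≢ y₂ → R.commonNeighbours (x₀ , y₀) (x₂ , y₂) ≡ 2
    common-in-general-position {x₂} {y₂} x₀≢x₂ y₀≢y₂ = begin
      R.commonNeighbours (x₀ , y₀) (x₂ , y₂)
        ≡⟨ ∑-cong allV corners ⟩
      ∑[ v ∈ allV ] (𝟙 (v ≟V (x₀ , y₂)) ℕ.+ 𝟙 (v ≟V (x₂ , y₀)))
        ≡⟨ ∑-+ allV _ _ ⟩
      ∑[ v ∈ allV ] 𝟙 (v ≟V (x₀ , y₂)) ℕ.+ ∑[ v ∈ allV ] 𝟙 (v ≟V (x₂ , y₀))
        ≡⟨ cong₂ ℕ._+_ (allV-exact (x₀ , y₂)) (allV-exact (x₂ , y₀)) ⟩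
      2 ∎
      where
      corners : ∀ v → 𝟙 (R.commonNeighbour? (x₀ , y₀) (x₂ , y₂) v) ≡ 𝟙 (v ≟V (x₀ , y₂)) ℕ.+ 𝟙 (v ≟V (x₂ , y₀))
      corners v = trans (𝟙-cong _ (v ≟V (x₀ , y₂) ⊎-dec v ≟V (x₂ , y₀)) (⇔-trans rook-common⇔ (mk⇔ to from)))
                        (𝟙-⊎ (v ≟V (x₀ , y₂)) (v ≟V (x₂ , y₀)) (λ e₁ e₂ → x₀≢x₂ (cong proj₁ (trans (sym e₁) e₂))))
        where
        to : ((x₀ , y₀) ≢ v × Aligned (x₀ , y₀) v) × (v ≢ (x₂ , y₂) × Aligned v (x₂ , y₂)) → v ≡ (x₀ , y₂) ⊎ v ≡ (x₂ , y₀)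
        to ((_ , l₀) , (_ , l₂)) = aligned-with-both x₀≢x₂ y₀≢y₂ l₀ l₂
        from : v ≡ (x₀ , y₂) ⊎ v ≡ (x₂ , y₀) → ((x₀ , y₀) ≢ v × Aligned (x₀ , y₀) v) × (v ≢ (x₂ , y₂) × Aligned v (x₂ , y₂))
        from (inj₁ refl) = ((y₀≢y₂ ∘ cong proj₂) , inj₁ refl) , ((x₀≢x₂ ∘ cong proj₁) , inj₂ refl)
        from (inj₂ refl) = ((x₀≢x₂ ∘ cong proj₁) , inj₂ refl) , ((y₀≢y₂ ∘ cong proj₂) , inj₁ refl)

  pairsThrough : V → V → ℕ
  pairsThrough v₀ v₂ = 𝟙 (v₀ ≢? v₂) ℕ.* (R.commonNeighbours v₀ v₂ ℕ.* (R.commonNeighbours v₀ v₂ ∸ 1))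

  pairsThrough-value : ∀ {v₀ v₂ n} → v₀ ≢ v₂ → R.commonNeighbours v₀ v₂ ≡ n → pairsThrough v₀ v₂ ≡ n ℕ.* (n ∸ 1)
  pairsThrough-value {v₀} {v₂} {n} v₀≢v₂ refl = trans (cong (ℕ._* (n ℕ.* (n ∸ 1))) (𝟙-yes (v₀ ≢? v₂) v₀≢v₂)) (ℕ.+-identityʳ _)

  aligned-pairs : ℕ
  aligned-pairs = (size ∸ 2) ℕ.* (size ∸ 2 ∸ 1)

  ∑pairsThrough : ∀ v₀ → ∑[ v₂ ∈ allV ] pairsThrough v₀ v₂ ≡
    (size ∸ 1) ℕ.* aligned-pairs ℕ.+ (size ∸ 1) ℕ.* (aligned-pairs ℕ.+ (size ∸ 1) ℕ.* 2)
  ∑pairsThrough (x₀ , y₀) = begin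
    ∑[ v₂ ∈ allV ] pairsThrough v₀ v₂
      ≡⟨ ∑V-split _ ⟩
    ∑[ x₂ ∈ elems ] ∑[ y₂ ∈ elems ] pairsThrough v₀ (x₂ , y₂)
      ≡⟨ ∑F.∑-split x₀ _ ⟩
    ∑[ y₂ ∈ elems ] pairsThrough v₀ (x₀ , y₂) ℕ.+ ∑[ x₂ ∈ elems ] (𝟙 (¬? (x₂ ≟ x₀)) ℕ.* ∑[ y₂ ∈ elems ] pairsThrough v₀ (x₂ , y₂))
      ≡⟨ cong₂ ℕ._+_ same-column (∑-≢-const x₀ _ other-column) ⟩
    (size ∸ 1) ℕ.* aligned-pairs ℕ.+ (size ∸ 1) ℕ.* (aligned-pairs ℕ.+ (size ∸ 1) ℕ.* 2)
      ∎
    where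
    v₀ : V
    v₀ = x₀ , y₀
    same-column : ∑[ y₂ ∈ elems ] pairsThrough v₀ (x₀ , y₂) ≡ (size ∸ 1) ℕ.* aligned-pairs
    same-column = begin
      ∑[ y₂ ∈ elems ] pairsThrough v₀ (x₀ , y₂)
        ≡⟨ ∑F.∑-split y₀ _ ⟩
      pairsThrough v₀ v₀ ℕ.+ ∑[ y₂ ∈ elems ] (𝟙 (¬? (y₂ ≟ y₀)) ℕ.* pairsThrough v₀ (x₀ , y₂))
        ≡⟨ cong₂ ℕ._+_ (cong (ℕ._* (R.commonNeighbours v₀ v₀ ℕ.* (R.commonNeighbours v₀ v₀ ∸ 1))) (𝟙-no (v₀ ≢? v₀) (λ v₀≢v₀ → v₀≢v₀ refl)))
                       (∑-≢-const y₀ _ (λ y₂ y₂≢y₀ → pairsThrough-value (y₂≢y₀ ∘ sym ∘ cong proj₂) (common-in-column (y₂≢y₀ ∘ sym)))) ⟩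
      (size ∸ 1) ℕ.* aligned-pairs
        ∎
    other-column : ∀ x₂ → x₂ ≢ x₀ → ∑[ y₂ ∈ elems ] pairsThrough v₀ (x₂ , y₂) ≡ aligned-pairs ℕ.+ (size ∸ 1) ℕ.* 2
    other-column x₂ x₂≢x₀ = begin
      ∑[ y₂ ∈ elems ] pairsThrough v₀ (x₂ , y₂)
        ≡⟨ ∑F.∑-split y₀ _ ⟩
      pairsThrough v₀ (x₂ , y₀) ℕ.+ ∑[ y₂ ∈ elems ] (𝟙 (¬? (y₂ ≟ y₀)) ℕ.* pairsThrough v₀ (x₂ , y₂))
        ≡⟨ cong₂ ℕ._+_ (pairsThrough-value v₀≢ (common-in-row (x₂≢x₀ ∘ sym)))
                       (∑-≢-const y₀ _ (λ y₂ y₂≢y₀ → pairsThrough-value v₀≢ (common-in-general-position (x₂≢x₀ ∘ sym) (y₂≢y₀ ∘ sym)))) ⟩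
      aligned-pairs ℕ.+ (size ∸ 1) ℕ.* 2
        ∎
      where
      v₀≢ : ∀ {y₂} → v₀ ≢ (x₂ , y₂)
      v₀≢ = x₂≢x₀ ∘ sym ∘ cong proj₁

  8*numCycles4-zero-level : 8 ℕ.* numCycles4 q 0# ≡
    size ℕ.* (size ℕ.* ((size ∸ 1) ℕ.* aligned-pairs ℕ.+ (size ∸ 1) ℕ.* (aligned-pairs ℕ.+ (size ∸ 1) ℕ.* 2)))
  8*numCycles4-zero-level = begin
    8 ℕ.* numCycles4 q 0#                             ≡⟨ G.orderedCycles≡8*numCycles4 ⟨
    G.orderedCycles                                   ≡⟨ orderedCycles-rook ⟩
    R.orderedCycles                                   ≡⟨ R.orderedCycles≡∑N[N-1] ⟩
    ∑[ v₀ ∈ allV ] ∑[ v₂ ∈ allV ] pairsThrough v₀ v₂  ≡⟨ trans (∑-cong allV ∑pairsThrough) (∑V-const _) ⟩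
    size ℕ.* (size ℕ.* ((size ∸ 1) ℕ.* aligned-pairs ℕ.+ (size ∸ 1) ℕ.* (aligned-pairs ℕ.+ (size ∸ 1) ℕ.* 2)))
                                                      ∎

module Arithmetic where

  open import Data.Nat
  open import Data.Nat.Properties
  open import Data.Nat.Combinatorics using (_C_; nC1≡n; nCk+nC[k+1]≡[n+1]C[k+1])
  open import Data.Nat.DivMod using (m*n/n≡m)
  open import Data.Nat.Solver using (module +-*-Solver)
  open import Relation.Binary.PropositionalEquality
  open +-*-Solver using (solve; _:+_; _:*_; _:^_; con; _:=_)
  open ≡-Reasoning

  exact-division : ∀ k .{{_ : NonZero k}} {c x} → k * c ≡ x → c ≡ x / k
  exact-division k {c} refl = sym (trans (cong (_/ k) (*-comm k c)) (m*n/n≡m c k))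

  2*mC2≡m[m∸1] : ∀ m → 2 * (m C 2) ≡ m * (m ∸ 1)
  2*mC2≡m[m∸1] zero = refl
  2*mC2≡m[m∸1] (suc m) = begin
    2 * (suc m C 2)              ≡⟨ cong (2 *_) (nCk+nC[k+1]≡[n+1]C[k+1] m 1) ⟨
    2 * (m C 1 + m C 2)          ≡⟨ cong (λ k → 2 * (k + m C 2)) (nC1≡n m) ⟩
    2 * (m + m C 2)              ≡⟨ *-distribˡ-+ 2 m (m C 2) ⟩
    2 * m + 2 * (m C 2)          ≡⟨ cong (2 * m +_) (2*mC2≡m[m∸1] m) ⟩
    2 * m + m * (m ∸ 1)          ≡⟨ step m ⟩
    suc m * m                    ∎
    where
    step : ∀ m → 2 * m + m * (m ∸ 1) ≡ suc m * m
    step zero = refl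
    step (suc k) = solve 1 (λ k → con 2 :* (con 1 :+ k) :+ (con 1 :+ k) :* k := (con 2 :+ k) :* (con 1 :+ k)) refl k

  6*mC3≡m[m∸1][m∸2] : ∀ m → 6 * (m C 3) ≡ m * ((m ∸ 1) * (m ∸ 2))
  6*mC3≡m[m∸1][m∸2] zero = refl
  6*mC3≡m[m∸1][m∸2] (suc m) = begin
    6 * (suc m C 3)                                    ≡⟨ cong (6 *_) (nCk+nC[k+1]≡[n+1]C[k+1] m 2) ⟨
    6 * (m C 2 + m C 3)                                ≡⟨ solve 2 (λ a b → con 6 :* (a :+ b) := con 3 :* (con 2 :* a) :+ con 6 :* b) refl (m C 2) (m C 3) ⟩
    3 * (2 * (m C 2)) + 6 * (m C 3)                    ≡⟨ cong₂ (λ x y → 3 * x + y) (2*mC2≡m[m∸1] m) (6*mC3≡m[m∸1][m∸2] m) ⟩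
    3 * (m * (m ∸ 1)) + m * ((m ∸ 1) * (m ∸ 2))        ≡⟨ step m ⟩
    suc m * (m * (m ∸ 1))                              ∎
    where
    step : ∀ m → 3 * (m * (m ∸ 1)) + m * ((m ∸ 1) * (m ∸ 2)) ≡ suc m * (m * (m ∸ 1))
    step zero = refl
    step (suc zero) = refl
    step (suc (suc k)) = solve 1 (λ k → con 3 :* ((con 2 :+ k) :* (con 1 :+ k)) :+ (con 2 :+ k) :* ((con 1 :+ k) :* k)
                                       := (con 3 :+ k) :* ((con 2 :+ k) :* (con 1 :+ k))) refl k

  count-isotropic-char≢2 : ∀ {f n c} → 1 + n ≡ f → 8 * c ≡ f * (f * (n * (n ∸ 2))) → c ≡ (f ^ 2 * (f ∸ 1) * (f ∸ 3)) / 8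
  count-isotropic-char≢2 {n = n} refl 8c≡ = exact-division 8 (trans 8c≡
    (solve 2 (λ n m → (con 1 :+ n) :* ((con 1 :+ n) :* (n :* m)) := (con 1 :+ n) :^ 2 :* n :* m) refl n (n ∸ 2)))

  count-isotropic-char2 : ∀ {f n c} → 1 + n ≡ f → 8 * c ≡ f * (f * (n * (n ∸ 1))) → c ≡ (f ^ 2 * (f ∸ 1) * (f ∸ 2)) / 8
  count-isotropic-char2 {n = n} refl 8c≡ = exact-division 8 (trans 8c≡
    (solve 2 (λ n m → (con 1 :+ n) :* ((con 1 :+ n) :* (n :* m)) := (con 1 :+ n) :^ 2 :* n :* m) refl n (n ∸ 1)))

  count-anisotropic-char≢2 : ∀ {f n c} → n ≡ f + 1 → 8 * c ≡ f * (f * (n * (n ∸ 2))) → c ≡ (f ^ 2 * (f + 1) * (f ∸ 1)) / 8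
  count-anisotropic-char≢2 {f} refl 8c≡ = exact-division 8 (trans 8c≡ (begin
    f * (f * ((f + 1) * ((f + 1) ∸ 2)))     ≡⟨ cong (λ k → f * (f * ((f + 1) * (k ∸ 2)))) (+-comm f 1) ⟩
    f * (f * ((f + 1) * (f ∸ 1)))           ≡⟨ solve 2 (λ f m → f :* (f :* ((f :+ con 1) :* m)) := f :^ 2 :* (f :+ con 1) :* m) refl f (f ∸ 1) ⟩
    f ^ 2 * (f + 1) * (f ∸ 1)               ∎))

  count-anisotropic-char2 : ∀ {f n c} → n ≡ f + 1 → 8 * c ≡ f * (f * (n * (n ∸ 1))) → c ≡ (f ^ 3 * (f + 1)) / 8
  count-anisotropic-char2 {f} refl 8c≡ = exact-division 8 (trans 8c≡ (begin
    f * (f * ((f + 1) * ((f + 1) ∸ 1)))     ≡⟨ cong (λ k → f * (f * ((f + 1) * (k ∸ 1)))) (+-comm f 1) ⟩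
    f * (f * ((f + 1) * f))                 ≡⟨ solve 1 (λ f → f :* (f :* ((f :+ con 1) :* f)) := f :^ 3 :* (f :+ con 1)) refl f ⟩
    f ^ 3 * (f + 1)                         ∎))

  -- Each vertex v₀ has 2 (f - 1) neighbours v₂ sharing N = f - 2 common neighbours with it
  -- and (f - 1)² other vertices v₂ sharing N = 2; each pair counts N (N - 1).
  count-zero-level : ∀ {f c} →
    8 * c ≡ f * (f * ((f ∸ 1) * ((f ∸ 2) * (f ∸ 2 ∸ 1)) + (f ∸ 1) * ((f ∸ 2) * (f ∸ 2 ∸ 1) + (f ∸ 1) * 2))) →
    c ≡ (f ^ 2 * (6 * ((f ∸ 1) C 3) + (f ∸ 1) ^ 2)) / 4
  count-zero-level {f} {c} 8c≡ = exact-division 4 (*-cancelˡ-≡ (4 * c) (f ^ 2 * (6 * (m C 3) + m ^ 2)) 2 (begin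
    2 * (4 * c)                                          ≡⟨ *-assoc 2 4 c ⟨
    8 * c                                                ≡⟨ 8c≡ ⟩
    f * (f * (m * ((f ∸ 2) * (f ∸ 2 ∸ 1)) + m * ((f ∸ 2) * (f ∸ 2 ∸ 1) + m * 2)))
                                                         ≡⟨ cong (λ r → f * (f * (m * r + m * (r + m * 2)))) r≡ ⟩
    f * (f * (m * ((m ∸ 1) * (m ∸ 2)) + m * ((m ∸ 1) * (m ∸ 2) + m * 2)))
                                                         ≡⟨ solve 3 (λ f m r → f :* (f :* (m :* r :+ m :* (r :+ m :* con 2)))
                                                                             := con 2 :* (f :^ 2 :* (m :* r :+ m :^ 2))) refl f m ((m ∸ 1) * (m ∸ 2)) ⟩
    2 * (f ^ 2 * (m * ((m ∸ 1) * (m ∸ 2)) + m ^ 2))      ≡⟨ cong (λ t → 2 * (f ^ 2 * (t + m ^ 2))) (6*mC3≡m[m∸1][m∸2] m) ⟨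
    2 * (f ^ 2 * (6 * (m C 3) + m ^ 2))                  ∎))
    where
    m : ℕ
    m = f ∸ 1
    r≡ : (f ∸ 2) * (f ∸ 2 ∸ 1) ≡ (m ∸ 1) * (m ∸ 2)
    r≡ = cong₂ _*_ (sym (∸-+-assoc f 1 1)) (trans (∸-+-assoc f 2 1) (sym (∸-+-assoc f 1 2)))

open import Defs
open import Data.Nat using (_*_; _+_; _∸_; _^_; _/_)
open import Data.Nat.Combinatorics using (_C_)
open import Data.Product using (_×_; _,_; Σ; proj₂)
open import Data.Sum using (inj₁; inj₂)
open import Data.Empty using (⊥-elim)
open import Relation.Nullary using (¬_)
open import Relation.Binary.PropositionalEquality using (_≡_; _≢_; refl)
open Arithmetic

InD~⇒point : ∀ {F q a} → a ≢ 0# F → InD~ F q a → Σ (V F) λ s → q s ≡ a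
InD~⇒point _ (inj₁ (_ , point)) = point
InD~⇒point a≢0 (inj₂ (_ , a≡0)) = ⊥-elim (a≢0 a≡0)

InD~⇒isotropic : ∀ {F q a} → a ≡ 0# F → InD~ F q a → Isotropic F q
InD~⇒isotropic a≡0 (inj₁ (a≢0 , _)) = ⊥-elim (a≢0 a≡0)
InD~⇒isotropic _ (inj₂ (isotropic , _)) = isotropic

numCycles4-isotropic : ∀ F q → IsQuadraticForm F q → NonDegenerate F q → ∀ {a} → a ≢ 0# F → Isotropic F q →
    (¬ Char2 F → numCycles4 F q a ≡ (size F ^ 2 * (size F ∸ 1) * (size F ∸ 3)) / 8)
  × (Char2 F → numCycles4 F q a ≡ (size F ^ 2 * (size F ∸ 1) * (size F ∸ 2)) / 8)
numCycles4-isotropic F q isQ nd {a} a≢0 (d₁ , d₁≢0 , qd₁≡0) =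
    (λ ¬char2 → count-isotropic-char≢2 points (L.8*numCycles4-char≢2 ¬char2))
  , (λ char2 → count-isotropic-char2 points (L.8*numCycles4-char2 char2))
  where
  module L = NonzeroLevel F q isQ nd a a≢0
  points : 1 + L.pointsOnConic ≡ size F
  points = HyperbolicCoordinates.level-count F q isQ nd d₁ d₁≢0 qd₁≡0 a≢0

numCycles4-anisotropic : ∀ F q → IsQuadraticForm F q → NonDegenerate F q → ∀ {a s} → a ≢ 0# F → q s ≡ a → ¬ Isotropic F q →
    (¬ Char2 F → numCycles4 F q a ≡ (size F ^ 2 * (size F + 1) * (size F ∸ 1)) / 8)
  × (Char2 F → numCycles4 F q a ≡ (size F ^ 3 * (size F + 1)) / 8)
numCycles4-anisotropic F q isQ nd {a} a≢0 qs≡a ¬isotropic =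
    (λ ¬char2 → count-anisotropic-char≢2 points (L.8*numCycles4-char≢2 ¬char2))
  , (λ char2 → count-anisotropic-char2 points (L.8*numCycles4-char2 char2))
  where
  module L = NonzeroLevel F q isQ nd a a≢0
  points : L.pointsOnConic ≡ size F + 1
  points = AnisotropicLevel.level-count F q isQ nd (λ d d≢0 qd≡0 → ¬isotropic (d , d≢0 , qd≡0)) a≢0 qs≡a

numCycles4-zero-level : ∀ F q → IsQuadraticForm F q → NonDegenerate F q → ∀ {a} → a ≡ 0# F → Isotropic F q →
  numCycles4 F q a ≡ (size F ^ 2 * (6 * ((size F ∸ 1) C 3) + (size F ∸ 1) ^ 2)) / 4
numCycles4-zero-level F q isQ nd refl (d₁ , d₁≢0 , qd₁≡0) =
  count-zero-level {size F} (ZeroLevel.8*numCycles4-zero-level F q isQ nd d₁ d₁≢0 qd₁≡0)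

theorem4p7 : (F : FiniteField) →
    (q : V F → Carrier F) → IsQuadraticForm F q → NonDegenerate F q →
    (a : Carrier F) → InD~ F q a →
      -- (i) a ≠ 0, q isotropic
      (a ≢ 0# F → Isotropic F q →
          (¬ Char2 F → numCycles4 F q a ≡ (size F ^ 2 * (size F ∸ 1) * (size F ∸ 3)) / 8)
        × (Char2 F → numCycles4 F q a ≡ (size F ^ 2 * (size F ∸ 1) * (size F ∸ 2)) / 8))
      -- (ii) a ≠ 0, q anisotropic
    × (a ≢ 0# F → ¬ Isotropic F q →
          (¬ Char2 F → numCycles4 F q a ≡ (size F ^ 2 * (size F + 1) * (size F ∸ 1)) / 8)
        × (Char2 F → numCycles4 F q a ≡ (size F ^ 3 * (size F + 1)) / 8))
      -- (iii) a = 0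
    × (a ≡ 0# F →
          numCycles4 F q a ≡ (size F ^ 2 * (6 * ((size F ∸ 1) C 3) + (size F ∸ 1) ^ 2)) / 4)
theorem4p7 F q isQ nd a a∈D̃ =
    (λ a≢0 → numCycles4-isotropic F q isQ nd a≢0)
  , (λ a≢0 → numCycles4-anisotropic F q isQ nd a≢0 (proj₂ (InD~⇒point {F} {q} a≢0 a∈D̃)))
  , (λ a≡0 → numCycles4-zero-level F q isQ nd a≡0 (InD~⇒isotropic {F} {q} a≡0 a∈D̃))
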